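{- Let $n\ge 1$, $h\ge 1$ and $0\le \bar w\le n$ be integers, let $H$ be a multiset of $h$ binary strings, each of length $n$ and weight $\bar w$, and let $M=M(H)$. Let $f$ be a cumulative weight function that is a solution to $M$. Then $|\mathcal{H}|=1$ (i.e., up to reversal there is exactly one multiset of binary strings compatible with $M$) if and only if $f$ satisfies both of the following conditions: (i) for any $m_1,m_2\in[2h]$ with $m_1^*=m_2$, there exist at most two maximal intervals between $f_{m_1}$ and $f_{m_2}$; (ii) for any $m_1,m_2\in[2h]$ with $m_1^*\neq m_2$, there exists at most one maximal interval between $f_{m_1}$ and $f_{m_2}$.
   Context: Notation: $[n]=\{1,\dots,n\}$; for integers $n_1,n_2$, $[n_1,n_2]=\{n_1,n_1+1,\dots,n_2\}$ if $n_1\le n_2$ and $\emptyset$ otherwise. For a binary string $t=t_1\cdots t_n$, $\mathrm{wt}(t)$ is its number of ones, $\overleftarrow{t}=t_n\cdots t_1$ is its reversal, and $t[l]$, $t[-l]$ denote its length-$l$ prefix and length-$l$ suffix. The prefix-suffix compositions $M(t)$ of $t$ is the multiset union of $\{(j-\mathrm{wt}(t[j]),\mathrm{wt}(t[j])) : j\in[n]\}$ and $\{(j-\mathrm{wt}(t[-j]),\mathrm{wt}(t[-j])) : j\in[n]\}$; for a multiset $U$ of binary strings, $M(U)$ is the multiset union of $M(t)$ over $t\in U$ (with multiplicity). A multiset $U$ is compatible with $M$ if $M(U)=M$. Two multisets $U,V$ of strings satisfy $V\sim U$ if $|V|=|U|$ and for every string $t\in U$ the sum of the multiplicities of $t$ and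 $\overleftarrow{t}$ in $U$ equals the sum of the multiplicities of $t$ and $\overleftarrow{t}$ in $V$; $[U]$ denotes the equivalence class of $U$. Define $\mathcal{H}=\{[U] : U \text{ a multiset of binary strings with } M(U)=M\}$. Let $T=\{0,1,\dots,n\}\times[2h]$. A cumulative weight function (CWF) is a map $f:T\to\{0,1,\dots,n\}$ such that (a) $f(0,m)=0$ for all $m\in[2h]$; (b) $f(l,m)-f(l-1,m)\in\{0,1\}$ for all $(l,m)\in[n]\times[2h]$; (c) for each $j\in[h]$ there is $w_j\in\{0,\dots,n\}$ with $f(l,2j-1)+f(n-l,2j)=w_j$ for all $l\in\{0,\dots,n\}$. Write $f_m(l)=f(l,m)$. For $m\in[2h]$, $m^*=m-1$ if $m$ is even and $m^*=m+1$ if $m$ is odd. A CWF $f$ is a solution to $M$ if $M$ equals, as multisets, $\{(l-f_m(l),f_m(l)) : m\in[2h],\ l\in[n]\}$. For $m_1,m_2\in[2h]$, the discrepancy is $D(m_1,m_2)=\{l\in[n]: f_{m_1}(l)\ne f_{m_2}(l)\}$; a nonempty set $[k_1,k_2]\subset[n]$ is a maximal interval between $f_{m_1}$ and $f_{m_2}$ if $[k_1,k_2]\subset D(m_1,m_2)$, $k_1-1\notin D(m_1,m_2)$ and $k_2+1\notin D(m_1,m_2)$. -}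

module Defs where

open import Data.Nat using (ℕ; zero; suc; _+_; _*_; _∸_; _≤_)
open import Data.Bool using (Bool; true; false; if_then_else_)
open import Data.Bool.Properties using () renaming (_≟_ to _≟B_)
open import Data.List using (List; []; _∷_; map; concatMap; _++_; length; take; drop)
open import Data.List.Relation.Binary.Permutation.Propositional using (_↭_)
open import Data.List.Membership.Propositional using (_∈_)
open import Data.Vec using (Vec; toList; reverse)
open import Data.Vec.Properties using (≡-dec)
open import Data.Product using (_×_; _,_; ∃-syntax)
open import Data.Sum using (_⊎_)
open import Relation.Nullary using (¬_; yes; no)
open import Relation.Binary.PropositionalEquality using (_≡_; _≢_)

Str : ℕ → Set
Str n = Vec Bool n

wt : List Bool → ℕ
wt []          = 0
wt (true ∷ b)  = suc (wt b)
wt (false ∷ b) = wt b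

comp : List Bool → ℕ × ℕ
comp s = (length s ∸ wt s , wt s)

-- the list [a, a+1, ..., b]  (empty if a > b)
range : ℕ → ℕ → List ℕ
range a b = go a (suc b ∸ a)
  where
  go : ℕ → ℕ → List ℕ
  go x zero    = []
  go x (suc k) = x ∷ go (suc x) k

-- prefix-suffix compositions M(t) as a list (multiset up to ↭)
Mstr : {n : ℕ} → Str n → List (ℕ × ℕ)
Mstr {n} t =
  map (λ j → comp (take j (toList t))) (range 1 n)
  ++ map (λ j → comp (drop (n ∸ j) (toList t))) (range 1 n)

Mset : {n : ℕ} → List (Str n) → List (ℕ × ℕ)
Mset U = concatMap Mstr U

mult : {n : ℕ} → Str n → List (Str n) → ℕ
mult t []      = 0
mult t (u ∷ U) with ≡-dec _≟B_ t u
... | yes _ = suc (mult t U)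
... | no  _ = mult t U

_∼_ : {n : ℕ} → List (Str n) → List (Str n) → Set
V ∼ U = (length V ≡ length U)
      × (∀ t → t ∈ U → mult t U + mult (reverse t) U ≡ mult t V + mult (reverse t) V)

-- |𝓗| = 1 : there is exactly one equivalence class of multisets compatible with M
UniqueClass : (n : ℕ) → List (ℕ × ℕ) → Set
UniqueClass n M =
  (∃[ U₀ ] (Mset {n} U₀ ↭ M))
  × (∀ (U V : List (Str n)) → Mset U ↭ M → Mset V ↭ M → V ∼ U)

-- A function f l m is considered on T = {0..n} × [2h] (values elsewhere are irrelevant).
CWF : (n h : ℕ) → (ℕ → ℕ → ℕ) → Set
CWF n h f =
  (∀ l m → l ≤ n → 1 ≤ m → m ≤ 2 * h → f l m ≤ n)
  × (∀ m → 1 ≤ m → m ≤ 2 * h → f 0 m ≡ 0)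
  × (∀ l m → 1 ≤ l → l ≤ n → 1 ≤ m → m ≤ 2 * h →
       (f l m ≡ f (l ∸ 1) m) ⊎ (f l m ≡ suc (f (l ∸ 1) m)))
  × (∀ j → 1 ≤ j → j ≤ h → ∃[ w ] (w ≤ n ×
       (∀ l → l ≤ n → f l (2 * j ∸ 1) + f (n ∸ l) (2 * j) ≡ w)))

cwfMultiset : (n h : ℕ) → (ℕ → ℕ → ℕ) → List (ℕ × ℕ)
cwfMultiset n h f =
  concatMap (λ m → map (λ l → (l ∸ f l m , f l m)) (range 1 n)) (range 1 (2 * h))

IsSolution : (n h : ℕ) → (ℕ → ℕ → ℕ) → List (ℕ × ℕ) → Set
IsSolution n h f M = M ↭ cwfMultiset n h f

isEven : ℕ → Bool
isEven zero          = true
isEven (suc zero)    = false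
isEven (suc (suc m)) = isEven m

star : ℕ → ℕ
star m = if isEven m then m ∸ 1 else suc m

InD : (n : ℕ) → (ℕ → ℕ → ℕ) → ℕ → ℕ → ℕ → Set
InD n f m₁ m₂ l = 1 ≤ l × l ≤ n × f l m₁ ≢ f l m₂

MaxInterval : (n : ℕ) → (ℕ → ℕ → ℕ) → ℕ → ℕ → ℕ × ℕ → Set
MaxInterval n f m₁ m₂ (k₁ , k₂) =
  1 ≤ k₁ × k₁ ≤ k₂ × k₂ ≤ n
  × (∀ l → k₁ ≤ l → l ≤ k₂ → InD n f m₁ m₂ l)
  × ¬ InD n f m₁ m₂ (k₁ ∸ 1)
  × ¬ InD n f m₁ m₂ (suc k₂)

AtMostOneMaxInterval : (n : ℕ) → (ℕ → ℕ → ℕ) → ℕ → ℕ → Set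
AtMostOneMaxInterval n f m₁ m₂ =
  ∀ I J → MaxInterval n f m₁ m₂ I → MaxInterval n f m₁ m₂ J → I ≡ J

AtMostTwoMaxIntervals : (n : ℕ) → (ℕ → ℕ → ℕ) → ℕ → ℕ → Set
AtMostTwoMaxIntervals n f m₁ m₂ =
  ∀ I J K → MaxInterval n f m₁ m₂ I → MaxInterval n f m₁ m₂ J → MaxInterval n f m₁ m₂ K
    → (I ≡ J) ⊎ (I ≡ K) ⊎ (J ≡ K)

ConditionI : (n h : ℕ) → (ℕ → ℕ → ℕ) → Set
ConditionI n h f = ∀ m₁ m₂ → 1 ≤ m₁ → m₁ ≤ 2 * h → 1 ≤ m₂ → m₂ ≤ 2 * h →
  star m₁ ≡ m₂ → AtMostTwoMaxIntervals n f m₁ m₂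

ConditionII : (n h : ℕ) → (ℕ → ℕ → ℕ) → Set
ConditionII n h f = ∀ m₁ m₂ → 1 ≤ m₁ → m₁ ≤ 2 * h → 1 ≤ m₂ → m₂ ≤ 2 * h →
  star m₁ ≢ m₂ → AtMostOneMaxInterval n f m₁ m₂

module Submission where

-- Paths 2j-1 and 2j are the prefix-weight paths of the j-th string and of its reversal; these partners
-- mirror each other (the height of one at level l fixes the other at level n - l).  M records how many
-- paths pass through each height at each level, and the class of t in a compatible multiset has the size
-- of the set of paths that coincide with the prefix-weight path of t.
-- Under (i) and (ii) these agreement counts are forced level by level: non-partners never meet again
-- after separating, and partners do so only in the second half, where the mirror symmetry dictates their
-- future; hence all compatible multisets lie in one class.  Conversely, if (i) or (ii) fails, exchanging
-- the labels of the offending paths on a set of levels closed under l ↦ n - l keeps every level count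
-- but destroys the history of one path, which yields a compatible multiset in another class.

open import Defs
open import Data.Nat using (ℕ; _≤_)
open import Data.Bool using (Bool)
open import Data.List using (List; length)
open import Data.List.Relation.Unary.All using (All)
open import Data.Product using (_×_)
open import Data.Vec using (Vec; toList)
open import Function.Bundles using (_⇔_)
open import Relation.Binary.PropositionalEquality using (_≡_)
open import Data.Nat using (_<_; _*_)
open import Function.Bundles using (mk⇔)

module Counting where

  open import Data.Nat
  open import Data.Nat.Properties
  open import Data.Bool using (Bool; true; false; _∧_; _∨_; not; if_then_else_)
  open import Data.Bool.Properties using (∧-conicalˡ)
  open import Data.List using (List; []; _∷_)
  open import Data.List.Membership.Propositional using (_∈_; _∉_)
  open import Data.List.Relation.Unary.All using (All; []; _∷_)
  open import Data.List.Relation.Unary.Any using (here; there)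
  open import Data.List.Relation.Unary.Unique.Propositional using (Unique; []; _∷_)
  open import Data.Product using (_×_; _,_; Σ)
  open import Data.Sum using (_⊎_; inj₁; inj₂)
  open import Data.Empty using (⊥; ⊥-elim)
  open import Relation.Nullary using (¬_; yes; no)
  open import Relation.Binary.PropositionalEquality
  open import Algebra.Properties.CommutativeSemigroup +-commutativeSemigroup using (interchange; xy∙z≈zy∙x; xy∙z≈xz∙y; xy∙z≈x∙zy)

  bit : Bool → ℕ
  bit true  = 1
  bit false = 0

  sumTo : (ℕ → ℕ) → ℕ → ℕ
  sumTo g zero    = 0
  sumTo g (suc K) = g 1 + sumTo (λ m → g (suc m)) K

  count : (ℕ → Bool) → ℕ → ℕ
  count P K = sumTo (λ m → bit (P m)) K

  InRange : ℕ → ℕ → Set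
  InRange K m = 1 ≤ m × m ≤ K

  1-inRange : ∀ {K} → InRange (suc K) 1
  1-inRange = s≤s z≤n , s≤s z≤n

  suc-inRange : ∀ {K m} → InRange K m → InRange (suc K) (suc m)
  suc-inRange (_ , m≤K) = s≤s z≤n , s≤s m≤K

  inRange-pred : ∀ {K m} → InRange (suc K) (suc (suc m)) → InRange K (suc m)
  inRange-pred (_ , s≤s m<K) = s≤s z≤n , m<K

  ¬inRange0 : ∀ {m} → ¬ InRange 0 m
  ¬inRange0 (1≤m , m≤0) = <-irrefl refl (≤-trans 1≤m m≤0)

  sumTo-cong : ∀ K (g g′ : ℕ → ℕ) → (∀ m → InRange K m → g m ≡ g′ m) → sumTo g K ≡ sumTo g′ K
  sumTo-cong zero    g g′ eq = refl
  sumTo-cong (suc K) g g′ eq = cong₂ _+_ (eq 1 1-inRange) (sumTo-cong K _ _ (λ m r → eq (suc m) (suc-inRange r)))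

  count-cong : ∀ K (P Q : ℕ → Bool) → (∀ m → InRange K m → P m ≡ Q m) → count P K ≡ count Q K
  count-cong K P Q eq = sumTo-cong K _ _ (λ m r → cong bit (eq m r))

  ∧-intro : ∀ {a b} → a ≡ true → b ≡ true → (a ∧ b) ≡ true
  ∧-intro refl refl = refl

  ∨-elim : ∀ {a b} → (a ∨ b) ≡ true → (a ≡ true) ⊎ (b ≡ true)
  ∨-elim {true}  _ = inj₁ refl
  ∨-elim {false} e = inj₂ e

  not-true : ∀ {a} → not a ≡ true → a ≡ false
  not-true {false} _ = refl

  true≢false : ∀ {a} → a ≡ true → a ≢ false
  true≢false refl ()

  ¬true⇒false : ∀ {a} → ¬ (a ≡ true) → a ≡ false
  ¬true⇒false {false} _ = refl
  ¬true⇒false {true}  h = ⊥-elim (h refl)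

  bool-ext : ∀ {a b} → (a ≡ true → b ≡ true) → (b ≡ true → a ≡ true) → a ≡ b
  bool-ext {false} {false} _ _ = refl
  bool-ext {false} {true}  _ q = q refl
  bool-ext {true}  {false} p _ = sym (p refl)
  bool-ext {true}  {true}  _ _ = refl

  ≡ᵇ-true⇒≡ : ∀ {x y} → (x ≡ᵇ y) ≡ true → x ≡ y
  ≡ᵇ-true⇒≡ {x} {y} e = ≡ᵇ⇒≡ x y (subst (λ b → Data.Bool.T b) (sym e) _)

  ≡⇒≡ᵇ-true : ∀ {x y} → x ≡ y → (x ≡ᵇ y) ≡ true
  ≡⇒≡ᵇ-true {zero}  refl = refl
  ≡⇒≡ᵇ-true {suc x} refl = ≡⇒≡ᵇ-true {x} refl

  ≢⇒≡ᵇ-false : ∀ {x y} → x ≢ y → (x ≡ᵇ y) ≡ false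
  ≢⇒≡ᵇ-false ne = ¬true⇒false (λ e → ne (≡ᵇ-true⇒≡ e))

  ≡ᵇ-false⇒≢ : ∀ {x y} → (x ≡ᵇ y) ≡ false → x ≢ y
  ≡ᵇ-false⇒≢ e x≡y = true≢false (≡⇒≡ᵇ-true x≡y) e

  count≤ : ∀ K P → count P K ≤ K
  count≤ zero    P = z≤n
  count≤ (suc K) P = +-mono-≤ (bit≤1 (P 1)) (count≤ K (λ m → P (suc m)))
    where
    bit≤1 : ∀ b → bit b ≤ 1
    bit≤1 true  = ≤-refl
    bit≤1 false = z≤n

  count-mono : ∀ K (P Q : ℕ → Bool) → (∀ m → InRange K m → P m ≡ true → Q m ≡ true) → count P K ≤ count Q K
  count-mono zero    P Q sub = z≤n
  count-mono (suc K) P Q sub =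
    +-mono-≤ (bit-mono (P 1) (Q 1) (sub 1 1-inRange))
             (count-mono K (λ m → P (suc m)) (λ m → Q (suc m)) (λ m r → sub (suc m) (suc-inRange r)))
    where
    bit-mono : ∀ a b → (a ≡ true → b ≡ true) → bit a ≤ bit b
    bit-mono false b _ = z≤n
    bit-mono true  b h rewrite h refl = ≤-refl

  count-split : ∀ K (P Q : ℕ → Bool) → count P K ≡ count (λ m → P m ∧ Q m) K + count (λ m → P m ∧ not (Q m)) K
  count-split zero    P Q = refl
  count-split (suc K) P Q =
    trans (cong₂ _+_ (bit-split (P 1) (Q 1)) (count-split K (λ m → P (suc m)) (λ m → Q (suc m))))
          (interchange (bit (P 1 ∧ Q 1)) (bit (P 1 ∧ not (Q 1))) _ _)
    where
    bit-split : ∀ a b → bit a ≡ bit (a ∧ b) + bit (a ∧ not b)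
    bit-split false b     = refl
    bit-split true  false = refl
    bit-split true  true  = refl

  count-∨-disjoint : ∀ K (P Q : ℕ → Bool) → (∀ m → InRange K m → P m ≡ true → Q m ≡ true → ⊥)
    → count (λ m → P m ∨ Q m) K ≡ count P K + count Q K
  count-∨-disjoint zero    P Q disj = refl
  count-∨-disjoint (suc K) P Q disj =
    trans (cong₂ _+_ (bit-∨ (P 1) (Q 1) (disj 1 1-inRange))
                     (count-∨-disjoint K (λ m → P (suc m)) (λ m → Q (suc m)) (λ m r → disj (suc m) (suc-inRange r))))
          (interchange (bit (P 1)) (bit (Q 1)) _ _)
    where
    bit-∨ : ∀ a b → (a ≡ true → b ≡ true → ⊥) → bit (a ∨ b) ≡ bit a + bit b
    bit-∨ false b     _ = refl
    bit-∨ true  false _ = refl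
    bit-∨ true  true  h = ⊥-elim (h refl refl)

  count≡0⇒false : ∀ K (P : ℕ → Bool) → count P K ≡ 0 → ∀ m → InRange K m → P m ≡ false
  count≡0⇒false zero    P _ m r = ⊥-elim (¬inRange0 r)
  count≡0⇒false (suc K) P e m r with P 1 in P1
  count≡0⇒false (suc K) P e m r             | true  = ⊥-elim (1+n≢0 e)
  count≡0⇒false (suc K) P e (suc zero) r    | false = P1
  count≡0⇒false (suc K) P e (suc (suc m)) r | false = count≡0⇒false K (λ m → P (suc m)) e (suc m) (inRange-pred r)

  false⇒count≡0 : ∀ K (P : ℕ → Bool) → (∀ m → InRange K m → P m ≡ false) → count P K ≡ 0
  false⇒count≡0 zero    P h = refl
  false⇒count≡0 (suc K) P h rewrite h 1 1-inRange = false⇒count≡0 K (λ m → P (suc m)) (λ m r → h (suc m) (suc-inRange r))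

  count≢0⇒witness : ∀ K (P : ℕ → Bool) → count P K ≢ 0 → Σ ℕ (λ m → InRange K m × P m ≡ true)
  count≢0⇒witness zero    P ne = ⊥-elim (ne refl)
  count≢0⇒witness (suc K) P ne with P 1 in P1
  ... | true  = 1 , 1-inRange , P1
  ... | false with count≢0⇒witness K (λ m → P (suc m)) ne
  ...   | m , r , Pm = suc m , suc-inRange r , Pm

  true⇒count≡K : ∀ K (P : ℕ → Bool) → (∀ m → InRange K m → P m ≡ true) → count P K ≡ K
  true⇒count≡K zero    P h = refl
  true⇒count≡K (suc K) P h rewrite h 1 1-inRange = cong suc (true⇒count≡K K (λ m → P (suc m)) (λ m r → h (suc m) (suc-inRange r)))

  count≡K⇒true : ∀ K (P : ℕ → Bool) → count P K ≡ K → ∀ m → InRange K m → P m ≡ true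
  count≡K⇒true zero    P _ m r = ⊥-elim (¬inRange0 r)
  count≡K⇒true (suc K) P e m r with P 1 in P1
  count≡K⇒true (suc K) P e m r             | false = ⊥-elim (1+n≰n (subst (_≤ K) e (count≤ K (λ m → P (suc m)))))
  count≡K⇒true (suc K) P e (suc zero) r    | true  = P1
  count≡K⇒true (suc K) P e (suc (suc m)) r | true  = count≡K⇒true K (λ m → P (suc m)) (suc-injective e) (suc m) (inRange-pred r)

  witness⇒1≤count : ∀ K (P : ℕ → Bool) m → InRange K m → P m ≡ true → 1 ≤ count P K
  witness⇒1≤count K P m r Pm with count P K in c
  ... | zero  = ⊥-elim (true≢false Pm (count≡0⇒false K P c m r))
  ... | suc _ = s≤s z≤n

  two-witnesses⇒2≤count : ∀ K (P : ℕ → Bool) m₁ m₂ → m₁ ≢ m₂ → InRange K m₁ → InRange K m₂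
    → P m₁ ≡ true → P m₂ ≡ true → 2 ≤ count P K
  two-witnesses⇒2≤count zero P m₁ m₂ ne r₁ r₂ _ _ = ⊥-elim (¬inRange0 r₁)
  two-witnesses⇒2≤count (suc K) P (suc zero) (suc zero) ne _ _ _ _ = ⊥-elim (ne refl)
  two-witnesses⇒2≤count (suc K) P (suc zero) (suc (suc m₂)) ne _ r₂ P1 Pm₂ rewrite P1 =
    s≤s (witness⇒1≤count K (λ m → P (suc m)) (suc m₂) (inRange-pred r₂) Pm₂)
  two-witnesses⇒2≤count (suc K) P (suc (suc m₁)) (suc zero) ne r₁ _ Pm₁ P1 rewrite P1 =
    s≤s (witness⇒1≤count K (λ m → P (suc m)) (suc m₁) (inRange-pred r₁) Pm₁)
  two-witnesses⇒2≤count (suc K) P (suc (suc m₁)) (suc (suc m₂)) ne r₁ r₂ Pm₁ Pm₂ =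
    ≤-trans (two-witnesses⇒2≤count K (λ m → P (suc m)) (suc m₁) (suc m₂) (λ e → ne (cong suc e))
                                   (inRange-pred r₁) (inRange-pred r₂) Pm₁ Pm₂)
            (m≤n+m _ (bit (P 1)))

  unique-witness⇒count≡1 : ∀ K (P : ℕ → Bool) m₀ → InRange K m₀ → P m₀ ≡ true
    → (∀ m → InRange K m → P m ≡ true → m ≡ m₀) → count P K ≡ 1
  unique-witness⇒count≡1 zero P m₀ r _ _ = ⊥-elim (¬inRange0 r)
  unique-witness⇒count≡1 (suc K) P (suc zero) r P1 uniq rewrite P1 =
    cong suc (false⇒count≡0 K (λ m → P (suc m)) λ { zero (() , _)
                                                   ; (suc m) r′ → ¬true⇒false (λ e → 1+n≢0 (suc-injective (uniq (suc (suc m)) (suc-inRange r′) e))) })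
  unique-witness⇒count≡1 (suc K) P (suc (suc m₀)) r Pm₀ uniq with P 1 in P1
  ... | true  = ⊥-elim (1+n≢0 (suc-injective (sym (uniq 1 1-inRange P1))))
  ... | false = unique-witness⇒count≡1 K (λ m → P (suc m)) (suc m₀) (inRange-pred r) Pm₀
                  (λ m r′ e → suc-injective (uniq (suc m) (suc-inRange r′) e))

  count-⊆-≡⇒⊇ : ∀ K (P Q : ℕ → Bool) → (∀ m → InRange K m → P m ≡ true → Q m ≡ true) → count P K ≡ count Q K
    → ∀ m → InRange K m → Q m ≡ true → P m ≡ true
  count-⊆-≡⇒⊇ K P Q P⊆Q eq m r Qm with P m in Pm
  ... | true  = refl
  ... | false = ⊥-elim (true≢false (∧-intro Qm (cong not Pm)) (count≡0⇒false K (λ m → Q m ∧ not (P m)) Q∖P≡0 m r))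
    where
    Q∧P≡P : ∀ m → InRange K m → (Q m ∧ P m) ≡ P m
    Q∧P≡P m r′ with P m in Pm′
    ... | false = Data.Bool.Properties.∧-zeroʳ (Q m)
    ... | true  rewrite P⊆Q m r′ Pm′ = refl
    Q∖P≡0 : count (λ m → Q m ∧ not (P m)) K ≡ 0
    Q∖P≡0 = +-cancelˡ-≡ (count P K) _ _ (begin
      count P K + count (λ m → Q m ∧ not (P m)) K
        ≡⟨ cong (_+ count (λ m → Q m ∧ not (P m)) K) (sym (count-cong K _ _ Q∧P≡P)) ⟩
      count (λ m → Q m ∧ P m) K + count (λ m → Q m ∧ not (P m)) K
        ≡⟨ sym (count-split K Q P) ⟩
      count Q K
        ≡⟨ sym eq ⟩
      count P K
        ≡⟨ sym (+-identityʳ _) ⟩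
      count P K + 0 ∎)
      where open ≡-Reasoning

  bounded-sum-≡ : ∀ {x y p q} → x ≤ p → y ≤ q → x + y ≡ p + q → (x ≡ p) × (y ≡ q)
  bounded-sum-≡ {x} x≤p y≤q e with m≤n⇒m<n∨m≡n x≤p
  ... | inj₂ refl = refl , +-cancelˡ-≡ x _ _ e
  ... | inj₁ x<p  = ⊥-elim (<-irrefl e (+-mono-<-≤ x<p y≤q))

  count-update : ∀ K (P Q : ℕ → Bool) m₀ → InRange K m₀ → (∀ m → InRange K m → m ≢ m₀ → P m ≡ Q m)
    → count P K + bit (Q m₀) ≡ count Q K + bit (P m₀)
  count-update zero P Q m₀ r _ = ⊥-elim (¬inRange0 r)
  count-update (suc K) P Q (suc zero) r agree =
    trans (cong (λ c → (bit (P 1) + c) + bit (Q 1))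
                (count-cong K _ _ (λ { (suc m) r′ → agree (suc (suc m)) (suc-inRange r′) (λ ()) })))
          (xy∙z≈zy∙x (bit (P 1)) _ (bit (Q 1)))
  count-update (suc K) P Q (suc (suc m₀)) r agree rewrite agree 1 1-inRange (λ ()) =
    trans (+-assoc (bit (Q 1)) _ _)
          (trans (cong (bit (Q 1) +_)
                       (count-update K (λ m → P (suc m)) (λ m → Q (suc m)) (suc m₀) (inRange-pred r)
                                     (λ m r′ ne → agree (suc m) (suc-inRange r′) (λ e → ne (suc-injective e)))))
                 (sym (+-assoc (bit (Q 1)) _ _)))

  countOn : (ℕ → Bool) → List ℕ → ℕ
  countOn P []      = 0
  countOn P (s ∷ S) = bit (P s) + countOn P S

  countOn-cong : ∀ {P Q : ℕ → Bool} S → All (λ s → P s ≡ Q s) S → countOn P S ≡ countOn Q S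
  countOn-cong []      []         = refl
  countOn-cong (s ∷ S) (eq ∷ eqs) = cong₂ _+_ (cong bit eq) (countOn-cong S eqs)

  count-local : ∀ K (P Q : ℕ → Bool) S → All (InRange K) S → Unique S
    → (∀ m → InRange K m → m ∉ S → P m ≡ Q m)
    → count P K + countOn Q S ≡ count Q K + countOn P S
  count-local K P Q [] _ _ agree = cong (_+ 0) (count-cong K P Q (λ m r → agree m r (λ ())))
  count-local K P Q (s ∷ S) (rs ∷ rS) (s∉S ∷ uS) agree = begin
      count P K + (bit (Q s) + countOn Q S)   ≡⟨ sym (+-assoc (count P K) _ _) ⟩
      (count P K + bit (Q s)) + countOn Q S   ≡⟨ cong (_+ countOn Q S) first ⟩
      (count R K + bit (P s)) + countOn Q S   ≡⟨ xy∙z≈xz∙y (count R K) _ _ ⟩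
      (count R K + countOn Q S) + bit (P s)   ≡⟨ cong (_+ bit (P s)) rest ⟩
      (count Q K + countOn R S) + bit (P s)   ≡⟨ cong (λ c → (count Q K + c) + bit (P s)) R≡P-on-S ⟩
      (count Q K + countOn P S) + bit (P s)   ≡⟨ xy∙z≈x∙zy (count Q K) _ _ ⟩
      count Q K + (bit (P s) + countOn P S)   ∎
    where
    open ≡-Reasoning
    R : ℕ → Bool
    R m = if m ≡ᵇ s then Q m else P m
    R-at : R s ≡ Q s
    R-at rewrite ≡⇒≡ᵇ-true {s} refl = refl
    R-off : ∀ m → m ≢ s → R m ≡ P m
    R-off m m≢s rewrite ≢⇒≡ᵇ-false m≢s = refl
    first : count P K + bit (Q s) ≡ count R K + bit (P s)
    first = subst (λ b → count P K + bit b ≡ count R K + bit (P s)) R-at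
                  (count-update K P R s rs (λ m _ m≢s → sym (R-off m m≢s)))
    rest : count R K + countOn Q S ≡ count Q K + countOn R S
    rest = count-local K R Q S rS uS R≡Q-off-S
      where
      R≡Q-off-S : ∀ m → InRange K m → m ∉ S → R m ≡ Q m
      R≡Q-off-S m r m∉S with m ≟ s
      ... | yes refl = R-at
      ... | no m≢s   = trans (R-off m m≢s) (agree m r λ { (here m≡s) → m≢s m≡s ; (there m∈S) → m∉S m∈S })
    R≡P-on-S : countOn R S ≡ countOn P S
    R≡P-on-S = countOn-cong S (Data.List.Relation.Unary.All.map (λ s≢x → R-off _ (λ x≡s → s≢x (sym x≡s))) s∉S)

  count-≡⇒countOn-≡ : ∀ K (P Q : ℕ → Bool) S → All (InRange K) S → Unique S
    → (∀ m → InRange K m → m ∉ S → P m ≡ Q m) → count P K ≡ count Q K → countOn P S ≡ countOn Q S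
  count-≡⇒countOn-≡ K P Q S rS uS agree eq =
    sym (+-cancelˡ-≡ (count P K) _ _ (trans (count-local K P Q S rS uS agree) (cong (_+ countOn P S) (sym eq))))


  countOn≢0⇒witness : ∀ (P : ℕ → Bool) S → countOn P S ≢ 0 → Σ ℕ (λ s → s ∈ S × P s ≡ true)
  countOn≢0⇒witness P []      ne = ⊥-elim (ne refl)
  countOn≢0⇒witness P (s ∷ S) ne with P s in Ps
  ... | true  = s , here refl , Ps
  ... | false with countOn≢0⇒witness P S ne
  ...   | x , x∈S , Px = x , there x∈S , Px


  ∈⇒countOn≢0 : ∀ (P : ℕ → Bool) {s} S → s ∈ S → P s ≡ true → countOn P S ≢ 0
  ∈⇒countOn≢0 P (x ∷ S) (here refl) Ps rewrite Ps = λ ()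
  ∈⇒countOn≢0 P (x ∷ S) (there s∈S) Ps e = ∈⇒countOn≢0 P S s∈S Ps (m+n≡0⇒n≡0 (bit (P x)) e)


  count-at : ∀ K c (P : ℕ → Bool) → InRange K c → count (λ l → (l ≡ᵇ c) ∧ P l) K ≡ bit (P c)
  count-at K c P rc with P c in Pc
  ... | true  = unique-witness⇒count≡1 K _ c rc (∧-intro (≡⇒≡ᵇ-true {c} refl) Pc) (λ m _ e → ≡ᵇ-true⇒≡ (∧-conicalˡ _ _ e))
  ... | false = false⇒count≡0 K _ only-c
    where
    only-c : ∀ m → InRange K m → ((m ≡ᵇ c) ∧ P m) ≡ false
    only-c m _ with m ≡ᵇ c in m≡c
    ... | false = refl
    ... | true rewrite ≡ᵇ-true⇒≡ {m} m≡c = Pc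

  count-at-outside : ∀ K c (P : ℕ → Bool) → ¬ InRange K c → count (λ l → (l ≡ᵇ c) ∧ P l) K ≡ 0
  count-at-outside K c P c∉ = false⇒count≡0 K _ only-c
    where
    only-c : ∀ m → InRange K m → ((m ≡ᵇ c) ∧ P m) ≡ false
    only-c m rm with m ≡ᵇ c in m≡c
    ... | false = refl
    ... | true rewrite ≡ᵇ-true⇒≡ {m} m≡c = ⊥-elim (c∉ rm)

  search² : ∀ K (Q : ℕ → ℕ → Bool)
    → Σ ℕ (λ x → Σ ℕ (λ y → InRange K x × InRange K y × Q x y ≡ true)) ⊎ (∀ x y → InRange K x → InRange K y → Q x y ≡ false)
  search² K Q with count (λ x → not (count (Q x) K ≡ᵇ 0)) K ≟ 0
  ... | yes none = inj₂ (λ x y rx ry → count≡0⇒false K (Q x) (≡ᵇ-true⇒≡ (not-false (count≡0⇒false K _ none x rx))) y ry)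
    where
    not-false : ∀ {a} → not a ≡ false → a ≡ true
    not-false {true} _ = refl
  ... | no some with count≢0⇒witness K _ some
  ...   | x , rx , Qx with count≢0⇒witness K (Q x) (≡ᵇ-false⇒≢ (not-true Qx))
  ...     | y , ry , Qxy = inj₁ (x , y , rx , ry , Qxy)

open Counting

module Agreement where

  open import Data.Nat
  open import Data.Nat.Properties
  open import Data.Bool using (Bool; true; false; _∧_)
  open import Data.Bool.Properties using (∧-conicalˡ; ∧-conicalʳ)
  open import Data.Product using (Σ; _×_; _,_)
  open import Data.Sum using (inj₁; inj₂)
  open import Relation.Binary.PropositionalEquality

  agreeUpTo : (ℕ → ℕ) → (ℕ → ℕ) → ℕ → Bool
  agreeUpTo p r zero    = p 0 ≡ᵇ r 0
  agreeUpTo p r (suc l) = agreeUpTo p r l ∧ (p (suc l) ≡ᵇ r (suc l))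

  agreeUpTo⇒≡ : ∀ p r l → agreeUpTo p r l ≡ true → ∀ i → i ≤ l → p i ≡ r i
  agreeUpTo⇒≡ p r zero    a .zero z≤n = ≡ᵇ-true⇒≡ a
  agreeUpTo⇒≡ p r (suc l) a i i≤1+l with m≤n⇒m<n∨m≡n i≤1+l
  ... | inj₁ (s≤s i≤l) = agreeUpTo⇒≡ p r l (∧-conicalˡ _ _ a) i i≤l
  ... | inj₂ refl      = ≡ᵇ-true⇒≡ (∧-conicalʳ (agreeUpTo p r l) _ a)

  ≡⇒agreeUpTo : ∀ p r l → (∀ i → i ≤ l → p i ≡ r i) → agreeUpTo p r l ≡ true
  ≡⇒agreeUpTo p r zero    eq = ≡⇒≡ᵇ-true (eq 0 z≤n)
  ≡⇒agreeUpTo p r (suc l) eq =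
    ∧-intro (≡⇒agreeUpTo p r l (λ i i≤l → eq i (m≤n⇒m≤1+n i≤l))) (≡⇒≡ᵇ-true (eq (suc l) ≤-refl))

  disagreement : ∀ p r l → agreeUpTo p r l ≡ false → Σ ℕ (λ i → i ≤ l × p i ≢ r i)
  disagreement p r zero    a = 0 , z≤n , ≡ᵇ-false⇒≢ a
  disagreement p r (suc l) a with agreeUpTo p r l in a′
  ... | true  = suc l , ≤-refl , ≡ᵇ-false⇒≢ a
  ... | false with disagreement p r l a′
  ...   | i , i≤l , ne = i , m≤n⇒m≤1+n i≤l , ne

  ≢⇒¬agreeUpTo : ∀ p r l i → i ≤ l → p i ≢ r i → agreeUpTo p r l ≡ false
  ≢⇒¬agreeUpTo p r l i i≤l ne = ¬true⇒false (λ a → ne (agreeUpTo⇒≡ p r l a i i≤l))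

  agreeUpTo-at : ∀ p r l → agreeUpTo p r l ≡ true → p l ≡ r l
  agreeUpTo-at p r l a = agreeUpTo⇒≡ p r l a l ≤-refl

  agreeUpTo-refl : ∀ p l → agreeUpTo p p l ≡ true
  agreeUpTo-refl p l = ≡⇒agreeUpTo p p l (λ _ _ → refl)

  agreeUpTo-sym : ∀ p q l → agreeUpTo p q l ≡ true → agreeUpTo q p l ≡ true
  agreeUpTo-sym p q l a = ≡⇒agreeUpTo q p l (λ i i≤l → sym (agreeUpTo⇒≡ p q l a i i≤l))

  agreeUpTo-trans : ∀ p q r l → agreeUpTo p q l ≡ true → agreeUpTo q r l ≡ true → agreeUpTo p r l ≡ true
  agreeUpTo-trans p q r l a b = ≡⇒agreeUpTo p r l (λ i i≤l → trans (agreeUpTo⇒≡ p q l a i i≤l) (agreeUpTo⇒≡ q r l b i i≤l))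

  agreeUpTo-congˡ : ∀ p p′ r l → (∀ i → i ≤ l → p i ≡ p′ i) → agreeUpTo p r l ≡ agreeUpTo p′ r l
  agreeUpTo-congˡ p p′ r zero    eq rewrite eq 0 z≤n = refl
  agreeUpTo-congˡ p p′ r (suc l) eq
    rewrite agreeUpTo-congˡ p p′ r l (λ i i≤l → eq i (m≤n⇒m≤1+n i≤l)) | eq (suc l) ≤-refl = refl

  agreeUpTo-congʳ : ∀ p r r′ l → (∀ i → i ≤ l → r i ≡ r′ i) → agreeUpTo p r l ≡ agreeUpTo p r′ l
  agreeUpTo-congʳ p r r′ zero    eq rewrite eq 0 z≤n = refl
  agreeUpTo-congʳ p r r′ (suc l) eq
    rewrite agreeUpTo-congʳ p r r′ l (λ i i≤l → eq i (m≤n⇒m≤1+n i≤l)) | eq (suc l) ≤-refl = refl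

open Agreement

module Multisets where

  open import Data.Nat
  open import Data.Nat.Properties
  open import Data.Bool using (true; false; _∧_)
  open import Data.List using (List; []; _∷_; map; concatMap; _++_)
  open import Data.List.Relation.Binary.Permutation.Propositional using (_↭_; refl; prep; swap; trans; ↭-sym)
  open import Data.List.Relation.Binary.Permutation.Propositional.Properties using (shift)
  open import Data.Product using (_×_; _,_; Σ)
  open import Data.Product.Properties using (≡-dec)
  open import Data.Empty using (⊥-elim)
  open import Relation.Nullary using (yes; no; does; Dec)
  open import Relation.Binary.PropositionalEquality as P using (_≡_; _≢_; refl; sym; cong; cong₂)
  open import Algebra.Properties.CommutativeSemigroup +-commutativeSemigroup using (x∙yz≈y∙xz)

  _≟²_ : (x y : ℕ × ℕ) → Dec (x ≡ y)
  _≟²_ = ≡-dec _≟_ _≟_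

  occurrences : ℕ × ℕ → List (ℕ × ℕ) → ℕ
  occurrences x []       = 0
  occurrences x (y ∷ ys) = bit (does (x ≟² y)) + occurrences x ys

  occurrences-++ : ∀ x xs ys → occurrences x (xs ++ ys) ≡ occurrences x xs + occurrences x ys
  occurrences-++ x []       ys = refl
  occurrences-++ x (y ∷ xs) ys =
    P.trans (cong (bit (does (x ≟² y)) +_) (occurrences-++ x xs ys)) (sym (+-assoc (bit (does (x ≟² y))) _ _))

  ↭⇒occurrences-≡ : ∀ {xs ys} → xs ↭ ys → ∀ x → occurrences x xs ≡ occurrences x ys
  ↭⇒occurrences-≡ refl          x = refl
  ↭⇒occurrences-≡ (prep y p)    x = cong (bit (does (x ≟² y)) +_) (↭⇒occurrences-≡ p x)
  ↭⇒occurrences-≡ (swap y z p)  x =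
    P.trans (x∙yz≈y∙xz (bit (does (x ≟² y))) (bit (does (x ≟² z))) _)
            (cong (λ c → bit (does (x ≟² z)) + (bit (does (x ≟² y)) + c)) (↭⇒occurrences-≡ p x))
  ↭⇒occurrences-≡ (trans p q)   x = P.trans (↭⇒occurrences-≡ p x) (↭⇒occurrences-≡ q x)

  occurrences-self : ∀ x xs → occurrences x (x ∷ xs) ≡ suc (occurrences x xs)
  occurrences-self x xs with x ≟² x
  ... | yes _  = refl
  ... | no x≢x = ⊥-elim (x≢x refl)

  occurrences≢0⇒split : ∀ x ys → occurrences x ys ≢ 0 → Σ (List (ℕ × ℕ)) (λ A → Σ (List (ℕ × ℕ)) (λ B → ys ≡ A ++ x ∷ B))
  occurrences≢0⇒split x []       ne = ⊥-elim (ne refl)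
  occurrences≢0⇒split x (y ∷ ys) ne with x ≟² y
  ... | yes refl = [] , ys , refl
  ... | no _ with occurrences≢0⇒split x ys ne
  ...   | A , B , e = y ∷ A , B , cong (y ∷_) e

  occurrences-≡⇒↭ : ∀ xs ys → (∀ x → occurrences x xs ≡ occurrences x ys) → xs ↭ ys
  occurrences-≡⇒↭ []       []       _  = refl
  occurrences-≡⇒↭ []       (y ∷ ys) eq = ⊥-elim (1+n≢0 (P.trans (sym (occurrences-self y ys)) (sym (eq y))))
  occurrences-≡⇒↭ (x ∷ xs) ys eq
    with occurrences≢0⇒split x ys (λ e → 1+n≢0 (P.trans (sym (occurrences-self x xs)) (P.trans (eq x) e)))
  ... | A , B , refl = trans (prep x (occurrences-≡⇒↭ xs (A ++ B) eq′)) (↭-sym (shift x A B))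
    where
    eq′ : ∀ z → occurrences z xs ≡ occurrences z (A ++ B)
    eq′ z = +-cancelˡ-≡ (bit (does (z ≟² x))) _ _ (P.trans (eq z) (↭⇒occurrences-≡ (shift x A B) z))

  sumMap : {A : Set} → (A → ℕ) → List A → ℕ
  sumMap g []       = 0
  sumMap g (x ∷ xs) = g x + sumMap g xs

  occurrences-concatMap : {A : Set} → ∀ x (φ : A → List (ℕ × ℕ)) xs
    → occurrences x (concatMap φ xs) ≡ sumMap (λ y → occurrences x (φ y)) xs
  occurrences-concatMap x φ []       = refl
  occurrences-concatMap x φ (y ∷ ys) =
    P.trans (occurrences-++ x (φ y) (concatMap φ ys)) (cong (occurrences x (φ y) +_) (occurrences-concatMap x φ ys))

  occurrences-map : {A : Set} → ∀ x (φ : A → ℕ × ℕ) xs → occurrences x (map φ xs) ≡ sumMap (λ y → bit (does (x ≟² φ y))) xs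
  occurrences-map x φ []       = refl
  occurrences-map x φ (y ∷ ys) = cong (bit (does (x ≟² φ y)) +_) (occurrences-map x φ ys)

  range-cons : ∀ a b → a ≤ b → range a b ≡ a ∷ range (suc a) b
  range-cons a b a≤b rewrite +-∸-assoc 1 a≤b = refl

  range-nil : ∀ a b → b < a → range a b ≡ []
  range-nil a b b<a rewrite m≤n⇒m∸n≡0 b<a = refl

  sumMap-range : ∀ (g : ℕ → ℕ) a K → sumMap g (range (suc a) (a + K)) ≡ sumTo (λ m → g (a + m)) K
  sumMap-range g a zero rewrite range-nil (suc a) (a + 0) (s≤s (≤-reflexive (+-identityʳ a))) = refl
  sumMap-range g a (suc K) rewrite range-cons (suc a) (a + suc K) (≤-trans (≤-reflexive (+-comm 1 a)) (+-monoʳ-≤ a (s≤s z≤n))) =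
    cong₂ _+_ (cong g (+-comm 1 a))
      (P.trans (cong (λ z → sumMap g (range (suc (suc a)) z)) (+-suc a K))
        (P.trans (sumMap-range g (suc a) K) (sumTo-cong K _ _ (λ m _ → cong g (sym (+-suc a m))))))

  sumMap-range1 : ∀ (g : ℕ → ℕ) K → sumMap g (range 1 K) ≡ sumTo g K
  sumMap-range1 g K = sumMap-range g 0 K

  composition-≟ : ∀ a b l y → y ≤ l → does ((a , b) ≟² (l ∸ y , y)) ≡ ((l ≡ᵇ a + b) ∧ (y ≡ᵇ b))
  composition-≟ a b l y y≤l with (a , b) ≟² (l ∸ y , y)
  ... | yes refl rewrite m∸n+n≡m y≤l | ≡⇒≡ᵇ-true {l} refl | ≡⇒≡ᵇ-true {y} refl = refl
  ... | no ne with l ≡ᵇ a + b in l≡ | y ≡ᵇ b in y≡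
  ...   | false | _     = refl
  ...   | true  | false = refl
  ...   | true  | true  = ⊥-elim (ne (cong₂ _,_ (sym (P.trans (cong₂ _∸_ (≡ᵇ-true⇒≡ {l} l≡) (≡ᵇ-true⇒≡ {y} y≡)) (m+n∸n≡m a b)))
                                                (sym (≡ᵇ-true⇒≡ {y} y≡))))

  occurrences-compositions : ∀ a b n (φ : ℕ → ℕ × ℕ) (p : ℕ → ℕ)
    → (∀ l → InRange n l → φ l ≡ (l ∸ p l , p l)) → (∀ l → InRange n l → p l ≤ l)
    → occurrences (a , b) (map φ (range 1 n)) ≡ count (λ l → (l ≡ᵇ a + b) ∧ (p l ≡ᵇ b)) n
  occurrences-compositions a b n φ p φ≡ p≤ =
    P.trans (occurrences-map (a , b) φ (range 1 n))
      (P.trans (sumMap-range1 _ n)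
        (sumTo-cong n _ _ (λ l r → cong bit (P.trans (cong (λ z → does ((a , b) ≟² z)) (φ≡ l r)) (composition-≟ a b l (p l) (p≤ l r))))))

module Families where

  open import Data.Nat
  open import Data.Nat.Properties
  open import Data.Bool using (true; false)
  open import Data.Product using (_,_; proj₁)
  open import Data.Sum using (_⊎_)
  open import Data.Empty using (⊥-elim)
  open import Relation.Binary.PropositionalEquality

  2*suc : ∀ h → 2 * suc h ≡ suc (suc (2 * h))
  2*suc h = *-suc 2 h

  star-suc-suc : ∀ m → 1 ≤ m → star (suc (suc m)) ≡ suc (suc (star m))
  star-suc-suc (suc m) _ with isEven (suc m)
  ... | true  = refl
  ... | false = refl

  star-pos : ∀ m → 1 ≤ m → 1 ≤ star m
  star-pos 1 _ = s≤s z≤n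
  star-pos 2 _ = s≤s z≤n
  star-pos (suc (suc (suc m))) _ rewrite star-suc-suc (suc m) (s≤s z≤n) = s≤s z≤n

  star-involutive : ∀ m → 1 ≤ m → star (star m) ≡ m
  star-involutive 1 _ = refl
  star-involutive 2 _ = refl
  star-involutive (suc (suc (suc m))) _ = begin
    star (star (3 + m))             ≡⟨ cong star (star-suc-suc (suc m) (s≤s z≤n)) ⟩
    star (2 + star (suc m))         ≡⟨ star-suc-suc (star (suc m)) (star-pos (suc m) (s≤s z≤n)) ⟩
    2 + star (star (suc m))         ≡⟨ cong (2 +_) (star-involutive (suc m) (s≤s z≤n)) ⟩
    3 + m                           ∎
    where open ≡-Reasoning

  star-injective : ∀ a b → 1 ≤ a → 1 ≤ b → star a ≡ star b → a ≡ b
  star-injective a b 1≤a 1≤b e = trans (sym (star-involutive a 1≤a)) (trans (cong star e) (star-involutive b 1≤b))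

  star-≢ : ∀ m → 1 ≤ m → star m ≢ m
  star-≢ 1 _ ()
  star-≢ 2 _ ()
  star-≢ (suc (suc (suc m))) _ e =
    star-≢ (suc m) (s≤s z≤n) (suc-injective (suc-injective (trans (sym (star-suc-suc (suc m) (s≤s z≤n))) e)))

  star-≤ : ∀ h m → 1 ≤ m → m ≤ 2 * h → star m ≤ 2 * h
  star-≤ zero    m 1≤m m≤0 = ⊥-elim (¬inRange0 (1≤m , m≤0))
  star-≤ (suc h) 1 _ _ rewrite 2*suc h = s≤s (s≤s z≤n)
  star-≤ (suc h) 2 _ _ rewrite 2*suc h = s≤s z≤n
  star-≤ (suc h) (suc (suc (suc m))) _ m≤ rewrite 2*suc h | star-suc-suc (suc m) (s≤s z≤n) with m≤
  ... | s≤s (s≤s m≤′) = s≤s (s≤s (star-≤ h (suc m) (s≤s z≤n) m≤′))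

  star-inRange : ∀ h m → InRange (2 * h) m → InRange (2 * h) (star m)
  star-inRange h m (1≤m , m≤2h) = star-pos m 1≤m , star-≤ h m 1≤m m≤2h

  Step : ℕ → ℕ → Set
  Step a b = (b ≡ a) ⊎ (b ≡ suc a)

  record PathFamily (n h w : ℕ) (X : ℕ → ℕ → ℕ) : Set where
    field
      start  : ∀ m → InRange (2 * h) m → X 0 m ≡ 0
      step   : ∀ m → InRange (2 * h) m → ∀ i → i < n → Step (X i m) (X (suc i) m)
      end    : ∀ m → InRange (2 * h) m → X n m ≡ w
      mirror : ∀ m → InRange (2 * h) m → ∀ i → i ≤ n → X i (star m) + X (n ∸ i) m ≡ w

  path : (ℕ → ℕ → ℕ) → ℕ → ℕ → ℕ
  path X m i = X i m

  levelCount : (ℕ → ℕ → ℕ) → ℕ → ℕ → ℕ → ℕ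
  levelCount X K l v = count (λ m → X l m ≡ᵇ v) K

  module _ {n h w : ℕ} where

    partner-height : ∀ {X} → PathFamily n h w X → ∀ m → InRange (2 * h) m → ∀ i → i ≤ n → X i (star m) ≡ w ∸ X (n ∸ i) m
    partner-height {X} F m r i i≤n =
      sym (trans (cong (_∸ X (n ∸ i) m) (sym (PathFamily.mirror F m r i i≤n))) (m+n∸n≡m (X i (star m)) (X (n ∸ i) m)))

    partner-≡ : ∀ {X Y} → PathFamily n h w X → PathFamily n h w Y → ∀ a b → InRange (2 * h) a → InRange (2 * h) b
      → ∀ i → i ≤ n → X (n ∸ i) a ≡ Y (n ∸ i) b → X i (star a) ≡ Y i (star b)
    partner-≡ FX FY a b ra rb i i≤n e =
      trans (partner-height FX a ra i i≤n) (trans (cong (w ∸_) e) (sym (partner-height FY b rb i i≤n)))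

    partner-≢ : ∀ {X} → PathFamily n h w X → ∀ m → InRange (2 * h) m → ∀ i → i ≤ n
      → X i m ≢ X i (star m) → X (n ∸ i) m ≢ X (n ∸ i) (star m)
    partner-≢ {X} F m r i i≤n ne e =
      ne (trans (cong (X i) (sym (star-involutive m (proj₁ r))))
                (partner-≡ F F (star m) m (star-inRange h m r) r i i≤n (sym e)))

  agreeCount : (ℕ → ℕ → ℕ) → ℕ → (ℕ → ℕ) → ℕ → ℕ
  agreeCount X K r l = count (λ m → agreeUpTo (path X m) r l) K

open Families

module Intervals (n : ℕ) (f : ℕ → ℕ → ℕ) (m₁ m₂ : ℕ) where

  open import Data.Nat
  open import Data.Nat.Properties
  open import Data.Product using (_×_; _,_; Σ; proj₁; proj₂)
  open import Data.Sum using (inj₁; inj₂)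
  open import Data.Empty using (⊥-elim)
  open import Relation.Nullary using (¬_; yes; no; Dec)
  open import Relation.Binary using (tri<; tri≈; tri>)
  open import Relation.Binary.PropositionalEquality

  D : ℕ → Set
  D = InD n f m₁ m₂

  MI : ℕ × ℕ → Set
  MI = MaxInterval n f m₁ m₂

  D? : ∀ l → Dec (D l)
  D? l with 1 ≤? l | l ≤? n | f l m₁ ≟ f l m₂
  ... | yes a | yes b | no c  = yes (a , b , c)
  ... | no a  | _     | _     = no (λ x → a (proj₁ x))
  ... | yes _ | no b  | _     = no (λ x → b (proj₁ (proj₂ x)))
  ... | yes _ | yes _ | yes c = no (λ x → proj₂ (proj₂ x) c)

  ¬D⇒≡ : f 0 m₁ ≡ f 0 m₂ → ∀ t → t ≤ n → ¬ D t → f t m₁ ≡ f t m₂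
  ¬D⇒≡ e₀ zero    _   _  = e₀
  ¬D⇒≡ e₀ (suc t) t≤n ¬D with f (suc t) m₁ ≟ f (suc t) m₂
  ... | yes e = e
  ... | no ne = ⊥-elim (¬D (s≤s z≤n , t≤n , ne))

  module _ {a b : ℕ} (I : MI (a , b)) where

    start≥1 : 1 ≤ a
    start≥1 = proj₁ I

    start≤end : a ≤ b
    start≤end = proj₁ (proj₂ I)

    end≤n : b ≤ n
    end≤n = proj₁ (proj₂ (proj₂ I))

    inside : ∀ l → a ≤ l → l ≤ b → D l
    inside = proj₁ (proj₂ (proj₂ (proj₂ I)))

    ¬D-before : ¬ D (a ∸ 1)
    ¬D-before = proj₁ (proj₂ (proj₂ (proj₂ (proj₂ I))))

    ¬D-after : ¬ D (suc b)
    ¬D-after = proj₂ (proj₂ (proj₂ (proj₂ (proj₂ I))))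

    ¬D⇒before-start : ∀ d e → a ≤ d → d ≤ b → ¬ D e → e ≤ d → e < a
    ¬D⇒before-start d e a≤d d≤b ¬De e≤d with a ≤? e
    ... | yes a≤e = ⊥-elim (¬De (inside e a≤e (≤-trans e≤d d≤b)))
    ... | no a≰e  = ≰⇒> a≰e

    ¬D⇒after-end : ∀ d e → a ≤ d → d ≤ b → ¬ D e → d ≤ e → b < e
    ¬D⇒after-end d e a≤d d≤b ¬De d≤e with e ≤? b
    ... | yes e≤b = ⊥-elim (¬De (inside e (≤-trans a≤d d≤e) e≤b))
    ... | no e≰b  = ≰⇒> e≰b

  IntervalAround : ℕ → Set
  IntervalAround d = Σ (ℕ × ℕ) (λ I → MI I × proj₁ I ≤ d × d ≤ proj₂ I)

  maxInterval-around : ∀ d → D d → IntervalAround d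
  maxInterval-around d Dd with leftEnd d Dd | rightEnd (n ∸ d) d (m+[n∸m]≡n (proj₁ (proj₂ Dd))) Dd
    where
    leftEnd : ∀ d → D d → Σ ℕ (λ k₁ → k₁ ≤ d × 1 ≤ k₁ × (∀ l → k₁ ≤ l → l ≤ d → D l) × ¬ D (k₁ ∸ 1))
    leftEnd zero (() , _)
    leftEnd (suc d) Dd with D? d
    ... | no ¬Dd = suc d , ≤-refl , s≤s z≤n , (λ l p q → subst D (≤-antisym p q) Dd) , ¬Dd
    ... | yes Dd′ with leftEnd d Dd′
    ...   | k₁ , k₁≤d , 1≤k₁ , all , ¬D′ = k₁ , m≤n⇒m≤1+n k₁≤d , 1≤k₁ , all′ , ¬D′
      where
      all′ : ∀ l → k₁ ≤ l → l ≤ suc d → D l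
      all′ l p q with m≤n⇒m<n∨m≡n q
      ... | inj₁ (s≤s l≤d) = all l p l≤d
      ... | inj₂ refl      = Dd
    rightEnd : ∀ k d → d + k ≡ n → D d → Σ ℕ (λ k₂ → d ≤ k₂ × k₂ ≤ n × (∀ l → d ≤ l → l ≤ k₂ → D l) × ¬ D (suc k₂))
    rightEnd k d e Dd with D? (suc d)
    ... | no ¬Dd = d , ≤-refl , proj₁ (proj₂ Dd) , (λ l p q → subst D (≤-antisym p q) Dd) , ¬Dd
    rightEnd zero    d e Dd | yes (_ , d<n , _) = ⊥-elim (<-irrefl (trans (sym (+-identityʳ d)) e) d<n)
    rightEnd (suc k) d e Dd | yes Dd′ with rightEnd k (suc d) (trans (sym (+-suc d k)) e) Dd′
    ... | k₂ , d<k₂ , k₂≤n , all , ¬D′ = k₂ , <⇒≤ d<k₂ , k₂≤n , all′ , ¬D′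
      where
      all′ : ∀ l → d ≤ l → l ≤ k₂ → D l
      all′ l p q with m≤n⇒m<n∨m≡n p
      ... | inj₁ d<l = all l d<l q
      ... | inj₂ refl = Dd
  ... | k₁ , k₁≤d , 1≤k₁ , allL , ¬Dl | k₂ , d≤k₂ , k₂≤n , allR , ¬Dr =
    (k₁ , k₂) , (1≤k₁ , ≤-trans k₁≤d d≤k₂ , k₂≤n , all , ¬Dl , ¬Dr) , k₁≤d , d≤k₂
    where
    all : ∀ l → k₁ ≤ l → l ≤ k₂ → D l
    all l p q with ≤-total l d
    ... | inj₁ l≤d = allL l p l≤d
    ... | inj₂ d≤l = allR l d≤l q

  separated⇒≢ : ∀ {a b c d} → MI (a , b) → MI (c , d) → ∀ x y z → a ≤ x → x ≤ b → c ≤ z → z ≤ d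
    → x ≤ y → y ≤ z → ¬ D y → (a , b) ≢ (c , d)
  separated⇒≢ I J x y z a≤x x≤b c≤z z≤d x≤y y≤z ¬Dy refl =
    <-irrefl refl (<-trans (¬D⇒after-end I x y a≤x x≤b ¬Dy x≤y) (<-≤-trans (¬D⇒before-start J z y c≤z z≤d ¬Dy y≤z) (start≤end J)))

  overlap⇒≡ : ∀ {a b c d} → MI (a , b) → MI (c , d) → ∀ p → a ≤ p → p ≤ b → c ≤ p → p ≤ d → (a , b) ≡ (c , d)
  overlap⇒≡ {suc a} {b} {suc c} {d} I J p a≤p p≤b c≤p p≤d =
    cong₂ _,_ (≤-antisym (¬D⇒before-start J p a c≤p p≤d (¬D-before I) (≤-trans (n≤1+n a) a≤p))
                         (¬D⇒before-start I p c a≤p p≤b (¬D-before J) (≤-trans (n≤1+n c) c≤p)))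
              (≤-antisym (≤-pred (¬D⇒after-end I p (suc d) a≤p p≤b (¬D-after J) (≤-trans p≤d (n≤1+n d))))
                         (≤-pred (¬D⇒after-end J p (suc b) c≤p p≤d (¬D-after I) (≤-trans p≤b (n≤1+n b)))))
  overlap⇒≡ {zero} I = ⊥-elim (<-irrefl refl (start≥1 I))
  overlap⇒≡ {suc _} {_} {zero} I J = ⊥-elim (<-irrefl refl (start≥1 J))

  Gap : Set
  Gap = Σ ℕ (λ i → Σ ℕ (λ k → Σ ℕ (λ j → i < k × k < j × j ≤ n × D i × ¬ D k × D j)))

  ordered⇒gap : ∀ {a b c d} → MI (a , b) → MI (c , d) → a < c → Gap
  ordered⇒gap {a} {b} {suc c} {d} I J (s≤s a≤c) =
    b , suc b , suc c , ≤-refl , s≤s (¬D⇒after-end I a c ≤-refl (start≤end I) (¬D-before J) a≤c)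
      , ≤-trans (start≤end J) (end≤n J) , inside I b (start≤end I) ≤-refl , ¬D-after I , inside J (suc c) ≤-refl (start≤end J)

  distinct⇒gap : ∀ {a b c d} → MI (a , b) → MI (c , d) → (a , b) ≢ (c , d) → Gap
  distinct⇒gap {a} {b} {c} {d} I J ne with <-cmp a c
  ... | tri< a<c _ _ = ordered⇒gap I J a<c
  ... | tri≈ _ a≡c _ = ⊥-elim (ne (overlap⇒≡ I J a ≤-refl (start≤end I) (≤-reflexive (sym a≡c)) (≤-trans (≤-reflexive a≡c) (start≤end J))))
  ... | tri> _ _ c<a = ordered⇒gap J I c<a

  interval-around : ∀ {d} (Dd : D d) → MI (proj₁ (maxInterval-around d Dd))
  interval-around Dd = proj₁ (proj₂ (maxInterval-around _ Dd))

  separated-intervals-≢ : ∀ x y z → x ≤ y → y ≤ z → (Dx : D x) → ¬ D y → (Dz : D z)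
    → proj₁ (maxInterval-around x Dx) ≢ proj₁ (maxInterval-around z Dz)
  separated-intervals-≢ x y z x≤y y≤z Dx ¬Dy Dz =
    separated⇒≢ (proj₁ (proj₂ A)) (proj₁ (proj₂ B)) x y z (proj₁ (proj₂ (proj₂ A))) (proj₂ (proj₂ (proj₂ A)))
                (proj₁ (proj₂ (proj₂ B))) (proj₂ (proj₂ (proj₂ B))) x≤y y≤z ¬Dy
    where
    A : IntervalAround x
    A = maxInterval-around x Dx
    B : IntervalAround z
    B = maxInterval-around z Dz

module EdgeCounts where

  open import Data.Nat
  open import Data.Nat.Properties
  open import Data.Bool using (true; false; _∧_; _∨_; not)
  open import Data.Bool.Properties using (∧-zeroʳ; ∨-identityʳ; ∧-conicalˡ)
  open import Data.Product using (_×_; _,_; proj₁; proj₂)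
  open import Data.Sum using (inj₁; inj₂)
  open import Relation.Nullary using (yes; no)
  open import Relation.Binary.PropositionalEquality

  edgeCount : (ℕ → ℕ → ℕ) → ℕ → ℕ → ℕ → ℕ → ℕ
  edgeCount X K l v d = count (λ m → (X l m ≡ᵇ v) ∧ (X (suc l) m ≡ᵇ d)) K

  v≢1+v : ∀ v → v ≢ suc v
  v≢1+v v e = <-irrefl e (n<1+n v)

  step-leaves : ∀ a b v → Step a b → ((a ≡ᵇ v) ∧ not (b ≡ᵇ v)) ≡ ((a ≡ᵇ v) ∧ (b ≡ᵇ suc v))
  step-leaves a b v s with a ≡ᵇ v in a≡v
  ... | false = refl
  ... | true with ≡ᵇ-true⇒≡ {a} a≡v | s
  ...   | refl | inj₁ refl rewrite ≡⇒≡ᵇ-true {a} refl | ≢⇒≡ᵇ-false (v≢1+v a) = refl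
  ...   | refl | inj₂ refl rewrite ≡⇒≡ᵇ-true {suc a} refl | ≢⇒≡ᵇ-false {suc a} {a} (λ e → v≢1+v a (sym e)) = refl

  step-arrives-0 : ∀ a b → Step a b → (b ≡ᵇ 0) ≡ ((a ≡ᵇ 0) ∧ (b ≡ᵇ 0))
  step-arrives-0 zero    b                  _          = refl
  step-arrives-0 (suc a) .(suc a)       (inj₁ refl) = refl
  step-arrives-0 (suc a) .(suc (suc a)) (inj₂ refl) = refl

  step-arrives-suc : ∀ a b v → Step a b
    → (b ≡ᵇ suc v) ≡ (((a ≡ᵇ suc v) ∧ (b ≡ᵇ suc v)) ∨ ((a ≡ᵇ v) ∧ (b ≡ᵇ suc v)))
  step-arrives-suc a .a v (inj₁ refl) with a ≡ᵇ suc v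
  ... | false = sym (∧-zeroʳ (a ≡ᵇ v))
  ... | true  = refl
  step-arrives-suc a .(suc a) v (inj₂ refl) with a ≡ᵇ v in a≡v
  ... | false = sym (trans (∨-identityʳ _) (∧-zeroʳ (a ≡ᵇ suc v)))
  ... | true rewrite ≢⇒≡ᵇ-false {a} {suc v} (λ e → v≢1+v v (trans (sym (≡ᵇ-true⇒≡ {a} a≡v)) e)) = refl

  step-only : ∀ a b v d → Step a b → d ≢ v → d ≢ suc v → ((a ≡ᵇ v) ∧ (b ≡ᵇ d)) ≡ false
  step-only a b v d s d≢v d≢1+v with a ≡ᵇ v in a≡v
  ... | false = refl
  ... | true with ≡ᵇ-true⇒≡ {a} a≡v | s
  ...   | refl | inj₁ refl = ≢⇒≡ᵇ-false (λ e → d≢v (sym e))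
  ...   | refl | inj₂ refl = ≢⇒≡ᵇ-false (λ e → d≢1+v (sym e))

  module _ {n h w : ℕ} {X : ℕ → ℕ → ℕ} (F : PathFamily n h w X) (l : ℕ) (l<n : l < n) where

    private
      K : ℕ
      K = 2 * h
      step : ∀ m → InRange K m → Step (X l m) (X (suc l) m)
      step m r = PathFamily.step F m r l l<n

    levelCount-leaving : ∀ v → levelCount X K l v ≡ edgeCount X K l v v + edgeCount X K l v (suc v)
    levelCount-leaving v =
      trans (count-split K (λ m → X l m ≡ᵇ v) (λ m → X (suc l) m ≡ᵇ v))
            (cong (edgeCount X K l v v +_) (count-cong K _ _ (λ m r → step-leaves (X l m) (X (suc l) m) v (step m r))))

    levelCount-arriving-0 : levelCount X K (suc l) 0 ≡ edgeCount X K l 0 0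
    levelCount-arriving-0 = count-cong K _ _ (λ m r → step-arrives-0 (X l m) (X (suc l) m) (step m r))

    levelCount-arriving-suc : ∀ v → levelCount X K (suc l) (suc v) ≡ edgeCount X K l (suc v) (suc v) + edgeCount X K l v (suc v)
    levelCount-arriving-suc v =
      trans (count-cong K _ _ (λ m r → step-arrives-suc (X l m) (X (suc l) m) v (step m r)))
            (count-∨-disjoint K _ _ (λ m r up flat → v≢1+v v (trans (sym (≡ᵇ-true⇒≡ {X l m} (∧-conicalˡ _ _ flat))) (≡ᵇ-true⇒≡ {X l m} (∧-conicalˡ _ _ up)))))

    edgeCount-non-step : ∀ v d → d ≢ v → d ≢ suc v → edgeCount X K l v d ≡ 0
    edgeCount-non-step v d d≢v d≢1+v = false⇒count≡0 K _ (λ m r → step-only (X l m) (X (suc l) m) v d (step m r) d≢v d≢1+v)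

  module _ {n h w : ℕ} {f g : ℕ → ℕ → ℕ} (Ff : PathFamily n h w f) (Fg : PathFamily n h w g) (l : ℕ) (l<n : l < n)
           (same  : ∀ v → levelCount g (2 * h) l v ≡ levelCount f (2 * h) l v)
           (same′ : ∀ v → levelCount g (2 * h) (suc l) v ≡ levelCount f (2 * h) (suc l) v) where

    private
      K : ℕ
      K = 2 * h

    rising-edges-≡-from-flat : ∀ v → edgeCount g K l v v ≡ edgeCount f K l v v → edgeCount g K l v (suc v) ≡ edgeCount f K l v (suc v)
    rising-edges-≡-from-flat v flat = +-cancelˡ-≡ (edgeCount g K l v v) _ _ (begin
      edgeCount g K l v v + edgeCount g K l v (suc v)  ≡⟨ sym (levelCount-leaving Fg l l<n v) ⟩
      levelCount g K l v                               ≡⟨ same v ⟩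
      levelCount f K l v                               ≡⟨ levelCount-leaving Ff l l<n v ⟩
      edgeCount f K l v v + edgeCount f K l v (suc v)  ≡⟨ cong (_+ edgeCount f K l v (suc v)) (sym flat) ⟩
      edgeCount g K l v v + edgeCount f K l v (suc v)  ∎)
      where open ≡-Reasoning

    flat-and-rising-edges-≡ : ∀ v → (edgeCount g K l v v ≡ edgeCount f K l v v) × (edgeCount g K l v (suc v) ≡ edgeCount f K l v (suc v))
    flat-and-rising-edges-≡ zero = flat₀ , rising-edges-≡-from-flat 0 flat₀
      where
      flat₀ : edgeCount g K l 0 0 ≡ edgeCount f K l 0 0
      flat₀ = trans (sym (levelCount-arriving-0 Fg l l<n)) (trans (same′ 0) (levelCount-arriving-0 Ff l l<n))
    flat-and-rising-edges-≡ (suc v) = flat , rising-edges-≡-from-flat (suc v) flat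
      where
      flat : edgeCount g K l (suc v) (suc v) ≡ edgeCount f K l (suc v) (suc v)
      flat = +-cancelʳ-≡ (edgeCount g K l v (suc v)) _ _ (begin
        edgeCount g K l (suc v) (suc v) + edgeCount g K l v (suc v)  ≡⟨ sym (levelCount-arriving-suc Fg l l<n v) ⟩
        levelCount g K (suc l) (suc v)                               ≡⟨ same′ (suc v) ⟩
        levelCount f K (suc l) (suc v)                               ≡⟨ levelCount-arriving-suc Ff l l<n v ⟩
        edgeCount f K l (suc v) (suc v) + edgeCount f K l v (suc v)  ≡⟨ cong (edgeCount f K l (suc v) (suc v) +_) (sym (proj₂ (flat-and-rising-edges-≡ v))) ⟩
        edgeCount f K l (suc v) (suc v) + edgeCount g K l v (suc v)  ∎)
        where open ≡-Reasoning

    edgeCount-≡ : ∀ v d → edgeCount g K l v d ≡ edgeCount f K l v d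
    edgeCount-≡ v d with d ≟ v | d ≟ suc v
    ... | yes refl | _        = proj₁ (flat-and-rising-edges-≡ v)
    ... | no _     | yes refl = proj₂ (flat-and-rising-edges-≡ v)
    ... | no d≢v   | no d≢1+v = trans (edgeCount-non-step Fg l l<n v d d≢v d≢1+v) (sym (edgeCount-non-step Ff l l<n v d d≢v d≢1+v))

open EdgeCounts

module Sufficiency {n h w : ℕ} {f g : ℕ → ℕ → ℕ} (Ff : PathFamily n h w f) (Fg : PathFamily n h w g)
  (condI : ConditionI n h f) (condII : ConditionII n h f)
  (same : ∀ l v → l ≤ n → levelCount g (2 * h) l v ≡ levelCount f (2 * h) l v) where

  open import Data.Nat
  open import Data.Nat.Properties
  open import Data.Bool using (Bool; true; false; _∧_; _∨_; not)
  open import Data.Bool.Properties using (∧-distribʳ-∨; ∨-zeroʳ; ∧-conicalˡ; ∧-conicalʳ)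
  open import Data.Product using (_×_; _,_; Σ; proj₁; proj₂)
  open import Data.Sum using (_⊎_; inj₁; inj₂; [_,_])
  open import Data.Empty using (⊥; ⊥-elim)
  open import Relation.Nullary using (¬_; yes; no)
  open import Relation.Binary.PropositionalEquality hiding ([_])

  private
    K : ℕ
    K = 2 * h

  disagreement-before : ∀ l a b → InRange K a → InRange K b → agreeUpTo (path f a) (path f b) l ≡ false
    → f l a ≡ f l b → l ≤ n → Σ ℕ (λ i → i < l × InD n f a b i)
  disagreement-before l a b ra rb a≉b eq l≤n with disagreement _ _ l a≉b
  ... | zero , _ , ne = ⊥-elim (ne (trans (PathFamily.start Ff a ra) (sym (PathFamily.start Ff b rb))))
  ... | suc i , i+1≤l , ne with m≤n⇒m<n∨m≡n i+1≤l
  ...   | inj₁ i+1<l = suc i , i+1<l , (s≤s z≤n , ≤-trans i+1≤l l≤n , ne)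
  ...   | inj₂ refl  = ⊥-elim (ne eq)

  -- Two paths that meet again after separating bound two distinct maximal intervals, which (ii) forbids for non-partners.
  non-partners-stay-together : ∀ l → l < n → ∀ a b → InRange K a → InRange K b → star a ≢ b
    → agreeUpTo (path f a) (path f b) l ≡ false → f l a ≡ f l b → f (suc l) a ≡ f (suc l) b
  non-partners-stay-together l l<n a b ra rb a*≢b a≉b eq with f (suc l) a ≟ f (suc l) b
  ... | yes eq′ = eq′
  ... | no ne with disagreement-before l a b ra rb a≉b eq (<⇒≤ l<n)
  ...   | i , i<l , Di = ⊥-elim (separated-intervals-≢ i l (suc l) (<⇒≤ i<l) (n≤1+n l) Di ¬Dl Dl+1
                                   (condII a b (proj₁ ra) (proj₂ ra) (proj₁ rb) (proj₂ rb) a*≢b _ _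
                                           (interval-around Di) (interval-around Dl+1)))
    where
    open Intervals n f a b
    ¬Dl : ¬ D l
    ¬Dl (_ , _ , ne′) = ne′ eq
    Dl+1 : D (suc l)
    Dl+1 = s≤s z≤n , l<n , ne

  -- Partners that meet again after separating give three distinct maximal intervals if l < n - l, by mirror symmetry.
  partners-rejoin-late : ∀ l → l < n → ∀ x → InRange K x → agreeUpTo (path f x) (path f (star x)) l ≡ false
    → f l x ≡ f l (star x) → f (suc l) x ≢ f (suc l) (star x) → n ∸ l ≤ l
  partners-rejoin-late l l<n x rx x≉x* eq ne with n ∸ l ≤? l
  ... | yes late = late
  ... | no early with disagreement-before l x (star x) rx (star-inRange h x rx) x≉x* eq (<⇒≤ l<n)
  ...   | i , i<l , Di = ⊥-elim (three-distinct (condI x (star x) (proj₁ rx) (proj₂ rx) (proj₁ rx*) (proj₂ rx*) refl _ _ _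
                                                       (interval-around Di) (interval-around Dl+1) (interval-around Dn-i)))
    where
    open Intervals n f x (star x)
    rx* : InRange K (star x)
    rx* = star-inRange h x rx
    l<n-l : l < n ∸ l
    l<n-l = ≰⇒> early
    i≤n : i ≤ n
    i≤n = ≤-trans (<⇒≤ i<l) (<⇒≤ l<n)
    ¬Dl : ¬ D l
    ¬Dl (_ , _ , ne′) = ne′ eq
    Dl+1 : D (suc l)
    Dl+1 = s≤s z≤n , l<n , ne
    Dn-i : D (n ∸ i)
    Dn-i = m<n⇒0<n∸m (<-trans i<l l<n) , m∸n≤m n i , partner-≢ Ff x rx i i≤n (proj₂ (proj₂ Di))
    ¬Dn-l : ¬ D (n ∸ l)
    ¬Dn-l (_ , _ , ne′) = partner-≢ Ff x rx (n ∸ l) (m∸n≤m n l) ne′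
                            (subst (λ t → f t x ≡ f t (star x)) (sym (m∸[m∸n]≡n (<⇒≤ l<n))) eq)
    three-distinct : (proj₁ (maxInterval-around i Di) ≡ proj₁ (maxInterval-around (suc l) Dl+1))
                   ⊎ (proj₁ (maxInterval-around i Di) ≡ proj₁ (maxInterval-around (n ∸ i) Dn-i))
                   ⊎ (proj₁ (maxInterval-around (suc l) Dl+1) ≡ proj₁ (maxInterval-around (n ∸ i) Dn-i)) → ⊥
    three-distinct (inj₁ e)        = separated-intervals-≢ i l (suc l) (<⇒≤ i<l) (n≤1+n l) Di ¬Dl Dl+1 e
    three-distinct (inj₂ (inj₁ e)) = separated-intervals-≢ i l (n ∸ i) (<⇒≤ i<l) (≤-trans (<⇒≤ l<n-l) (∸-monoʳ-≤ n (<⇒≤ i<l))) Di ¬Dl Dn-i e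
    three-distinct (inj₂ (inj₂ e)) = separated-intervals-≢ (suc l) (n ∸ l) (n ∸ i) l<n-l (∸-monoʳ-≤ n (<⇒≤ i<l)) Dl+1 ¬Dn-l Dn-i e

  partner-determined : ∀ {X} → PathFamily n h w X → ∀ l → l < n → n ∸ l ≤ l → ∀ x z → InRange K x → InRange K z
    → agreeUpTo (path X z) (path f x) l ≡ true
    → (X l (star z) ≡ f l (star x)) × (X (suc l) (star z) ≡ f (suc l) (star x))
  partner-determined FX l l<n late x z rx rz z≈x =
    partner-≡ FX Ff z x rz rx l (<⇒≤ l<n) (agreeUpTo⇒≡ _ _ l z≈x (n ∸ l) late) ,
    partner-≡ FX Ff z x rz rx (suc l) l<n (agreeUpTo⇒≡ _ _ l z≈x (n ∸ suc l) (≤-trans (∸-monoʳ-≤ n (n≤1+n l)) late))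

  module Extension (l : ℕ) (l<n : l < n) (IH : ∀ r → agreeCount g K r l ≡ agreeCount f K r l) where

    l≤n : l ≤ n
    l≤n = <⇒≤ l<n

    extensions : (ℕ → ℕ → ℕ) → (ℕ → ℕ) → ℕ → ℕ
    extensions X r d = count (λ m → agreeUpTo (path X m) r l ∧ (X (suc l) m ≡ᵇ d)) K

    agreeCount-split : ∀ {X} → PathFamily n h w X → ∀ r → agreeCount X K r l ≡ extensions X r (suc (r l)) + extensions X r (r l)
    agreeCount-split {X} FX r =
      trans (count-split K (λ m → agreeUpTo (path X m) r l) (λ m → X (suc l) m ≡ᵇ suc (r l)))
            (cong (extensions X r (suc (r l)) +_) (count-cong K _ _ not-rise⇒flat))
      where
      not-rise⇒flat : ∀ m → InRange K m
        → (agreeUpTo (path X m) r l ∧ not (X (suc l) m ≡ᵇ suc (r l))) ≡ (agreeUpTo (path X m) r l ∧ (X (suc l) m ≡ᵇ r l))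
      not-rise⇒flat m rm with agreeUpTo (path X m) r l in m≈r
      ... | false = refl
      ... | true with agreeUpTo-at (path X m) r l m≈r | PathFamily.step FX m rm l l<n
      ...   | at | inj₁ flat rewrite flat | at | ≡⇒≡ᵇ-true {r l} refl | ≢⇒≡ᵇ-false (v≢1+v (r l)) = refl
      ...   | at | inj₂ rise rewrite rise | at | ≡⇒≡ᵇ-true {r l} refl | ≢⇒≡ᵇ-false {suc (r l)} {r l} (λ e → v≢1+v (r l) (sym e)) = refl

    extensions≤edgeCount : ∀ {X} r d → extensions X r d ≤ edgeCount X K l (r l) d
    extensions≤edgeCount {X} r d = count-mono K _ _ λ m _ e →
      ∧-intro (≡⇒≡ᵇ-true (agreeUpTo-at (path X m) r l (∧-conicalˡ _ _ e))) (∧-conicalʳ (agreeUpTo (path X m) r l) _ e)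

    extensions≤agreeCount : ∀ {X} r d → extensions X r d ≤ agreeCount X K r l
    extensions≤agreeCount r d = count-mono K _ _ (λ m _ e → ∧-conicalˡ _ _ e)

    flat-≡-from-rise : ∀ r → extensions g r (suc (r l)) ≡ extensions f r (suc (r l)) → extensions g r (r l) ≡ extensions f r (r l)
    flat-≡-from-rise r rise = +-cancelˡ-≡ (extensions f r (suc (r l))) _ _
      (trans (cong (_+ extensions g r (r l)) (sym rise)) (trans (sym (agreeCount-split Fg r)) (trans (IH r) (agreeCount-split Ff r))))

    rise-≡-from-flat : ∀ r → extensions g r (r l) ≡ extensions f r (r l) → extensions g r (suc (r l)) ≡ extensions f r (suc (r l))
    rise-≡-from-flat r flat = +-cancelʳ-≡ (extensions f r (r l)) _ _
      (trans (cong (extensions g r (suc (r l)) +_) (sym flat)) (trans (sym (agreeCount-split Fg r)) (trans (IH r) (agreeCount-split Ff r))))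

    both-zero : ∀ {a b c} → a ≤ c → b ≤ c → c ≡ 0 → a ≡ b
    both-zero a≤c b≤c refl = trans (n≤0⇒n≡0 a≤c) (sym (n≤0⇒n≡0 b≤c))

    extensions-≡-from-rise : ∀ r → extensions g r (suc (r l)) ≡ extensions f r (suc (r l)) → ∀ d → extensions g r d ≡ extensions f r d
    extensions-≡-from-rise r rise d with d ≟ suc (r l) | d ≟ r l
    ... | yes refl | _        = rise
    ... | no _     | yes refl = flat-≡-from-rise r rise
    ... | no d≢1+v | no d≢v   =
      both-zero (≤-trans (extensions≤edgeCount r d) (≤-reflexive (edgeCount-non-step Fg l l<n (r l) d d≢v d≢1+v)))
                (≤-trans (extensions≤edgeCount r d) (≤-reflexive (edgeCount-non-step Ff l l<n (r l) d d≢v d≢1+v))) refl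

    edges-≡ : ∀ v d → edgeCount g K l v d ≡ edgeCount f K l v d
    edges-≡ = edgeCount-≡ Ff Fg l l<n (λ v → same l v l≤n) (λ v → same (suc l) v l<n)

    rise-≡-if-no-rising-edge : ∀ r → edgeCount f K l (r l) (suc (r l)) ≡ 0 → extensions g r (suc (r l)) ≡ extensions f r (suc (r l))
    rise-≡-if-no-rising-edge r none =
      both-zero (≤-trans (extensions≤edgeCount r _) (≤-reflexive (edges-≡ (r l) (suc (r l))))) (extensions≤edgeCount r _) none

    rise-≡-if-no-flat-edge : ∀ r → edgeCount f K l (r l) (r l) ≡ 0 → extensions g r (suc (r l)) ≡ extensions f r (suc (r l))
    rise-≡-if-no-flat-edge r none = rise-≡-from-flat r
      (both-zero (≤-trans (extensions≤edgeCount r _) (≤-reflexive (edges-≡ (r l) (r l)))) (extensions≤edgeCount r _) none)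

    rise-≡-if-no-agreement : ∀ r → agreeCount f K r l ≡ 0 → ∀ d → extensions g r d ≡ extensions f r d
    rise-≡-if-no-agreement r none d =
      both-zero (≤-trans (extensions≤agreeCount r d) (≤-reflexive (IH r))) (extensions≤agreeCount r d) none

    -- If all f-paths at height r l share one history, the g-paths at that height must all follow r as well, by counting.
    extensions-≡-if-common-history : ∀ r x → (∀ z → InRange K z → f l z ≡ r l → agreeUpTo (path f z) (path f x) l ≡ true) → ∀ d → extensions g r d ≡ extensions f r d
    extensions-≡-if-common-history r x common d with agreeUpTo r (path f x) l in r≈x
    ... | true = trans (extensions-at-height Fg g-follows) (trans (edges-≡ (r l) d) (sym (extensions-at-height Ff f-follows)))
      where
      at-height : ∀ {X} m → agreeUpTo (path X m) r l ≡ true → (X l m ≡ᵇ r l) ≡ true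
      at-height {X} m m≈r = ≡⇒≡ᵇ-true (agreeUpTo-at (path X m) r l m≈r)
      f-follows : ∀ m → InRange K m → agreeUpTo (path f m) r l ≡ (f l m ≡ᵇ r l)
      f-follows m rm = bool-ext (at-height {f} m) (λ e → agreeUpTo-trans _ _ _ l (common m rm (≡ᵇ-true⇒≡ e)) (agreeUpTo-sym _ _ l r≈x))
      g-follows : ∀ m → InRange K m → agreeUpTo (path g m) r l ≡ (g l m ≡ᵇ r l)
      g-follows m rm = bool-ext (at-height {g} m)
        (count-⊆-≡⇒⊇ K _ _ (λ m′ _ → at-height {g} m′)
                     (trans (IH r) (trans (count-cong K _ _ f-follows) (sym (same l (r l) l≤n)))) m rm)
      extensions-at-height : ∀ {X} → PathFamily n h w X → (∀ m → InRange K m → agreeUpTo (path X m) r l ≡ (X l m ≡ᵇ r l))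
        → extensions X r d ≡ edgeCount X K l (r l) d
      extensions-at-height {X} _ follows = count-cong K _ _ (λ m rm → cong (_∧ (X (suc l) m ≡ᵇ d)) (follows m rm))
    ... | false = rise-≡-if-no-agreement r (false⇒count≡0 K _ no-f-path) d
      where
      no-f-path : ∀ m → InRange K m → agreeUpTo (path f m) r l ≡ false
      no-f-path m rm = ¬true⇒false λ m≈r →
        true≢false (agreeUpTo-trans _ _ _ l (agreeUpTo-sym _ _ l m≈r) (common m rm (agreeUpTo-at _ _ l m≈r))) r≈x

    module SplittingPair (v x y : ℕ) (rx : InRange K x) (ry : InRange K y) (fx : f l x ≡ v) (ux : f (suc l) x ≡ suc v)
                         (fy : f l y ≡ v) (uy : f (suc l) y ≡ v) (x≉y : agreeUpTo (path f x) (path f y) l ≡ false) where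

      α β : ℕ → ℕ
      α = path f x
      β = path f y

      1+v≢v : suc v ≢ v
      1+v≢v e = v≢1+v v (sym e)

      x*≡y : star x ≡ y
      x*≡y with star x ≟ y
      ... | yes e = e
      ... | no x*≢y = ⊥-elim (1+v≢v (trans (sym ux) (trans (non-partners-stay-together l l<n x y rx ry x*≢y x≉y (trans fx (sym fy))) uy)))

      y*≡x : star y ≡ x
      y*≡x = trans (cong star (sym x*≡y)) (star-involutive x (proj₁ rx))

      late : n ∸ l ≤ l
      late = partners-rejoin-late l l<n x rx (subst (λ z → agreeUpTo α (path f z) l ≡ false) (sym x*≡y) x≉y)
                                  (trans fx (trans (sym fy) (cong (f l) (sym x*≡y))))
                                  (λ e → 1+v≢v (trans (sym ux) (trans e (trans (cong (f (suc l)) x*≡y) uy))))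

      ¬α∧β : ∀ p → agreeUpTo p α l ≡ true → agreeUpTo p β l ≡ true → ⊥
      ¬α∧β p p≈α p≈β = true≢false (agreeUpTo-trans _ _ _ l (agreeUpTo-sym _ _ l p≈α) p≈β) x≉y

      α⇒at-v : ∀ {X} m → agreeUpTo (path X m) α l ≡ true → X l m ≡ v
      α⇒at-v m m≈α = trans (agreeUpTo-at _ _ l m≈α) fx
      β⇒at-v : ∀ {X} m → agreeUpTo (path X m) β l ≡ true → X l m ≡ v
      β⇒at-v m m≈β = trans (agreeUpTo-at _ _ l m≈β) fy

      z*≢y : ∀ z → InRange K z → z ≢ x → star z ≢ y
      z*≢y z rz z≢x e = z≢x (star-injective z x (proj₁ rz) (proj₁ rx) (trans e (sym x*≡y)))
      z*≢x : ∀ z → InRange K z → z ≢ y → star z ≢ x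
      z*≢x z rz z≢y e = z≢y (trans (sym (star-involutive z (proj₁ rz))) (trans (cong star e) x*≡y))

      α-others-flat : ∀ z → InRange K z → z ≢ x → agreeUpTo (path f z) α l ≡ true → f (suc l) z ≡ v
      α-others-flat z rz z≢x z≈α = trans (non-partners-stay-together l l<n z y rz ry (z*≢y z rz z≢x)
                                            (¬true⇒false (¬α∧β _ z≈α)) (trans (α⇒at-v {f} z z≈α) (sym fy))) uy

      β-others-rise : ∀ z → InRange K z → z ≢ y → agreeUpTo (path f z) β l ≡ true → f (suc l) z ≡ suc v
      β-others-rise z rz z≢y z≈β = trans (non-partners-stay-together l l<n z x rz rx (z*≢x z rz z≢y)
                                            (¬true⇒false (λ z≈α → ¬α∧β _ z≈α z≈β)) (trans (β⇒at-v {f} z z≈β) (sym fx))) ux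

      at-v⇒α⊎β : ∀ z → InRange K z → f l z ≡ v → (agreeUpTo (path f z) α l ≡ true) ⊎ (agreeUpTo (path f z) β l ≡ true)
      at-v⇒α⊎β z rz fz with agreeUpTo (path f z) α l in z≈α | agreeUpTo (path f z) β l in z≈β
      ... | true  | _     = inj₁ refl
      ... | false | true  = inj₂ refl
      ... | false | false = ⊥-elim (1+v≢v (trans (sym rises) flat))
        where
        z≢x : z ≢ x
        z≢x refl = true≢false (agreeUpTo-refl α l) z≈α
        z≢y : z ≢ y
        z≢y refl = true≢false (agreeUpTo-refl β l) z≈β
        rises : f (suc l) z ≡ suc v
        rises = trans (non-partners-stay-together l l<n z x rz rx (z*≢x z rz z≢y) z≈α (trans fz (sym fx))) ux
        flat : f (suc l) z ≡ v
        flat = trans (non-partners-stay-together l l<n z y rz ry (z*≢y z rz z≢x) z≈β (trans fz (sym fy))) uy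

      α-rises-once : extensions f α (suc v) ≡ 1
      α-rises-once = unique-witness⇒count≡1 K _ x rx (∧-intro (agreeUpTo-refl α l) (≡⇒≡ᵇ-true ux)) only-x
        where
        only-x : ∀ m → InRange K m → (agreeUpTo (path f m) α l ∧ (f (suc l) m ≡ᵇ suc v)) ≡ true → m ≡ x
        only-x m rm e with m ≟ x
        ... | yes m≡x = m≡x
        ... | no m≢x  = ⊥-elim (1+v≢v (trans (sym (≡ᵇ-true⇒≡ (∧-conicalʳ (agreeUpTo (path f m) α l) _ e)))
                                             (α-others-flat m rm m≢x (∧-conicalˡ _ _ e))))

      β-flat-once : extensions f β v ≡ 1
      β-flat-once = unique-witness⇒count≡1 K _ y ry (∧-intro (agreeUpTo-refl β l) (≡⇒≡ᵇ-true uy)) only-y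
        where
        only-y : ∀ m → InRange K m → (agreeUpTo (path f m) β l ∧ (f (suc l) m ≡ᵇ v)) ≡ true → m ≡ y
        only-y m rm e with m ≟ y
        ... | yes m≡y = m≡y
        ... | no m≢y  = ⊥-elim (1+v≢v (trans (sym (β-others-rise m rm m≢y (∧-conicalˡ _ _ e)))
                                             (≡ᵇ-true⇒≡ (∧-conicalʳ (agreeUpTo (path f m) β l) _ e))))

      -- A flat α-path z and a rising β-path m would be non-partners that separate and meet again at l + 1.
      α-flat-or-β-rise-empty : (extensions f α v ≡ 0) ⊎ (extensions f β (suc v) ≡ 0)
      α-flat-or-β-rise-empty with extensions f α v ≟ 0
      ... | yes none = inj₁ none
      ... | no some with count≢0⇒witness K _ some
      ...   | z , rz , ez = inj₂ (false⇒count≡0 K _ no-β-rise)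
        where
        z≈α : agreeUpTo (path f z) α l ≡ true
        z≈α = ∧-conicalˡ _ _ ez
        z-flat : f (suc l) z ≡ v
        z-flat = ≡ᵇ-true⇒≡ (∧-conicalʳ (agreeUpTo (path f z) α l) _ ez)
        β-rise-impossible : ∀ m → InRange K m → (agreeUpTo (path f m) β l ∧ (f (suc l) m ≡ᵇ suc v)) ≡ true → ⊥
        β-rise-impossible m rm e = 1+v≢v (trans (sym m-rises) (trans (sym (non-partners-stay-together l l<n z m rz rm z*≢m z≉m
                                                                        (trans (α⇒at-v {f} z z≈α) (sym (β⇒at-v {f} m m≈β))))) z-flat))
          where
          m≈β : agreeUpTo (path f m) β l ≡ true
          m≈β = ∧-conicalˡ _ _ e
          m-rises : f (suc l) m ≡ suc v
          m-rises = ≡ᵇ-true⇒≡ (∧-conicalʳ (agreeUpTo (path f m) β l) _ e)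
          z*-flat : f (suc l) (star z) ≡ v
          z*-flat = trans (proj₂ (partner-determined Ff l l<n late x z rx rz z≈α)) (trans (cong (f (suc l)) x*≡y) uy)
          z*≢m : star z ≢ m
          z*≢m e′ = 1+v≢v (trans (sym m-rises) (trans (cong (f (suc l)) (sym e′)) z*-flat))
          z≉m : agreeUpTo (path f z) (path f m) l ≡ false
          z≉m = ¬true⇒false (λ z≈m → ¬α∧β _ (agreeUpTo-trans _ _ _ l (agreeUpTo-sym _ _ l z≈m) z≈α) m≈β)
        no-β-rise : ∀ m → InRange K m → (agreeUpTo (path f m) β l ∧ (f (suc l) m ≡ᵇ suc v)) ≡ false
        no-β-rise m rm = ¬true⇒false (β-rise-impossible m rm)

      at-v⇔α∨β : ∀ {X} → (∀ m → InRange K m → X l m ≡ v → (agreeUpTo (path X m) α l ≡ true) ⊎ (agreeUpTo (path X m) β l ≡ true))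
        → ∀ m → InRange K m → (X l m ≡ᵇ v) ≡ (agreeUpTo (path X m) α l ∨ agreeUpTo (path X m) β l)
      at-v⇔α∨β {X} α⊎β m rm = bool-ext (λ e → to (α⊎β m rm (≡ᵇ-true⇒≡ e))) (λ e → from (∨-elim e))
        where
        to : (agreeUpTo (path X m) α l ≡ true) ⊎ (agreeUpTo (path X m) β l ≡ true) → (agreeUpTo (path X m) α l ∨ agreeUpTo (path X m) β l) ≡ true
        to (inj₁ e) rewrite e = refl
        to (inj₂ e) rewrite e | ∨-zeroʳ (agreeUpTo (path X m) α l) = refl
        from : (agreeUpTo (path X m) α l ≡ true) ⊎ (agreeUpTo (path X m) β l ≡ true) → (X l m ≡ᵇ v) ≡ true
        from (inj₁ e) = ≡⇒≡ᵇ-true (α⇒at-v {X} m e)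
        from (inj₂ e) = ≡⇒≡ᵇ-true (β⇒at-v {X} m e)

      edgeCount-f-splits : ∀ d → edgeCount f K l v d ≡ extensions f α d + extensions f β d
      edgeCount-f-splits d =
        trans (count-cong K _ _ (λ m rm → trans (cong (_∧ (f (suc l) m ≡ᵇ d)) (at-v⇔α∨β {f} at-v⇒α⊎β m rm))
                                               (∧-distribʳ-∨ (f (suc l) m ≡ᵇ d) (agreeUpTo (path f m) α l) (agreeUpTo (path f m) β l))))
              (count-∨-disjoint K _ _ (λ m _ e₁ e₂ → ¬α∧β _ (∧-conicalˡ _ _ e₁) (∧-conicalˡ _ _ e₂)))

      g-extensions≤edgeCount : ∀ d → extensions g α d + extensions g β d ≤ edgeCount g K l v d
      g-extensions≤edgeCount d =
        ≤-trans (≤-reflexive (sym (count-∨-disjoint K _ _ (λ m _ e₁ e₂ → ¬α∧β _ (∧-conicalˡ _ _ e₁) (∧-conicalˡ _ _ e₂)))))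
                (count-mono K _ _ at-v)
        where
        at-v : ∀ m → InRange K m → ((agreeUpTo (path g m) α l ∧ (g (suc l) m ≡ᵇ d)) ∨ (agreeUpTo (path g m) β l ∧ (g (suc l) m ≡ᵇ d))) ≡ true
               → ((g l m ≡ᵇ v) ∧ (g (suc l) m ≡ᵇ d)) ≡ true
        at-v m rm e with ∨-elim e
        ... | inj₁ q = ∧-intro (≡⇒≡ᵇ-true (α⇒at-v {g} m (∧-conicalˡ _ _ q))) (∧-conicalʳ (agreeUpTo (path g m) α l) _ q)
        ... | inj₂ q = ∧-intro (≡⇒≡ᵇ-true (β⇒at-v {g} m (∧-conicalˡ _ _ q))) (∧-conicalʳ (agreeUpTo (path g m) β l) _ q)

      total-≡ : ∀ p → p l ≡ v → extensions g p (suc v) + extensions g p v ≡ extensions f p (suc v) + extensions f p v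
      total-≡ p refl = trans (sym (agreeCount-split Fg p)) (trans (IH p) (agreeCount-split Ff p))

      rising-edges : edgeCount g K l v (suc v) ≡ extensions f α (suc v) + extensions f β (suc v)
      rising-edges = trans (edges-≡ v (suc v)) (edgeCount-f-splits (suc v))
      flat-edges : edgeCount g K l v v ≡ extensions f α v + extensions f β v
      flat-edges = trans (edges-≡ v v) (edgeCount-f-splits v)

      partners⇒2≤edgeCount : ∀ d m → InRange K m → g l m ≡ v → g (suc l) m ≡ d → g l (star m) ≡ v → g (suc l) (star m) ≡ d
        → 2 ≤ edgeCount g K l v d
      partners⇒2≤edgeCount d m rm e₁ e₂ e₃ e₄ =
        two-witnesses⇒2≤count K _ m (star m) (λ e → star-≢ m (proj₁ rm) (sym e)) rm (star-inRange h m rm)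
                               (∧-intro (≡⇒≡ᵇ-true e₁) (≡⇒≡ᵇ-true e₂)) (∧-intro (≡⇒≡ᵇ-true e₃) (≡⇒≡ᵇ-true e₄))

      no-doubled-edge : ∀ z d → InRange K z → f l z ≡ v → f l (star z) ≡ v → f (suc l) (star z) ≡ d → edgeCount g K l v d ≡ 1
        → ∀ m → InRange K m → (agreeUpTo (path g m) (path f z) l ∧ (g (suc l) m ≡ᵇ d)) ≡ true → ⊥
      no-doubled-edge z d rz fz fz* uz* once m rm e =
        <-irrefl refl (≤-trans (partners⇒2≤edgeCount d m rm (trans (agreeUpTo-at _ _ l m≈z) fz) (≡ᵇ-true⇒≡ (∧-conicalʳ _ _ e))
                                                     (trans (proj₁ m*) fz*) (trans (proj₂ m*) uz*))
                               (≤-reflexive once))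
        where
        m≈z : agreeUpTo (path g m) (path f z) l ≡ true
        m≈z = ∧-conicalˡ _ _ e
        m* : (g l (star m) ≡ f l (star z)) × (g (suc l) (star m) ≡ f (suc l) (star z))
        m* = partner-determined Fg l l<n late z m rz rm m≈z

      -- In the second half a g-path following β (resp. α) drags its partner along x (resp. y),
      -- so making the empty move would double an edge that f uses only once.
      rise-≡-if-β-rise-empty : extensions f β (suc v) ≡ 0
        → (extensions g α (suc v) ≡ extensions f α (suc v)) × (extensions g β (suc v) ≡ extensions f β (suc v))
      rise-≡-if-β-rise-empty β↑≡0 = trans α↑≡1 (sym α-rises-once) , trans gβ↑≡0 (sym β↑≡0)
        where
        rises-once : edgeCount g K l v (suc v) ≡ 1
        rises-once = trans rising-edges (cong₂ _+_ α-rises-once β↑≡0)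
        gβ↑≡0 : extensions g β (suc v) ≡ 0
        gβ↑≡0 = false⇒count≡0 K _ λ m rm → ¬true⇒false (no-doubled-edge y (suc v) ry fy (trans (cong (f l) y*≡x) fx) (trans (cong (f (suc l)) y*≡x) ux) rises-once m rm)
        gβ→≡1 : extensions g β v ≡ 1
        gβ→≡1 = trans (sym (cong (_+ extensions g β v) gβ↑≡0)) (trans (total-≡ β fy) (cong₂ _+_ β↑≡0 β-flat-once))
        α↑≤1 : extensions g α (suc v) ≤ 1
        α↑≤1 = ≤-trans (≤-reflexive (sym (trans (cong (extensions g α (suc v) +_) gβ↑≡0) (+-identityʳ _))))
                       (≤-trans (g-extensions≤edgeCount (suc v)) (≤-reflexive rises-once))
        α→≤ : extensions g α v ≤ extensions f α v
        α→≤ = +-cancelʳ-≤ 1 _ _ (≤-trans (≤-reflexive (cong (extensions g α v +_) (sym gβ→≡1)))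
                                         (≤-trans (g-extensions≤edgeCount v) (≤-reflexive (trans flat-edges (cong (extensions f α v +_) β-flat-once)))))
        α↑≡1 : extensions g α (suc v) ≡ 1
        α↑≡1 = proj₁ (bounded-sum-≡ α↑≤1 α→≤ (trans (total-≡ α fx) (cong (_+ extensions f α v) α-rises-once)))

      rise-≡-if-α-flat-empty : extensions f α v ≡ 0
        → (extensions g α (suc v) ≡ extensions f α (suc v)) × (extensions g β (suc v) ≡ extensions f β (suc v))
      rise-≡-if-α-flat-empty α→≡0 = trans α↑≡1 (sym α-rises-once) , β↑≡
        where
        flat-once : edgeCount g K l v v ≡ 1
        flat-once = trans flat-edges (cong₂ _+_ α→≡0 β-flat-once)
        gα→≡0 : extensions g α v ≡ 0
        gα→≡0 = false⇒count≡0 K _ λ m rm → ¬true⇒false (no-doubled-edge x v rx fx (trans (cong (f l) x*≡y) fy) (trans (cong (f (suc l)) x*≡y) uy) flat-once m rm)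
        α↑≡1 : extensions g α (suc v) ≡ 1
        α↑≡1 = +-cancelʳ-≡ 0 _ _ (trans (cong (extensions g α (suc v) +_) (sym gα→≡0))
                                        (trans (total-≡ α fx) (cong₂ _+_ α-rises-once α→≡0)))
        β↑≤ : extensions g β (suc v) ≤ extensions f β (suc v)
        β↑≤ = +-cancelˡ-≤ 1 _ _ (≤-trans (≤-reflexive (cong (_+ extensions g β (suc v)) (sym α↑≡1)))
                                         (≤-trans (g-extensions≤edgeCount (suc v)) (≤-reflexive (trans rising-edges (cong (_+ extensions f β (suc v)) α-rises-once)))))
        β→≤1 : extensions g β v ≤ 1
        β→≤1 = ≤-trans (≤-reflexive (cong (_+ extensions g β v) (sym gα→≡0))) (≤-trans (g-extensions≤edgeCount v) (≤-reflexive flat-once))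
        β↑≡ : extensions g β (suc v) ≡ extensions f β (suc v)
        β↑≡ = proj₁ (bounded-sum-≡ β↑≤ β→≤1 (trans (total-≡ β fy) (cong (extensions f β (suc v) +_) β-flat-once)))

      rise-≡-on-α-β : (extensions g α (suc v) ≡ extensions f α (suc v)) × (extensions g β (suc v) ≡ extensions f β (suc v))
      rise-≡-on-α-β with α-flat-or-β-rise-empty
      ... | inj₁ α→≡0 = rise-≡-if-α-flat-empty α→≡0
      ... | inj₂ β↑≡0 = rise-≡-if-β-rise-empty β↑≡0

      extensions-cong : ∀ {X} r p → agreeUpTo r p l ≡ true → ∀ d → extensions X r d ≡ extensions X p d
      extensions-cong {X} r p r≈p d = count-cong K _ _ λ m rm → cong (_∧ (X (suc l) m ≡ᵇ d))
        (bool-ext (λ m≈r → agreeUpTo-trans _ _ _ l m≈r r≈p) (λ m≈p → agreeUpTo-trans _ _ _ l m≈p (agreeUpTo-sym _ _ l r≈p)))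

      rise-≡ : ∀ r → r l ≡ v → extensions g r (suc v) ≡ extensions f r (suc v)
      rise-≡ r rl≡v with agreeUpTo r α l in r≈α | agreeUpTo r β l in r≈β
      ... | true  | _    = trans (extensions-cong r α r≈α (suc v)) (trans (proj₁ rise-≡-on-α-β) (sym (extensions-cong r α r≈α (suc v))))
      ... | false | true = trans (extensions-cong r β r≈β (suc v)) (trans (proj₂ rise-≡-on-α-β) (sym (extensions-cong r β r≈β (suc v))))
      ... | false | false = subst (λ u → extensions g r (suc u) ≡ extensions f r (suc u)) rl≡v
                              (rise-≡-if-no-agreement r (false⇒count≡0 K _ no-f-path) (suc (r l)))
        where
        no-f-path : ∀ m → InRange K m → agreeUpTo (path f m) r l ≡ false
        no-f-path m rm = ¬true⇒false λ m≈r → [ (λ m≈α → true≢false (agreeUpTo-trans _ _ _ l (agreeUpTo-sym _ _ l m≈r) m≈α) r≈α)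
                                             , (λ m≈β → true≢false (agreeUpTo-trans _ _ _ l (agreeUpTo-sym _ _ l m≈r) m≈β) r≈β)
                                             ] (at-v⇒α⊎β m rm (trans (agreeUpTo-at _ _ l m≈r) rl≡v))

    splitting : ℕ → ℕ → ℕ → Bool
    splitting v x y = (f l x ≡ᵇ v) ∧ (f (suc l) x ≡ᵇ suc v) ∧ (f l y ≡ᵇ v) ∧ (f (suc l) y ≡ᵇ v) ∧ not (agreeUpTo (path f x) (path f y) l)

    ¬splitting⇒agree : ∀ v x y → f l x ≡ v → f (suc l) x ≡ suc v → f l y ≡ v → f (suc l) y ≡ v → splitting v x y ≡ false
      → agreeUpTo (path f x) (path f y) l ≡ true
    ¬splitting⇒agree v x y fx ux fy uy ¬split with agreeUpTo (path f x) (path f y) l in x≈y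
    ... | true  = refl
    ... | false = ⊥-elim (true≢false (∧-intro (≡⇒≡ᵇ-true fx) (∧-intro (≡⇒≡ᵇ-true ux) (∧-intro (≡⇒≡ᵇ-true fy) (∧-intro (≡⇒≡ᵇ-true uy) refl)))) ¬split)

    splitting⇒ : ∀ v x y → splitting v x y ≡ true
      → f l x ≡ v × f (suc l) x ≡ suc v × f l y ≡ v × f (suc l) y ≡ v × agreeUpTo (path f x) (path f y) l ≡ false
    splitting⇒ v x y split with f l x ≡ᵇ v in fx | f (suc l) x ≡ᵇ suc v in ux | f l y ≡ᵇ v in fy | f (suc l) y ≡ᵇ v in uy
                              | agreeUpTo (path f x) (path f y) l in x≈y
    splitting⇒ v x y refl | true | true | true | true | false = ≡ᵇ-true⇒≡ fx , ≡ᵇ-true⇒≡ ux , ≡ᵇ-true⇒≡ fy , ≡ᵇ-true⇒≡ uy , refl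

    rise-≡-if-splitting : ∀ r x y → InRange K x → InRange K y → splitting (r l) x y ≡ true
      → extensions g r (suc (r l)) ≡ extensions f r (suc (r l))
    rise-≡-if-splitting r x y rx ry split with splitting⇒ (r l) x y split
    ... | fx , ux , fy , uy , x≉y = SplittingPair.rise-≡ (r l) x y rx ry fx ux fy uy x≉y r refl

    rise-≡ : ∀ r → extensions g r (suc (r l)) ≡ extensions f r (suc (r l))
    rise-≡ r with edgeCount f K l (r l) (suc (r l)) ≟ 0 | edgeCount f K l (r l) (r l) ≟ 0
    ... | yes none | _        = rise-≡-if-no-rising-edge r none
    ... | no _     | yes none = rise-≡-if-no-flat-edge r none
    ... | no some↑ | no some→ with count≢0⇒witness K _ some↑ | count≢0⇒witness K _ some→
    ...   | x , rx , ex | y , ry , ey with search² K (splitting (r l))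
    ...     | inj₁ (x′ , y′ , rx′ , ry′ , split) = rise-≡-if-splitting r x′ y′ rx′ ry′ split
    ...     | inj₂ none = extensions-≡-if-common-history r x common (suc (r l))
      where
      fx : f l x ≡ r l
      fx = ≡ᵇ-true⇒≡ (∧-conicalˡ _ _ ex)
      ux : f (suc l) x ≡ suc (r l)
      ux = ≡ᵇ-true⇒≡ (∧-conicalʳ (f l x ≡ᵇ r l) _ ex)
      fy : f l y ≡ r l
      fy = ≡ᵇ-true⇒≡ (∧-conicalˡ _ _ ey)
      uy : f (suc l) y ≡ r l
      uy = ≡ᵇ-true⇒≡ (∧-conicalʳ (f l y ≡ᵇ r l) _ ey)
      x≈y : agreeUpTo (path f x) (path f y) l ≡ true
      x≈y = ¬splitting⇒agree (r l) x y fx ux fy uy (none x y rx ry)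
      common : ∀ z → InRange K z → f l z ≡ r l → agreeUpTo (path f z) (path f x) l ≡ true
      common z rz fz with PathFamily.step Ff z rz l l<n
      ... | inj₁ flat = agreeUpTo-sym _ _ l (¬splitting⇒agree (r l) x z fx ux fz (trans flat fz) (none x z rx rz))
      ... | inj₂ rise = agreeUpTo-trans _ _ _ l (¬splitting⇒agree (r l) z y fz (trans rise (cong suc fz)) fy uy (none z y rz ry))
                                                (agreeUpTo-sym _ _ l x≈y)

    agreeCount-step : ∀ r → agreeCount g K r (suc l) ≡ agreeCount f K r (suc l)
    agreeCount-step r = extensions-≡-from-rise r (rise-≡ r) (r (suc l))

  agreeCount-≡ : ∀ l → l ≤ n → ∀ r → agreeCount g K r l ≡ agreeCount f K r l
  agreeCount-≡ zero    _     r = count-cong K _ _ λ m rm → cong (_≡ᵇ r 0) (trans (PathFamily.start Fg m rm) (sym (PathFamily.start Ff m rm)))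
  agreeCount-≡ (suc l) l+1≤n r = Extension.agreeCount-step l l+1≤n (agreeCount-≡ l (≤-trans (n≤1+n l) l+1≤n)) r

module Relabelling where

  open import Data.Nat
  open import Data.Nat.Properties
  open import Data.Bool using (Bool; true; false)
  open import Data.List using ([]; _∷_)
  open import Data.List.Relation.Unary.All using ([]; _∷_)
  open import Data.List.Relation.Unary.Unique.Propositional using ([]; _∷_)
  open import Data.List.Relation.Unary.Any using (here; there)
  open import Data.Product using (_×_; _,_)
  open import Data.Sum using (_⊎_; inj₁; inj₂)
  open import Data.Empty using (⊥-elim)
  open import Relation.Nullary using (yes; no)
  open import Relation.Binary.PropositionalEquality
  open import Algebra.Properties.CommutativeSemigroup +-commutativeSemigroup using (x∙yz≈y∙xz)

  transpose : ℕ → ℕ → ℕ → ℕ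
  transpose a b m with m ≟ a
  ... | yes _ = b
  ... | no _ with m ≟ b
  ...   | yes _ = a
  ...   | no _  = m

  transpose-a : ∀ a b → transpose a b a ≡ b
  transpose-a a b with a ≟ a
  ... | yes _  = refl
  ... | no a≢a = ⊥-elim (a≢a refl)

  transpose-b : ∀ a b → a ≢ b → transpose a b b ≡ a
  transpose-b a b a≢b with b ≟ a
  ... | yes b≡a = ⊥-elim (a≢b (sym b≡a))
  ... | no _ with b ≟ b
  ...   | yes _  = refl
  ...   | no b≢b = ⊥-elim (b≢b refl)

  transpose-other : ∀ a b m → m ≢ a → m ≢ b → transpose a b m ≡ m
  transpose-other a b m m≢a m≢b with m ≟ a
  ... | yes m≡a = ⊥-elim (m≢a m≡a)
  ... | no _ with m ≟ b
  ...   | yes m≡b = ⊥-elim (m≢b m≡b)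
  ...   | no _    = refl

  transpose-cases : ∀ a b m → (m ≡ a × transpose a b m ≡ b) ⊎ (m ≢ a × m ≡ b × transpose a b m ≡ a)
                              ⊎ (m ≢ a × m ≢ b × transpose a b m ≡ m)
  transpose-cases a b m with m ≟ a
  ... | yes m≡a = inj₁ (m≡a , refl)
  ... | no m≢a with m ≟ b
  ...   | yes m≡b = inj₂ (inj₁ (m≢a , m≡b , refl))
  ...   | no m≢b  = inj₂ (inj₂ (m≢a , m≢b , refl))

  transpose-comm : ∀ a b m → a ≢ b → transpose a b m ≡ transpose b a m
  transpose-comm a b m a≢b with transpose-cases a b m
  ... | inj₁ (refl , e)               = trans e (sym (transpose-b b m (λ e′ → a≢b (sym e′))))
  ... | inj₂ (inj₁ (_ , refl , e))    = trans e (sym (transpose-a m a))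
  ... | inj₂ (inj₂ (m≢a , m≢b , e))   = trans e (sym (transpose-other b a m m≢b m≢a))

  transpose-inRange : ∀ K a b m → InRange K a → InRange K b → InRange K m → InRange K (transpose a b m)
  transpose-inRange K a b m ra rb rm with transpose-cases a b m
  ... | inj₁ (_ , e)               rewrite e = rb
  ... | inj₂ (inj₁ (_ , _ , e))    rewrite e = ra
  ... | inj₂ (inj₂ (_ , _ , e))    rewrite e = rm

  star-transpose : ∀ a b m → 1 ≤ a → 1 ≤ b → 1 ≤ m → a ≢ b → star (transpose a b m) ≡ transpose (star a) (star b) (star m)
  star-transpose a b m 1≤a 1≤b 1≤m a≢b with transpose-cases a b m
  ... | inj₁ (refl , e) rewrite e | transpose-a (star m) (star b) = refl
  ... | inj₂ (inj₁ (m≢a , refl , e))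
    rewrite e | transpose-b (star a) (star m) (λ q → a≢b (star-injective a m 1≤a 1≤m q)) = refl
  ... | inj₂ (inj₂ (m≢a , m≢b , e))
    rewrite e | transpose-other (star a) (star b) (star m) (λ q → m≢a (star-injective m a 1≤m 1≤a q))
                                                           (λ q → m≢b (star-injective m b 1≤m 1≤b q)) = refl

  transposeIf : Bool → ℕ → ℕ → ℕ → ℕ
  transposeIf true  a b m = transpose a b m
  transposeIf false a b m = m

  transposeIf-inRange : ∀ K c a b m → InRange K a → InRange K b → InRange K m → InRange K (transposeIf c a b m)
  transposeIf-inRange K true  a b m ra rb rm = transpose-inRange K a b m ra rb rm
  transposeIf-inRange K false a b m ra rb rm = rm

  transposeIf-other : ∀ c a b m → m ≢ a → m ≢ b → transposeIf c a b m ≡ m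
  transposeIf-other true  a b m m≢a m≢b = transpose-other a b m m≢a m≢b
  transposeIf-other false a b m m≢a m≢b = refl

  transposeIf-pair : ∀ c a b m → (m ≡ a) ⊎ (m ≡ b) → (transposeIf c a b m ≡ a) ⊎ (transposeIf c a b m ≡ b)
  transposeIf-pair false a b m m∈ab = m∈ab
  transposeIf-pair true  a b m (inj₁ refl) = inj₂ (transpose-a m b)
  transposeIf-pair true  a b m (inj₂ refl) with a ≟ m
  ... | yes refl = inj₁ (transpose-a a a)
  ... | no a≢m   = inj₁ (transpose-b a m a≢m)

  transposeIf-≡-at : ∀ (X : ℕ → ℕ → ℕ) t a b → X t a ≡ X t b → ∀ c m → X t (transposeIf c a b m) ≡ X t m
  transposeIf-≡-at X t a b e false m = refl
  transposeIf-≡-at X t a b e true  m with transpose-cases a b m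
  ... | inj₁ (refl , q)            rewrite q = sym e
  ... | inj₂ (inj₁ (_ , refl , q)) rewrite q = e
  ... | inj₂ (inj₂ (_ , _ , q))    rewrite q = refl

  count-transposeIf : ∀ K (P : ℕ → Bool) c a b → InRange K a → InRange K b → a ≢ b
    → count (λ m → P (transposeIf c a b m)) K ≡ count P K
  count-transposeIf K P false a b ra rb a≢b = refl
  count-transposeIf K P true  a b ra rb a≢b =
    +-cancelʳ-≡ (countOn P (a ∷ b ∷ [])) _ _ (trans
      (count-local K (λ m → P (transpose a b m)) P (a ∷ b ∷ []) (ra ∷ rb ∷ []) ((a≢b ∷ []) ∷ [] ∷ [])
                   (λ m _ m∉ → cong P (transpose-other a b m (λ e → m∉ (here e)) (λ e → m∉ (there (here e))))))
      (cong (count P K +_) swapped))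
    where
    swapped : countOn (λ m → P (transpose a b m)) (a ∷ b ∷ []) ≡ countOn P (a ∷ b ∷ [])
    swapped rewrite transpose-a a b | transpose-b a b a≢b = x∙yz≈y∙xz (bit (P b)) (bit (P a)) 0

  module Relabel {n h w : ℕ} {f : ℕ → ℕ → ℕ} (Ff : PathFamily n h w f) (σ : ℕ → ℕ → ℕ)
    (σ-inRange : ∀ l m → InRange (2 * h) m → InRange (2 * h) (σ l m))
    (σ-step : ∀ i → i < n → ∀ m → InRange (2 * h) m
            → (σ (suc i) m ≡ σ i m) ⊎ (f i (σ i m) ≡ f i (σ (suc i) m)) ⊎ (f (suc i) (σ i m) ≡ f (suc i) (σ (suc i) m)))
    (σ-star : ∀ i → i ≤ n → ∀ m → InRange (2 * h) m → σ i (star m) ≡ star (σ (n ∸ i) m)) where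

    relabelled : ℕ → ℕ → ℕ
    relabelled l m = f l (σ l m)

    relabelled-family : PathFamily n h w relabelled
    relabelled-family = record
      { start  = λ m r → PathFamily.start Ff (σ 0 m) (σ-inRange 0 m r)
      ; step   = step
      ; end    = λ m r → PathFamily.end Ff (σ n m) (σ-inRange n m r)
      ; mirror = mirror }
      where
      step : ∀ m → InRange (2 * h) m → ∀ i → i < n → Step (relabelled i m) (relabelled (suc i) m)
      step m r i i<n with σ-step i i<n m r
      ... | inj₁ same rewrite same = PathFamily.step Ff (σ i m) (σ-inRange i m r) i i<n
      ... | inj₂ (inj₁ meet) with PathFamily.step Ff (σ (suc i) m) (σ-inRange (suc i) m r) i i<n
      ...   | inj₁ flat = inj₁ (trans flat (sym meet))
      ...   | inj₂ rise = inj₂ (trans rise (cong suc (sym meet)))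
      step m r i i<n | inj₂ (inj₂ meet) with PathFamily.step Ff (σ i m) (σ-inRange i m r) i i<n
      ...   | inj₁ flat = inj₁ (trans (sym meet) flat)
      ...   | inj₂ rise = inj₂ (trans (sym meet) rise)
      mirror : ∀ m → InRange (2 * h) m → ∀ i → i ≤ n → relabelled i (star m) + relabelled (n ∸ i) m ≡ w
      mirror m r i i≤n rewrite σ-star i i≤n m r = PathFamily.mirror Ff (σ (n ∸ i) m) (σ-inRange (n ∸ i) m r) i i≤n

open Relabelling

module Necessity {n h w : ℕ} {f : ℕ → ℕ → ℕ} (Ff : PathFamily n h w f)
  (rigid : ∀ f′ → PathFamily n h w f′ → (∀ l v → l ≤ n → levelCount f′ (2 * h) l v ≡ levelCount f (2 * h) l v)
         → ∀ m → InRange (2 * h) m → agreeCount f′ (2 * h) (path f m) n ≡ agreeCount f (2 * h) (path f m) n) where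

  open import Data.Nat
  open import Data.Nat.Properties
  open import Data.Bool using (Bool; true; false; _∧_; _∨_; T)
  open import Data.Bool.Properties using (∨-comm; ∧-conicalˡ; ∧-conicalʳ) renaming (_≟_ to _≟ᴮ_)
  open import Data.List using (List; []; _∷_)
  open import Data.List.Membership.Propositional using (_∈_; _∉_)
  open import Data.List.Relation.Unary.All using (All; []; _∷_)
  open import Data.List.Relation.Unary.Any using (here; there)
  open import Data.List.Relation.Unary.Unique.Propositional using (Unique; []; _∷_)
  open import Data.Product using (_×_; _,_; Σ; proj₁; proj₂)
  open import Data.Product.Properties using () renaming (≡-dec to ≡-dec²)
  open import Data.Sum using (_⊎_; inj₁; inj₂)
  open import Data.Empty using (⊥; ⊥-elim)
  open import Relation.Nullary using (¬_; yes; no)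
  open import Relation.Nullary.Decidable using (_×-dec_; dec-true; dec-false)
  open import Relation.Binary using (tri<; tri≈; tri>)
  open import Relation.Binary.PropositionalEquality

  private
    K : ℕ
    K = 2 * h

  agrees-with : (ℕ → ℕ → ℕ) → ℕ → ℕ → Bool
  agrees-with X p m = agreeUpTo (path X m) (path f p) n

  agreement-on : ∀ f′ → PathFamily n h w f′ → (∀ l v → l ≤ n → levelCount f′ K l v ≡ levelCount f K l v)
    → ∀ S → All (InRange K) S → Unique S → (∀ m → InRange K m → m ∉ S → ∀ i → f′ i m ≡ f i m)
    → ∀ p → InRange K p → countOn (agrees-with f′ p) S ≡ countOn (agrees-with f p) S
  agreement-on f′ F′ same S rS uS outside p rp =
    count-≡⇒countOn-≡ K _ _ S rS uS (λ m rm m∉S → agreeUpTo-congˡ _ _ _ n (λ i _ → outside m rm m∉S i)) (rigid f′ F′ same p rp)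

  meet-outside : ∀ a b t → InRange K a → InRange K b → t ≤ n → ¬ InD n f a b t → f t a ≡ f t b
  meet-outside a b t ra rb = Intervals.¬D⇒≡ n f a b (trans (PathFamily.start Ff a ra) (sym (PathFamily.start Ff b rb))) t

  -- Swapping m₁ and m₁* on a maximal interval I and on its mirror image changes no level count,
  -- but a discrepancy outside both makes m₁'s history disappear.
  module PartnerSwap (m₁ : ℕ) (rm₁ : InRange K m₁) (a₁ b₁ : ℕ) (I : MaxInterval n f m₁ (star m₁) (a₁ , b₁))
                     (d : ℕ) (Dd : InD n f m₁ (star m₁) d) (d∉I : ¬ (a₁ ≤ d × d ≤ b₁)) (n-d∉I : ¬ (a₁ ≤ n ∸ d × n ∸ d ≤ b₁)) where

    open Intervals n f m₁ (star m₁)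

    m₁* : ℕ
    m₁* = star m₁
    rm₁* : InRange K m₁*
    rm₁* = star-inRange h m₁ rm₁
    m₁≢m₁* : m₁ ≢ m₁*
    m₁≢m₁* e = star-≢ m₁ (proj₁ rm₁) (sym e)

    inI : ℕ → Bool
    inI x = (a₁ ≤ᵇ x) ∧ (x ≤ᵇ b₁)

    inI⇒ : ∀ x → inI x ≡ true → a₁ ≤ x × x ≤ b₁
    inI⇒ x e = ≤ᵇ⇒≤ a₁ x (subst T (sym (∧-conicalˡ _ _ e)) _) , ≤ᵇ⇒≤ x b₁ (subst T (sym (∧-conicalʳ (a₁ ≤ᵇ x) _ e)) _)

    ⇒inI : ∀ x → a₁ ≤ x → x ≤ b₁ → inI x ≡ true
    ⇒inI x a₁≤x x≤b₁ = ∧-intro (T⇒≡true (≤⇒≤ᵇ a₁≤x)) (T⇒≡true (≤⇒≤ᵇ x≤b₁))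
      where
      T⇒≡true : ∀ {b} → T b → b ≡ true
      T⇒≡true {true} _ = refl

    ¬⇒inI-false : ∀ x → ¬ (a₁ ≤ x × x ≤ b₁) → inI x ≡ false
    ¬⇒inI-false x x∉I = ¬true⇒false (λ e → x∉I (inI⇒ x e))

    swapped : ℕ → Bool
    swapped l = inI l ∨ inI (n ∸ l)

    σ : ℕ → ℕ → ℕ
    σ l m = transposeIf (swapped l) m₁ m₁* m

    Meet : ℕ → Set
    Meet t = f t m₁ ≡ f t m₁*

    meet-at-end : Meet n
    meet-at-end = trans (PathFamily.end Ff m₁ rm₁) (sym (PathFamily.end Ff m₁* rm₁*))

    b₁<n : b₁ < n
    b₁<n with m≤n⇒m<n∨m≡n (end≤n I)
    ... | inj₁ b₁<n = b₁<n
    ... | inj₂ refl = ⊥-elim (proj₂ (proj₂ (inside I b₁ (start≤end I) ≤-refl)) meet-at-end)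

    meet-before : Meet (a₁ ∸ 1)
    meet-before = meet-outside m₁ m₁* (a₁ ∸ 1) rm₁ rm₁* (≤-trans (m∸n≤m a₁ 1) (≤-trans (start≤end I) (end≤n I))) (¬D-before I)

    meet-after : Meet (suc b₁)
    meet-after = meet-outside m₁ m₁* (suc b₁) rm₁ rm₁* b₁<n (¬D-after I)

    meet-mirror : ∀ t → t ≤ n → Meet (n ∸ t) → Meet t
    meet-mirror t t≤n e = trans (cong (f t) (sym (star-involutive m₁ (proj₁ rm₁))))
                                (partner-≡ Ff Ff m₁* m₁ rm₁* rm₁ t t≤n (sym e))

    inI-changes⇒meet : ∀ x → inI (suc x) ≢ inI x → Meet x ⊎ Meet (suc x)
    inI-changes⇒meet x ne with inI (suc x) in e₁ | inI x in e₂
    ... | true  | true  = ⊥-elim (ne refl)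
    ... | false | false = ⊥-elim (ne refl)
    ... | true  | false = inj₁ (subst Meet (cong (_∸ 1) a₁≡x+1) meet-before)
      where
      a₁≡x+1 : a₁ ≡ suc x
      a₁≡x+1 with a₁ ≤? x
      ... | yes a₁≤x = ⊥-elim (true≢false (⇒inI x a₁≤x (≤-trans (n≤1+n x) (proj₂ (inI⇒ (suc x) e₁)))) e₂)
      ... | no a₁≰x  = ≤-antisym (proj₁ (inI⇒ (suc x) e₁)) (≰⇒> a₁≰x)
    ... | false | true  = inj₂ (subst Meet (cong suc b₁≡x) meet-after)
      where
      b₁≡x : b₁ ≡ x
      b₁≡x with suc x ≤? b₁
      ... | yes x<b₁ = ⊥-elim (true≢false (⇒inI (suc x) (≤-trans (proj₁ (inI⇒ x e₂)) (n≤1+n x)) x<b₁) e₁)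
      ... | no x≮b₁  = ≤-antisym (≤-pred (≰⇒> x≮b₁)) (proj₂ (inI⇒ x e₂))

    swapped-changes⇒meet : ∀ i → i < n → swapped (suc i) ≢ swapped i → Meet i ⊎ Meet (suc i)
    swapped-changes⇒meet i i<n ne with inI (suc i) ≟ᴮ inI i
    ... | no changes = inI-changes⇒meet i changes
    ... | yes same with inI-changes⇒meet (n ∸ suc i) mirror-changes
      where
      mirror-changes : inI (suc (n ∸ suc i)) ≢ inI (n ∸ suc i)
      mirror-changes e = ne (cong₂ _∨_ same (sym (trans (cong inI (+-∸-assoc 1 i<n)) e)))
    ...   | inj₁ e = inj₂ (meet-mirror (suc i) i<n e)
    ...   | inj₂ e = inj₁ (meet-mirror i (<⇒≤ i<n) (subst Meet (sym (+-∸-assoc 1 i<n)) e))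

    σ-inRange : ∀ l m → InRange K m → InRange K (σ l m)
    σ-inRange l m r = transposeIf-inRange K (swapped l) m₁ m₁* m rm₁ rm₁* r

    σ-step : ∀ i → i < n → ∀ m → InRange K m
      → (σ (suc i) m ≡ σ i m) ⊎ (f i (σ i m) ≡ f i (σ (suc i) m)) ⊎ (f (suc i) (σ i m) ≡ f (suc i) (σ (suc i) m))
    σ-step i i<n m r with swapped (suc i) ≟ᴮ swapped i
    ... | yes same = inj₁ (cong (λ c → transposeIf c m₁ m₁* m) same)
    ... | no changes with swapped-changes⇒meet i i<n changes
    ...   | inj₁ e = inj₂ (inj₁ (trans (transposeIf-≡-at f i m₁ m₁* e (swapped i) m) (sym (transposeIf-≡-at f i m₁ m₁* e (swapped (suc i)) m))))
    ...   | inj₂ e = inj₂ (inj₂ (trans (transposeIf-≡-at f (suc i) m₁ m₁* e (swapped i) m)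
                                       (sym (transposeIf-≡-at f (suc i) m₁ m₁* e (swapped (suc i)) m))))

    swapped-mirror : ∀ i → i ≤ n → swapped i ≡ swapped (n ∸ i)
    swapped-mirror i i≤n = trans (∨-comm (inI i) (inI (n ∸ i))) (cong (λ z → inI (n ∸ i) ∨ inI z) (sym (m∸[m∸n]≡n i≤n)))

    σ-star : ∀ i → i ≤ n → ∀ m → InRange K m → σ i (star m) ≡ star (σ (n ∸ i) m)
    σ-star i i≤n m r rewrite sym (swapped-mirror i i≤n) = commutes (swapped i)
      where
      commutes : ∀ c → transposeIf c m₁ m₁* (star m) ≡ star (transposeIf c m₁ m₁* m)
      commutes false = refl
      commutes true  = sym (trans (star-transpose m₁ m₁* m (proj₁ rm₁) (proj₁ rm₁*) (proj₁ r) m₁≢m₁*)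
                                  (trans (cong (λ z → transpose m₁* z (star m)) (star-involutive m₁ (proj₁ rm₁)))
                                         (transpose-comm m₁* m₁ (star m) (λ e → m₁≢m₁* (sym e)))))

    open Relabel Ff σ σ-inRange σ-step σ-star

    same-levels : ∀ l v → l ≤ n → levelCount relabelled K l v ≡ levelCount f K l v
    same-levels l v _ = count-transposeIf K (λ m → f l m ≡ᵇ v) (swapped l) m₁ m₁* rm₁ rm₁* m₁≢m₁*

    contradiction : ⊥
    contradiction with countOn≢0⇒witness (agrees-with relabelled m₁) (m₁ ∷ m₁* ∷ []) relabelled-count≢0
      where
      unchanged : ∀ m → InRange K m → m ∉ m₁ ∷ m₁* ∷ [] → ∀ i → relabelled i m ≡ f i m
      unchanged m _ m∉ i = cong (f i) (transposeIf-other (swapped i) m₁ m₁* m (λ e → m∉ (here e)) (λ e → m∉ (there (here e))))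
      f-count≢0 : countOn (agrees-with f m₁) (m₁ ∷ m₁* ∷ []) ≢ 0
      f-count≢0 e = 1+n≢0 (trans (sym (cong (λ b → bit b + countOn (agrees-with f m₁) (m₁* ∷ [])) (agreeUpTo-refl (path f m₁) n))) e)
      relabelled-count≢0 : countOn (agrees-with relabelled m₁) (m₁ ∷ m₁* ∷ []) ≢ 0
      relabelled-count≢0 e = f-count≢0 (trans (sym (agreement-on relabelled relabelled-family same-levels (m₁ ∷ m₁* ∷ [])
                                                                  (rm₁ ∷ rm₁* ∷ []) ((m₁≢m₁* ∷ []) ∷ [] ∷ []) unchanged m₁ rm₁)) e)
    ... | .m₁ , here refl , agrees =
      true≢false agrees (≢⇒¬agreeUpTo _ _ n a₁ (≤-trans (start≤end I) (end≤n I)) λ e →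
        proj₂ (proj₂ (inside I a₁ ≤-refl (start≤end I)))
              (sym (trans (cong (f a₁) (sym (trans (cong (λ c → transposeIf c m₁ m₁* m₁) swapped-a₁) (transpose-a m₁ m₁*)))) e)))
      where
      swapped-a₁ : swapped a₁ ≡ true
      swapped-a₁ rewrite ⇒inI a₁ ≤-refl (start≤end I) = refl
    ... | .m₁* , there (here refl) , agrees =
      true≢false agrees (≢⇒¬agreeUpTo _ _ n d (proj₁ (proj₂ Dd)) λ e →
        proj₂ (proj₂ Dd) (sym (trans (cong (f d) (sym (cong (λ c → transposeIf c m₁ m₁* m₁*) swapped-d))) e)))
      where
      swapped-d : swapped d ≡ false
      swapped-d rewrite ¬⇒inI-false d d∉I | ¬⇒inI-false (n ∸ d) n-d∉I = refl

  history-moves : ∀ f′ → PathFamily n h w f′ → (∀ l v → l ≤ n → levelCount f′ K l v ≡ levelCount f K l v)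
    → ∀ S → All (InRange K) S → Unique S → (∀ m → InRange K m → m ∉ S → ∀ i → f′ i m ≡ f i m)
    → ∀ p → InRange K p → p ∈ S → Σ ℕ (λ s → s ∈ S × agrees-with f′ p s ≡ true)
  history-moves f′ F′ same S rS uS outside p rp p∈S =
    countOn≢0⇒witness (agrees-with f′ p) S (λ e →
      ∈⇒countOn≢0 (agrees-with f p) S p∈S (agreeUpTo-refl (path f p) n) (trans (sym (agreement-on f′ F′ same S rS uS outside p rp)) e))

  -- With i₀ < k < j a gap of non-partners m₁, m₂, exchange m₁ and m₂ above level k, and m₁*, m₂* at the mirrored levels.
  -- The histories of m₁ and m₂ then have to reappear on m₁* and m₂*, which mirror symmetry rules out.
  module NonPartnerSwap (m₁ m₂ : ℕ) (rm₁ : InRange K m₁) (rm₂ : InRange K m₂) (m₁*≢m₂ : star m₁ ≢ m₂)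
      (i₀ k j : ℕ) (i₀<k : i₀ < k) (k<j : k < j) (j≤n : j ≤ n)
      (differ-i₀ : f i₀ m₁ ≢ f i₀ m₂) (meet-k : f k m₁ ≡ f k m₂) (differ-j : f j m₁ ≢ f j m₂) where

    m₁* m₂* : ℕ
    m₁* = star m₁
    m₂* = star m₂
    rm₁* : InRange K m₁*
    rm₁* = star-inRange h m₁ rm₁
    rm₂* : InRange K m₂*
    rm₂* = star-inRange h m₂ rm₂

    m₁≢m₂ : m₁ ≢ m₂
    m₁≢m₂ refl = differ-i₀ refl
    m₁≢m₁* : m₁ ≢ m₁*
    m₁≢m₁* e = star-≢ m₁ (proj₁ rm₁) (sym e)
    m₂≢m₂* : m₂ ≢ m₂*
    m₂≢m₂* e = star-≢ m₂ (proj₁ rm₂) (sym e)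
    m₁≢m₂* : m₁ ≢ m₂*
    m₁≢m₂* e = m₁*≢m₂ (trans (cong star e) (star-involutive m₂ (proj₁ rm₂)))
    m₂≢m₁* : m₂ ≢ m₁*
    m₂≢m₁* e = m₁*≢m₂ (sym e)
    m₁*≢m₂* : m₁* ≢ m₂*
    m₁*≢m₂* e = m₁≢m₂ (star-injective m₁ m₂ (proj₁ rm₁) (proj₁ rm₂) e)

    k≤n : k ≤ n
    k≤n = ≤-trans (<⇒≤ k<j) j≤n
    i₀≤n : i₀ ≤ n
    i₀≤n = ≤-trans (<⇒≤ i₀<k) k≤n

    above : ℕ → Bool
    above l = k <ᵇ l
    mirrored-above : ℕ → Bool
    mirrored-above l = k <ᵇ (n ∸ l)

    σ : ℕ → ℕ → ℕ
    σ l m = transposeIf (above l) m₁ m₂ (transposeIf (mirrored-above l) m₁* m₂* m)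

    σ-on-pair : ∀ l m → (m ≡ m₁) ⊎ (m ≡ m₂) → σ l m ≡ transposeIf (above l) m₁ m₂ m
    σ-on-pair l m (inj₁ refl) = cong (transposeIf (above l) m₁ m₂) (transposeIf-other (mirrored-above l) m₁* m₂* m m₁≢m₁* m₁≢m₂*)
    σ-on-pair l m (inj₂ refl) = cong (transposeIf (above l) m₁ m₂) (transposeIf-other (mirrored-above l) m₁* m₂* m m₂≢m₁* m₂≢m₂*)

    σ-on-partners : ∀ l m → (m ≡ m₁*) ⊎ (m ≡ m₂*) → σ l m ≡ transposeIf (mirrored-above l) m₁* m₂* m
    σ-on-partners l m m∈ with transposeIf-pair (mirrored-above l) m₁* m₂* m m∈
    ... | inj₁ e = trans (cong (transposeIf (above l) m₁ m₂) e)
                         (trans (transposeIf-other (above l) m₁ m₂ m₁* (λ q → m₁≢m₁* (sym q)) (λ q → m₂≢m₁* (sym q))) (sym e))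
    ... | inj₂ e = trans (cong (transposeIf (above l) m₁ m₂) e)
                         (trans (transposeIf-other (above l) m₁ m₂ m₂* (λ q → m₁≢m₂* (sym q)) (λ q → m₂≢m₂* (sym q))) (sym e))

    σ-other : ∀ l m → m ≢ m₁ → m ≢ m₂ → m ≢ m₁* → m ≢ m₂* → σ l m ≡ m
    σ-other l m ≢m₁ ≢m₂ ≢m₁* ≢m₂* =
      trans (cong (transposeIf (above l) m₁ m₂) (transposeIf-other (mirrored-above l) m₁* m₂* m ≢m₁* ≢m₂*))
            (transposeIf-other (above l) m₁ m₂ m ≢m₁ ≢m₂)

    σ-inRange : ∀ l m → InRange K m → InRange K (σ l m)
    σ-inRange l m r = transposeIf-inRange K (above l) m₁ m₂ _ rm₁ rm₂ (transposeIf-inRange K (mirrored-above l) m₁* m₂* m rm₁* rm₂* r)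

    changes-at-k : ∀ x → (k <ᵇ suc x) ≢ (k <ᵇ x) → x ≡ k
    changes-at-k x ne with <-cmp k x
    ... | tri< k<x _ _ = ⊥-elim (ne (trans (dec-true (k <? suc x) (m<n⇒m<1+n k<x)) (sym (dec-true (k <? x) k<x))))
    ... | tri≈ _ k≡x _ = sym k≡x
    ... | tri> _ _ x<k = ⊥-elim (ne (trans (dec-false (k <? suc x) (λ q → <-irrefl refl (<-≤-trans x<k (≤-pred q))))
                                           (sym (dec-false (k <? x) (λ q → <-asym q x<k)))))

    meet-partners-at-n-k : f (n ∸ k) m₁* ≡ f (n ∸ k) m₂*
    meet-partners-at-n-k = partner-≡ Ff Ff m₁ m₂ rm₁ rm₂ (n ∸ k) (m∸n≤m n k) (subst (λ t → f t m₁ ≡ f t m₂) (sym (m∸[m∸n]≡n k≤n)) meet-k)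

    StepOK : ℕ → ℕ → Set
    StepOK i m = (σ (suc i) m ≡ σ i m) ⊎ (f i (σ i m) ≡ f i (σ (suc i) m)) ⊎ (f (suc i) (σ i m) ≡ f (suc i) (σ (suc i) m))

    pair-step : ∀ i → i < n → ∀ m → (m ≡ m₁) ⊎ (m ≡ m₂) → StepOK i m
    pair-step i i<n m m∈ with above (suc i) ≟ᴮ above i
    ... | yes same = inj₁ (trans (σ-on-pair (suc i) m m∈) (trans (cong (λ c → transposeIf c m₁ m₂ m) same) (sym (σ-on-pair i m m∈))))
    ... | no changes = inj₂ (inj₁ (trans (cong (f i) (σ-on-pair i m m∈))
                                  (trans (transposeIf-≡-at f i m₁ m₂ meet-i (above i) m)
                                         (sym (trans (cong (f i) (σ-on-pair (suc i) m m∈)) (transposeIf-≡-at f i m₁ m₂ meet-i (above (suc i)) m))))))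
      where
      meet-i : f i m₁ ≡ f i m₂
      meet-i = subst (λ t → f t m₁ ≡ f t m₂) (sym (changes-at-k i changes)) meet-k

    partner-pair-step : ∀ i → i < n → ∀ m → (m ≡ m₁*) ⊎ (m ≡ m₂*) → StepOK i m
    partner-pair-step i i<n m m∈ with mirrored-above (suc i) ≟ᴮ mirrored-above i
    ... | yes same = inj₁ (trans (σ-on-partners (suc i) m m∈)
                                 (trans (cong (λ c → transposeIf c m₁* m₂* m) same) (sym (σ-on-partners i m m∈))))
    ... | no changes = inj₂ (inj₂ (trans (cong (f (suc i)) (σ-on-partners i m m∈))
                                  (trans (transposeIf-≡-at f (suc i) m₁* m₂* meet-i+1 (mirrored-above i) m)
                                         (sym (trans (cong (f (suc i)) (σ-on-partners (suc i) m m∈))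
                                                     (transposeIf-≡-at f (suc i) m₁* m₂* meet-i+1 (mirrored-above (suc i)) m))))))
      where
      n-i-1≡k : n ∸ suc i ≡ k
      n-i-1≡k = changes-at-k (n ∸ suc i) (λ e → changes (sym (trans (cong (k <ᵇ_) (+-∸-assoc 1 i<n)) e)))
      meet-i+1 : f (suc i) m₁* ≡ f (suc i) m₂*
      meet-i+1 = subst (λ t → f t m₁* ≡ f t m₂*) (trans (cong (n ∸_) (sym n-i-1≡k)) (m∸[m∸n]≡n i<n)) meet-partners-at-n-k

    σ-step : ∀ i → i < n → ∀ m → InRange K m → StepOK i m
    σ-step i i<n m r with m ≟ m₁ | m ≟ m₂ | m ≟ m₁* | m ≟ m₂*
    ... | yes e | _     | _     | _     = pair-step i i<n m (inj₁ e)
    ... | no _  | yes e | _     | _     = pair-step i i<n m (inj₂ e)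
    ... | no _  | no _  | yes e | _     = partner-pair-step i i<n m (inj₁ e)
    ... | no _  | no _  | no _  | yes e = partner-pair-step i i<n m (inj₂ e)
    ... | no a  | no b  | no c  | no d  = inj₁ (trans (σ-other (suc i) m a b c d) (sym (σ-other i m a b c d)))

    pair-star : ∀ i → i ≤ n → ∀ m → InRange K m → (m ≡ m₁) ⊎ (m ≡ m₂) → σ i (star m) ≡ star (σ (n ∸ i) m)
    pair-star i i≤n m r m∈ = trans (σ-on-partners i (star m) (star-∈ m∈)) (trans (commutes (mirrored-above i)) (cong star (sym (σ-on-pair (n ∸ i) m m∈))))
      where
      star-∈ : (m ≡ m₁) ⊎ (m ≡ m₂) → (star m ≡ m₁*) ⊎ (star m ≡ m₂*)
      star-∈ (inj₁ refl) = inj₁ refl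
      star-∈ (inj₂ refl) = inj₂ refl
      commutes : ∀ c → transposeIf c m₁* m₂* (star m) ≡ star (transposeIf c m₁ m₂ m)
      commutes false = refl
      commutes true  = sym (star-transpose m₁ m₂ m (proj₁ rm₁) (proj₁ rm₂) (proj₁ r) m₁≢m₂)

    partner-pair-star : ∀ i → i ≤ n → ∀ m → InRange K m → (m ≡ m₁*) ⊎ (m ≡ m₂*) → σ i (star m) ≡ star (σ (n ∸ i) m)
    partner-pair-star i i≤n m r m∈ =
      trans (σ-on-pair i (star m) (star-∈ m∈))
            (trans (cong (λ c → transposeIf c m₁ m₂ (star m)) (cong (k <ᵇ_) (sym (m∸[m∸n]≡n i≤n))))
                   (trans (commutes (mirrored-above (n ∸ i))) (cong star (sym (σ-on-partners (n ∸ i) m m∈)))))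
      where
      star-∈ : (m ≡ m₁*) ⊎ (m ≡ m₂*) → (star m ≡ m₁) ⊎ (star m ≡ m₂)
      star-∈ (inj₁ refl) = inj₁ (star-involutive m₁ (proj₁ rm₁))
      star-∈ (inj₂ refl) = inj₂ (star-involutive m₂ (proj₁ rm₂))
      commutes : ∀ c → transposeIf c m₁ m₂ (star m) ≡ star (transposeIf c m₁* m₂* m)
      commutes false = refl
      commutes true  = sym (trans (star-transpose m₁* m₂* m (proj₁ rm₁*) (proj₁ rm₂*) (proj₁ r) m₁*≢m₂*)
                                  (cong₂ (λ a b → transpose a b (star m)) (star-involutive m₁ (proj₁ rm₁)) (star-involutive m₂ (proj₁ rm₂))))

    σ-star : ∀ i → i ≤ n → ∀ m → InRange K m → σ i (star m) ≡ star (σ (n ∸ i) m)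
    σ-star i i≤n m r with m ≟ m₁ | m ≟ m₂ | m ≟ m₁* | m ≟ m₂*
    ... | yes e | _     | _     | _     = pair-star i i≤n m r (inj₁ e)
    ... | no _  | yes e | _     | _     = pair-star i i≤n m r (inj₂ e)
    ... | no _  | no _  | yes e | _     = partner-pair-star i i≤n m r (inj₁ e)
    ... | no _  | no _  | no _  | yes e = partner-pair-star i i≤n m r (inj₂ e)
    ... | no a  | no b  | no c  | no d  =
      trans (σ-other i (star m) (λ e → c (trans (sym (star-involutive m (proj₁ r))) (cong star e)))
                                (λ e → d (trans (sym (star-involutive m (proj₁ r))) (cong star e)))
                                (λ e → a (star-injective m m₁ (proj₁ r) (proj₁ rm₁) e))
                                (λ e → b (star-injective m m₂ (proj₁ r) (proj₁ rm₂) e)))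
            (cong star (sym (σ-other (n ∸ i) m a b c d)))

    open Relabel Ff σ σ-inRange σ-step σ-star

    same-levels : ∀ l v → l ≤ n → levelCount relabelled K l v ≡ levelCount f K l v
    same-levels l v _ = trans (count-transposeIf K (λ x → f l (transposeIf (above l) m₁ m₂ x) ≡ᵇ v) (mirrored-above l) m₁* m₂* rm₁* rm₂* m₁*≢m₂*)
                              (count-transposeIf K (λ x → f l x ≡ᵇ v) (above l) m₁ m₂ rm₁ rm₂ m₁≢m₂)

    above-j : above j ≡ true
    above-j = dec-true (k <? j) k<j
    ¬above-i₀ : above i₀ ≡ false
    ¬above-i₀ = dec-false (k <? i₀) (λ q → <-asym q i₀<k)

    σ-fixes-pair : ∀ l m → (m ≡ m₁) ⊎ (m ≡ m₂) → above l ≡ false → σ l m ≡ m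
    σ-fixes-pair l m m∈ ¬above = trans (σ-on-pair l m m∈) (cong (λ c → transposeIf c m₁ m₂ m) ¬above)
    σ-fixes-partners : ∀ l m → (m ≡ m₁*) ⊎ (m ≡ m₂*) → mirrored-above l ≡ false → σ l m ≡ m
    σ-fixes-partners l m m∈ ¬above = trans (σ-on-partners l m m∈) (cong (λ c → transposeIf c m₁* m₂* m) ¬above)

    σ-swaps-m₁ : ∀ l → above l ≡ true → σ l m₁ ≡ m₂
    σ-swaps-m₁ l a = trans (σ-on-pair l m₁ (inj₁ refl)) (trans (cong (λ c → transposeIf c m₁ m₂ m₁) a) (transpose-a m₁ m₂))
    σ-swaps-m₂ : ∀ l → above l ≡ true → σ l m₂ ≡ m₁
    σ-swaps-m₂ l a = trans (σ-on-pair l m₂ (inj₂ refl)) (trans (cong (λ c → transposeIf c m₁ m₂ m₂) a) (transpose-b m₁ m₂ m₁≢m₂))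
    σ-swaps-m₁* : ∀ l → mirrored-above l ≡ true → σ l m₁* ≡ m₂*
    σ-swaps-m₁* l a = trans (σ-on-partners l m₁* (inj₁ refl)) (trans (cong (λ c → transposeIf c m₁* m₂* m₁*) a) (transpose-a m₁* m₂*))
    σ-swaps-m₂* : ∀ l → mirrored-above l ≡ true → σ l m₂* ≡ m₁*
    σ-swaps-m₂* l a = trans (σ-on-partners l m₂* (inj₂ refl)) (trans (cong (λ c → transposeIf c m₁* m₂* m₂*) a) (transpose-b m₁* m₂* m₁*≢m₂*))

    mirrored-above-i₀ : k ≤ n ∸ k → mirrored-above i₀ ≡ true
    mirrored-above-i₀ k≤n-k = dec-true (k <? (n ∸ i₀)) (≤-<-trans k≤n-k (∸-monoʳ-< i₀<k k≤n))
    ¬mirrored-above-j : n ∸ k < k → mirrored-above j ≡ false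
    ¬mirrored-above-j n-k<k = dec-false (k <? (n ∸ j)) (λ q → <-asym n-k<k (<-≤-trans q (∸-monoʳ-≤ n (<⇒≤ k<j))))

    S : List ℕ
    S = m₁ ∷ m₂ ∷ m₁* ∷ m₂* ∷ []

    S-inRange : All (InRange K) S
    S-inRange = rm₁ ∷ rm₂ ∷ rm₁* ∷ rm₂* ∷ []

    S-unique : Unique S
    S-unique = (m₁≢m₂ ∷ m₁≢m₁* ∷ m₁≢m₂* ∷ []) ∷ (m₂≢m₁* ∷ m₂≢m₂* ∷ []) ∷ (m₁*≢m₂* ∷ []) ∷ [] ∷ []

    unchanged : ∀ m → InRange K m → m ∉ S → ∀ i → relabelled i m ≡ f i m
    unchanged m _ m∉S i = cong (f i) (σ-other i m (λ e → m∉S (here e)) (λ e → m∉S (there (here e)))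
                                                   (λ e → m∉S (there (there (here e)))) (λ e → m∉S (there (there (there (here e))))))

    moved-to-partners : ∀ p → InRange K p → p ∈ S → agrees-with relabelled p m₁ ≡ false → agrees-with relabelled p m₂ ≡ false
      → (agrees-with relabelled p m₁* ≡ true) ⊎ (agrees-with relabelled p m₂* ≡ true)
    moved-to-partners p rp p∈S ¬m₁ ¬m₂ with history-moves relabelled relabelled-family same-levels S S-inRange S-unique unchanged p rp p∈S
    ... | _ , here refl , a                         = ⊥-elim (true≢false a ¬m₁)
    ... | _ , there (here refl) , a                 = ⊥-elim (true≢false a ¬m₂)
    ... | _ , there (there (here refl)) , a         = inj₁ a
    ... | _ , there (there (there (here refl))) , a = inj₂ a

    differs-at : ∀ p m t → t ≤ n → f t (σ t m) ≢ f t p → agrees-with relabelled p m ≡ false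
    differs-at p m t t≤n ne = ≢⇒¬agreeUpTo _ _ n t t≤n ne

    m₁-moved : (agrees-with relabelled m₁ m₁* ≡ true) ⊎ (agrees-with relabelled m₁ m₂* ≡ true)
    m₁-moved = moved-to-partners m₁ rm₁ (here refl)
      (differs-at m₁ m₁ j j≤n (λ e → differ-j (sym (trans (cong (f j) (sym (σ-swaps-m₁ j above-j))) e))))
      (differs-at m₁ m₂ i₀ i₀≤n (λ e → differ-i₀ (sym (trans (cong (f i₀) (sym (σ-fixes-pair i₀ m₂ (inj₂ refl) ¬above-i₀))) e))))

    m₂-moved : (agrees-with relabelled m₂ m₁* ≡ true) ⊎ (agrees-with relabelled m₂ m₂* ≡ true)
    m₂-moved = moved-to-partners m₂ rm₂ (there (here refl))
      (differs-at m₂ m₁ i₀ i₀≤n (λ e → differ-i₀ (trans (cong (f i₀) (sym (σ-fixes-pair i₀ m₁ (inj₁ refl) ¬above-i₀))) e)))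
      (differs-at m₂ m₂ j j≤n (λ e → differ-j (trans (cong (f j) (sym (σ-swaps-m₂ j above-j))) e)))

    mirror-agreement : ∀ a b → InRange K a → InRange K b → (∀ i → i ≤ n → relabelled i a ≡ f i b)
      → ∀ i → i ≤ n → relabelled i (star a) ≡ f i (star b)
    mirror-agreement a b ra rb e i i≤n = partner-≡ relabelled-family Ff a b ra rb i i≤n (e (n ∸ i) (m∸n≤m n i))

    mirror-agreement* : ∀ a b → InRange K a → InRange K b → (∀ i → i ≤ n → relabelled i (star a) ≡ f i b)
      → ∀ i → i ≤ n → relabelled i a ≡ f i (star b)
    mirror-agreement* a b ra rb e i i≤n =
      subst (λ z → relabelled i z ≡ f i (star b)) (star-involutive a (proj₁ ra)) (mirror-agreement (star a) b (star-inRange h a ra) rb e i i≤n)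

    -- If k ≤ n ∸ k, level i₀ sees only the exchange of m₁*, m₂*; otherwise level j sees only that of m₁, m₂.
    straight : (∀ i → i ≤ n → relabelled i m₁* ≡ f i m₁) → (∀ i → i ≤ n → relabelled i m₂* ≡ f i m₂) → ⊥
    straight m₁*↦m₁ m₂*↦m₂ with k ≤? n ∸ k
    ... | yes k≤n-k = differ-i₀ (sym (trans (trans (cong (f i₀) (sym (σ-fixes-pair i₀ m₂ (inj₂ refl) ¬above-i₀)))
                                                   (mirror-agreement* m₂ m₂ rm₂ rm₂ m₂*↦m₂ i₀ i₀≤n))
                                            (trans (cong (f i₀) (sym (σ-swaps-m₁* i₀ (mirrored-above-i₀ k≤n-k)))) (m₁*↦m₁ i₀ i₀≤n))))
    ... | no k≰n-k = differ-j (sym (trans (trans (cong (f j) (sym (σ-swaps-m₁ j above-j))) (mirror-agreement* m₁ m₁ rm₁ rm₁ m₁*↦m₁ j j≤n))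
                                          (trans (cong (f j) (sym (σ-fixes-partners j m₁* (inj₁ refl) (¬mirrored-above-j (≰⇒> k≰n-k)))))
                                                 (m₁*↦m₁ j j≤n))))

    crossed : (∀ i → i ≤ n → relabelled i m₂* ≡ f i m₁) → (∀ i → i ≤ n → relabelled i m₁* ≡ f i m₂) → ⊥
    crossed m₂*↦m₁ m₁*↦m₂ with k ≤? n ∸ k
    ... | yes k≤n-k = differ-i₀ (sym (trans (trans (cong (f i₀) (sym (σ-fixes-pair i₀ m₂ (inj₂ refl) ¬above-i₀)))
                                                   (mirror-agreement* m₂ m₁ rm₂ rm₁ m₂*↦m₁ i₀ i₀≤n))
                                            (trans (cong (f i₀) (sym (σ-swaps-m₂* i₀ (mirrored-above-i₀ k≤n-k)))) (m₂*↦m₁ i₀ i₀≤n))))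
    ... | no k≰n-k = differ-j (sym (trans (trans (cong (f j) (sym (σ-swaps-m₁ j above-j))) (mirror-agreement* m₁ m₂ rm₁ rm₂ m₁*↦m₂ j j≤n))
                                          (trans (cong (f j) (sym (σ-fixes-partners j m₂* (inj₂ refl) (¬mirrored-above-j (≰⇒> k≰n-k)))))
                                                 (m₂*↦m₁ j j≤n))))

    contradiction : ⊥
    contradiction with m₁-moved | m₂-moved
    ... | inj₁ a | inj₁ b = differ-i₀ (trans (sym (agreeUpTo⇒≡ _ _ n a i₀ i₀≤n)) (agreeUpTo⇒≡ _ _ n b i₀ i₀≤n))
    ... | inj₂ a | inj₂ b = differ-i₀ (trans (sym (agreeUpTo⇒≡ _ _ n a i₀ i₀≤n)) (agreeUpTo⇒≡ _ _ n b i₀ i₀≤n))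
    ... | inj₁ a | inj₂ b = straight (agreeUpTo⇒≡ _ _ n a) (agreeUpTo⇒≡ _ _ n b)
    ... | inj₂ a | inj₁ b = crossed (agreeUpTo⇒≡ _ _ n a) (agreeUpTo⇒≡ _ _ n b)

  mirror-interval : ∀ m → InRange K m → ∀ {a b} → MaxInterval n f m (star m) (a , b) → MaxInterval n f m (star m) (n ∸ b , n ∸ a)
  mirror-interval m rm {a} {b} I = 1≤n-b , ∸-monoʳ-≤ n (start≤end I) , m∸n≤m n a , inside′ , before′ , after′
    where
    open Intervals n f m (star m)
    meet-at-end : f n m ≡ f n (star m)
    meet-at-end = trans (PathFamily.end Ff m rm) (sym (PathFamily.end Ff (star m) (star-inRange h m rm)))
    b<n : b < n
    b<n with m≤n⇒m<n∨m≡n (end≤n I)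
    ... | inj₁ b<n = b<n
    ... | inj₂ refl = ⊥-elim (proj₂ (proj₂ (inside I b (start≤end I) ≤-refl)) meet-at-end)
    1≤n-b : 1 ≤ n ∸ b
    1≤n-b = m<n⇒0<n∸m b<n
    a≤n : a ≤ n
    a≤n = ≤-trans (start≤end I) (end≤n I)
    mirror-D : ∀ t → t ≤ n → D (n ∸ t) → f t m ≢ f t (star m)
    mirror-D t t≤n Dn-t = subst (λ z → f z m ≢ f z (star m)) (m∸[m∸n]≡n t≤n) (partner-≢ Ff m rm (n ∸ t) (m∸n≤m n t) (proj₂ (proj₂ Dn-t)))
    inside′ : ∀ l → n ∸ b ≤ l → l ≤ n ∸ a → D l
    inside′ l n-b≤l l≤n-a = ≤-trans 1≤n-b n-b≤l , ≤-trans l≤n-a (m∸n≤m n a) ,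
      mirror-D l (≤-trans l≤n-a (m∸n≤m n a))
               (inside I (n ∸ l) (≤-trans (≤-reflexive (sym (m∸[m∸n]≡n a≤n))) (∸-monoʳ-≤ n l≤n-a))
                                 (≤-trans (∸-monoʳ-≤ n n-b≤l) (≤-reflexive (m∸[m∸n]≡n (end≤n I)))))
    before′ : ¬ D ((n ∸ b) ∸ 1)
    before′ D′ = ¬D-after I (s≤s z≤n , b<n , mirror-D (suc b) b<n (subst D (trans (∸-+-assoc n b 1) (cong (n ∸_) (+-comm b 1))) D′))
    after′ : ¬ D (suc (n ∸ a))
    after′ = after-mirror a (start≥1 I) a≤n (¬D-before I)
      where
      after-mirror : ∀ a′ → 1 ≤ a′ → a′ ≤ n → ¬ D (a′ ∸ 1) → ¬ D (suc (n ∸ a′))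
      after-mirror 1 _ 1≤n _ D′ = proj₂ (proj₂ D′) (subst (λ z → f z m ≡ f z (star m)) (+-∸-assoc 1 1≤n) meet-at-end)
      after-mirror (suc (suc a′)) _ a′+2≤n ¬D′ D′ =
        ¬D′ (s≤s z≤n , ≤-trans (n≤1+n (suc a′)) a′+2≤n ,
             mirror-D (suc a′) (≤-trans (n≤1+n (suc a′)) a′+2≤n) (subst D (sym (+-∸-assoc 1 a′+2≤n)) D′))

  necessary-II : ConditionII n h f
  necessary-II m₁ m₂ 1≤m₁ m₁≤2h 1≤m₂ m₂≤2h m₁*≢m₂ I J mi mj with ≡-dec² _≟_ _≟_ I J
  ... | yes I≡J = I≡J
  ... | no I≢J with Intervals.distinct⇒gap n f m₁ m₂ mi mj I≢J
  ...   | i₀ , k , j , i₀<k , k<j , j≤n , Di₀ , ¬Dk , Dj =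
    ⊥-elim (NonPartnerSwap.contradiction m₁ m₂ (1≤m₁ , m₁≤2h) (1≤m₂ , m₂≤2h) m₁*≢m₂ i₀ k j i₀<k k<j j≤n (proj₂ (proj₂ Di₀))
              (meet-outside m₁ m₂ k (1≤m₁ , m₁≤2h) (1≤m₂ , m₂≤2h) (<⇒≤ (<-≤-trans k<j j≤n)) ¬Dk) (proj₂ (proj₂ Dj)))

  OutsideOrMirror : ℕ → ℕ × ℕ → ℕ × ℕ → Set
  OutsideOrMirror m (a , b) J = J ≡ (n ∸ b , n ∸ a) ⊎ Σ ℕ (λ d → InD n f m (star m) d × ¬ (a ≤ d × d ≤ b) × ¬ (a ≤ n ∸ d × n ∸ d ≤ b))

  mirror-or-outside : ∀ m → InRange K m → ∀ {a b} → MaxInterval n f m (star m) (a , b)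
    → ∀ J → MaxInterval n f m (star m) J → (a , b) ≢ J → OutsideOrMirror m (a , b) J
  mirror-or-outside m rm {a} {b} I (x , y) J I≢J with (a ≤? x) ×-dec (x ≤? b)
  ... | yes (a≤x , x≤b) = ⊥-elim (I≢J (overlap⇒≡ I J x a≤x x≤b ≤-refl (start≤end J)))
    where open Intervals n f m (star m)
  ... | no x∉I with (a ≤? n ∸ x) ×-dec (n ∸ x ≤? b)
  ...   | yes (a≤n-x , n-x≤b) = inj₁ (sym (overlap⇒≡ (mirror-interval m rm I) J x n-b≤x x≤n-a ≤-refl (start≤end J)))
    where
    open Intervals n f m (star m)
    x≤n : x ≤ n
    x≤n = ≤-trans (start≤end J) (end≤n J)
    n-b≤x : n ∸ b ≤ x
    n-b≤x = ≤-trans (∸-monoʳ-≤ n n-x≤b) (≤-reflexive (m∸[m∸n]≡n x≤n))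
    x≤n-a : x ≤ n ∸ a
    x≤n-a = ≤-trans (≤-reflexive (sym (m∸[m∸n]≡n x≤n))) (∸-monoʳ-≤ n a≤n-x)
  ...   | no n-x∉I = inj₂ (x , Intervals.inside n f m (star m) J x ≤-refl (Intervals.start≤end n f m (star m) J) , x∉I , n-x∉I)

  necessary-I : ConditionI n h f
  necessary-I m₁ .(star m₁) 1≤m₁ m₁≤2h _ _ refl (a₁ , b₁) J L I mj ml
    with ≡-dec² _≟_ _≟_ (a₁ , b₁) J | ≡-dec² _≟_ _≟_ (a₁ , b₁) L | ≡-dec² _≟_ _≟_ J L
  ... | yes I≡J | _       | _       = inj₁ I≡J
  ... | no _    | yes I≡L | _       = inj₂ (inj₁ I≡L)
  ... | no _    | no _    | yes J≡L = inj₂ (inj₂ J≡L)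
  ... | no I≢J  | no I≢L  | no J≢L  = ⊥-elim (two-others (mirror-or-outside m₁ rm₁ I J mj I≢J) (mirror-or-outside m₁ rm₁ I L ml I≢L))
    where
    rm₁ : InRange K m₁
    rm₁ = 1≤m₁ , m₁≤2h
    two-others : OutsideOrMirror m₁ (a₁ , b₁) J → OutsideOrMirror m₁ (a₁ , b₁) L → ⊥
    two-others (inj₁ J≡I′) (inj₁ L≡I′)                 = J≢L (trans J≡I′ (sym L≡I′))
    two-others (inj₂ (d , Dd , d∉I , n-d∉I)) _         = PartnerSwap.contradiction m₁ rm₁ a₁ b₁ I d Dd d∉I n-d∉I
    two-others (inj₁ _) (inj₂ (d , Dd , d∉I , n-d∉I)) = PartnerSwap.contradiction m₁ rm₁ a₁ b₁ I d Dd d∉I n-d∉I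

module Weights where

  open import Data.Nat
  open import Data.Nat.Properties
  open import Data.Bool using (Bool; true; false)
  open import Data.List as L using (List; []; _∷_; _++_; length; take; drop; [_])
  open import Data.List.Properties using (take++drop≡id; length-drop; reverse-++; unfold-reverse; length-reverse; ∷-injectiveˡ; ∷-injectiveʳ)
  open import Data.Vec as V using (Vec)
  open import Data.Sum using (inj₁; inj₂)
  open import Data.Empty using (⊥-elim)
  open import Relation.Binary.PropositionalEquality hiding ([_])

  wt-++ : ∀ xs ys → wt (xs ++ ys) ≡ wt xs + wt ys
  wt-++ []           ys = refl
  wt-++ (true ∷ xs)  ys = cong suc (wt-++ xs ys)
  wt-++ (false ∷ xs) ys = wt-++ xs ys

  wt-reverse : ∀ xs → wt (L.reverse xs) ≡ wt xs
  wt-reverse []       = refl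
  wt-reverse (x ∷ xs) =
    trans (cong wt (unfold-reverse x xs)) (trans (wt-++ (L.reverse xs) [ x ]) (trans (cong (_+ wt [ x ]) (wt-reverse xs)) (last x)))
    where
    last : ∀ x → wt xs + wt [ x ] ≡ wt (x ∷ xs)
    last true  = +-comm (wt xs) 1
    last false = +-identityʳ (wt xs)

  wt-take+drop : ∀ k xs → wt (take k xs) + wt (drop k xs) ≡ wt xs
  wt-take+drop k xs = trans (sym (wt-++ (take k xs) (drop k xs))) (cong wt (take++drop≡id k xs))

  take-length-++ : ∀ {A : Set} (xs ys : List A) → take (length xs) (xs ++ ys) ≡ xs
  take-length-++ []       ys = refl
  take-length-++ (x ∷ xs) ys = cong (x ∷_) (take-length-++ xs ys)

  wt-take-reverse : ∀ xs j → j ≤ length xs → wt (take j (L.reverse xs)) ≡ wt (drop (length xs ∸ j) xs)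
  wt-take-reverse xs j j≤ = begin
      wt (take j (L.reverse xs))                                       ≡⟨ cong (λ z → wt (take j (L.reverse z))) (sym (take++drop≡id k xs)) ⟩
      wt (take j (L.reverse (A ++ B)))                                 ≡⟨ cong (λ z → wt (take j z)) (reverse-++ A B) ⟩
      wt (take j (L.reverse B ++ L.reverse A))                         ≡⟨ cong (λ z → wt (take z (L.reverse B ++ L.reverse A))) (sym length-B) ⟩
      wt (take (length (L.reverse B)) (L.reverse B ++ L.reverse A))   ≡⟨ cong wt (take-length-++ (L.reverse B) (L.reverse A)) ⟩
      wt (L.reverse B)                                                 ≡⟨ wt-reverse B ⟩
      wt B                                                             ∎
    where
    open ≡-Reasoning
    k : ℕ
    k = length xs ∸ j
    A B : List Bool
    A = take k xs
    B = drop k xs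
    length-B : length (L.reverse B) ≡ j
    length-B = trans (length-reverse B) (trans (length-drop k xs) (m∸[m∸n]≡n j≤))

  wt-take≤ : ∀ l xs → wt (take l xs) ≤ l
  wt-take≤ zero    xs           = z≤n
  wt-take≤ (suc l) []           = z≤n
  wt-take≤ (suc l) (true ∷ xs)  = s≤s (wt-take≤ l xs)
  wt-take≤ (suc l) (false ∷ xs) = m≤n⇒m≤1+n (wt-take≤ l xs)

  wt-take-step : ∀ i xs → Step (wt (take i xs)) (wt (take (suc i) xs))
  wt-take-step zero    []           = inj₁ refl
  wt-take-step zero    (true ∷ xs)  = inj₂ refl
  wt-take-step zero    (false ∷ xs) = inj₁ refl
  wt-take-step (suc i) []           = inj₁ refl
  wt-take-step (suc i) (true ∷ xs) with wt-take-step i xs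
  ... | inj₁ e = inj₁ (cong suc e)
  ... | inj₂ e = inj₂ (cong suc e)
  wt-take-step (suc i) (false ∷ xs) = wt-take-step i xs

  prefix-weights-injective : ∀ xs ys → length xs ≡ length ys → (∀ i → i ≤ length xs → wt (take i xs) ≡ wt (take i ys)) → xs ≡ ys
  prefix-weights-injective []           []           _ _ = refl
  prefix-weights-injective (true ∷ xs)  (true ∷ ys)  e h =
    cong (true ∷_) (prefix-weights-injective xs ys (suc-injective e) (λ i i≤ → suc-injective (h (suc i) (s≤s i≤))))
  prefix-weights-injective (false ∷ xs) (false ∷ ys) e h =
    cong (false ∷_) (prefix-weights-injective xs ys (suc-injective e) (λ i i≤ → h (suc i) (s≤s i≤)))
  prefix-weights-injective (true ∷ xs)  (false ∷ ys) e h = ⊥-elim (1+n≢0 (h 1 (s≤s z≤n)))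
  prefix-weights-injective (false ∷ xs) (true ∷ ys)  e h = ⊥-elim (1+n≢0 (sym (h 1 (s≤s z≤n))))

  toList-injective : ∀ {A : Set} {k} (u v : Vec A k) → V.toList u ≡ V.toList v → u ≡ v
  toList-injective V.[]       V.[]       _ = refl
  toList-injective (x V.∷ u) (y V.∷ v) e = cong₂ V._∷_ (∷-injectiveˡ e) (toList-injective u v (∷-injectiveʳ e))

module Strings (n : ℕ) where

  open Multisets
  open Weights
  open import Data.Nat
  open import Data.Nat.Properties
  open import Data.Bool using (Bool; true; _∧_; not)
  open import Data.Bool.Properties using () renaming (_≟_ to _≟ᴮ_)
  open import Data.List as L using (List; []; _∷_; map; concatMap; _++_; length; take; drop)
  open import Data.List.Properties using (length-take; length-drop; take-all)
  open import Data.List.Membership.Propositional using (_∈_)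
  open import Data.List.Relation.Unary.All using (All; []; _∷_)
  open import Data.List.Relation.Unary.Any using (here; there)
  open import Data.Vec as V using (Vec; toList)
  open import Data.Vec.Properties using (toList-reverse; length-toList; reverse-involutive; ≡-dec)
  open import Data.Product using (_×_; _,_; Σ; proj₁; proj₂)
  open import Data.Sum using (_⊎_; inj₁; inj₂)
  open import Data.Empty using (⊥-elim)
  open import Relation.Nullary using (¬_; yes; no; does)
  open import Relation.Binary.PropositionalEquality
  open import Algebra.Properties.CommutativeSemigroup +-commutativeSemigroup using (interchange)

  prefixWt : Str n → ℕ → ℕ
  prefixWt u l = wt (take l (toList u))

  suffixWt : Str n → ℕ → ℕ
  suffixWt u l = wt (take l (toList (V.reverse u)))

  suffixWt-drop : ∀ u l → l ≤ n → suffixWt u l ≡ wt (drop (n ∸ l) (toList u))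
  suffixWt-drop u l l≤n =
    trans (cong (λ z → wt (take l z)) (toList-reverse u))
          (trans (wt-take-reverse (toList u) l (subst (l ≤_) (sym (length-toList u)) l≤n))
                 (cong (λ z → wt (drop (z ∸ l) (toList u))) (length-toList u)))

  prefixWt-n : ∀ u → prefixWt u n ≡ wt (toList u)
  prefixWt-n u = cong wt (take-all n (toList u) (≤-reflexive (length-toList u)))

  suffixWt-n : ∀ u → suffixWt u n ≡ wt (toList u)
  suffixWt-n u = trans (suffixWt-drop u n ≤-refl) (cong (λ z → wt (drop z (toList u))) (n∸n≡0 n))

  prefixWt-injective : ∀ u v → (∀ i → i ≤ n → prefixWt u i ≡ prefixWt v i) → u ≡ v
  prefixWt-injective u v eq = toList-injective u v
    (prefix-weights-injective (toList u) (toList v) (trans (length-toList u) (sym (length-toList v)))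
                              (λ i i≤ → eq i (subst (i ≤_) (length-toList u) i≤)))

  suffixWt+prefixWt : ∀ u i → i ≤ n → suffixWt u i + prefixWt u (n ∸ i) ≡ wt (toList u)
  suffixWt+prefixWt u i i≤n =
    trans (cong (_+ prefixWt u (n ∸ i)) (suffixWt-drop u i i≤n))
          (trans (+-comm _ (prefixWt u (n ∸ i))) (wt-take+drop (n ∸ i) (toList u)))

  prefixWt+suffixWt : ∀ u i → i ≤ n → prefixWt u i + suffixWt u (n ∸ i) ≡ wt (toList u)
  prefixWt+suffixWt u i i≤n =
    trans (cong (prefixWt u i +_) (trans (suffixWt-drop u (n ∸ i) (m∸n≤m n i)) (cong (λ z → wt (drop z (toList u))) (m∸[m∸n]≡n i≤n))))
          (wt-take+drop i (toList u))

  pathsOf : List (Str n) → ℕ → ℕ → ℕ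
  pathsOf []      l m                   = 0
  pathsOf (u ∷ U) l zero                = 0
  pathsOf (u ∷ U) l 1                   = prefixWt u l
  pathsOf (u ∷ U) l 2                   = suffixWt u l
  pathsOf (u ∷ U) l (suc (suc (suc m))) = pathsOf U l (suc m)

  pathsOf-shift : ∀ u U l m → 1 ≤ m → pathsOf (u ∷ U) l (suc (suc m)) ≡ pathsOf U l m
  pathsOf-shift u U l (suc m) _ = refl

  inRange-drop2 : ∀ k m → InRange (2 * suc k) (suc (suc m)) → 1 ≤ m → InRange (2 * k) m
  inRange-drop2 k m (_ , m+2≤) 1≤m rewrite 2*suc k = 1≤m , ≤-pred (≤-pred m+2≤)

  inRange-add2 : ∀ k m → InRange (2 * k) m → InRange (2 * suc k) (suc (suc m))
  inRange-add2 k m (_ , m≤) rewrite 2*suc k = s≤s z≤n , s≤s (s≤s m≤)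

  pathsOf-start : ∀ U m → pathsOf U 0 m ≡ 0
  pathsOf-start []      m                   = refl
  pathsOf-start (u ∷ U) zero                = refl
  pathsOf-start (u ∷ U) 1                   = refl
  pathsOf-start (u ∷ U) 2                   = refl
  pathsOf-start (u ∷ U) (suc (suc (suc m))) = pathsOf-start U (suc m)

  pathsOf-step : ∀ U m i → Step (pathsOf U i m) (pathsOf U (suc i) m)
  pathsOf-step []      m                   i = inj₁ refl
  pathsOf-step (u ∷ U) zero                i = inj₁ refl
  pathsOf-step (u ∷ U) 1                   i = wt-take-step i (toList u)
  pathsOf-step (u ∷ U) 2                   i = wt-take-step i (toList (V.reverse u))
  pathsOf-step (u ∷ U) (suc (suc (suc m))) i = pathsOf-step U (suc m) i

  pathsOf-≤ : ∀ U m l → pathsOf U l m ≤ l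
  pathsOf-≤ []      m                   l = z≤n
  pathsOf-≤ (u ∷ U) zero                l = z≤n
  pathsOf-≤ (u ∷ U) 1                   l = wt-take≤ l (toList u)
  pathsOf-≤ (u ∷ U) 2                   l = wt-take≤ l (toList (V.reverse u))
  pathsOf-≤ (u ∷ U) (suc (suc (suc m))) l = pathsOf-≤ U (suc m) l

  pathsOf-mirror : ∀ U m → InRange (2 * length U) m → ∀ i → i ≤ n → pathsOf U i (star m) + pathsOf U (n ∸ i) m ≡ pathsOf U n m
  pathsOf-mirror []      m r = ⊥-elim (¬inRange0 r)
  pathsOf-mirror (u ∷ U) 1 r i i≤n = trans (suffixWt+prefixWt u i i≤n) (sym (prefixWt-n u))
  pathsOf-mirror (u ∷ U) 2 r i i≤n = trans (prefixWt+suffixWt u i i≤n) (sym (suffixWt-n u))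
  pathsOf-mirror (u ∷ U) (suc (suc (suc m))) r i i≤n =
    trans (cong (λ z → pathsOf (u ∷ U) i z + pathsOf U (n ∸ i) (suc m)) (star-suc-suc (suc m) (s≤s z≤n)))
          (trans (cong (_+ pathsOf U (n ∸ i) (suc m)) (pathsOf-shift u U i (star (suc m)) (star-pos (suc m) (s≤s z≤n))))
                 (pathsOf-mirror U (suc m) (inRange-drop2 (length U) (suc m) r (s≤s z≤n)) i i≤n))

  pathsOf-end : ∀ {w} U → All (λ t → wt (toList t) ≡ w) U → ∀ m → InRange (2 * length U) m → pathsOf U n m ≡ w
  pathsOf-end []      []            m r = ⊥-elim (¬inRange0 r)
  pathsOf-end (u ∷ U) (wt≡ ∷ _)    1 r = trans (prefixWt-n u) wt≡
  pathsOf-end (u ∷ U) (wt≡ ∷ _)    2 r = trans (suffixWt-n u) wt≡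
  pathsOf-end (u ∷ U) (_ ∷ wts) (suc (suc (suc m))) r = pathsOf-end U wts (suc m) (inRange-drop2 (length U) (suc m) r (s≤s z≤n))

  pathsOf-family : ∀ U w → (∀ m → InRange (2 * length U) m → pathsOf U n m ≡ w) → PathFamily n (length U) w (pathsOf U)
  pathsOf-family U w end = record
    { start  = λ m _ → pathsOf-start U m
    ; step   = λ m _ i _ → pathsOf-step U m i
    ; end    = end
    ; mirror = λ m r i i≤n → trans (pathsOf-mirror U m r i i≤n) (end m r) }

  compositionCount : (ℕ → ℕ → ℕ) → ℕ → ℕ → ℕ → ℕ
  compositionCount X K c b = sumTo (λ m → count (λ l → (l ≡ᵇ c) ∧ (X l m ≡ᵇ b)) n) K

  occurrences-Mstr : ∀ u a b → occurrences (a , b) (Mstr u)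
    ≡ count (λ l → (l ≡ᵇ a + b) ∧ (prefixWt u l ≡ᵇ b)) n + count (λ l → (l ≡ᵇ a + b) ∧ (suffixWt u l ≡ᵇ b)) n
  occurrences-Mstr u a b =
    trans (occurrences-++ (a , b) (map (λ j → comp (take j (toList u))) (range 1 n)) (map (λ j → comp (drop (n ∸ j) (toList u))) (range 1 n)))
          (cong₂ _+_ (occurrences-compositions a b n _ (prefixWt u) (λ l r → cong (λ z → (z ∸ prefixWt u l , prefixWt u l)) (length-prefix l (proj₂ r)))
                                               (λ l _ → wt-take≤ l (toList u)))
                     (occurrences-compositions a b n _ (suffixWt u) (λ l r → cong₂ (λ z y → (z ∸ y , y)) (length-suffix l (proj₂ r)) (sym (suffixWt-drop u l (proj₂ r))))
                                               (λ l _ → wt-take≤ l (toList (V.reverse u)))))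
    where
    length-prefix : ∀ l → l ≤ n → length (take l (toList u)) ≡ l
    length-prefix l l≤n = trans (length-take l (toList u)) (m≤n⇒m⊓n≡m (subst (l ≤_) (sym (length-toList u)) l≤n))
    length-suffix : ∀ l → l ≤ n → length (drop (n ∸ l) (toList u)) ≡ l
    length-suffix l l≤n = trans (length-drop (n ∸ l) (toList u)) (trans (cong (_∸ (n ∸ l)) (length-toList u)) (m∸[m∸n]≡n l≤n))

  occurrences-Mset : ∀ U a b → occurrences (a , b) (Mset U) ≡ compositionCount (pathsOf U) (2 * length U) (a + b) b
  occurrences-Mset []      a b = refl
  occurrences-Mset (u ∷ U) a b = begin
    occurrences (a , b) (Mstr u ++ Mset U)                               ≡⟨ occurrences-++ (a , b) (Mstr u) (Mset U) ⟩
    occurrences (a , b) (Mstr u) + occurrences (a , b) (Mset U)          ≡⟨ cong₂ _+_ (occurrences-Mstr u a b) (occurrences-Mset U a b) ⟩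
    (pre + suf) + compositionCount (pathsOf U) (2 * length U) (a + b) b  ≡⟨ +-assoc pre suf _ ⟩
    pre + (suf + compositionCount (pathsOf U) (2 * length U) (a + b) b)  ≡⟨ cong (λ z → pre + (suf + z)) (sumTo-cong (2 * length U) _ _ shifted) ⟩
    pre + (suf + sumTo (λ m → count (λ l → (l ≡ᵇ a + b) ∧ (pathsOf (u ∷ U) l (suc (suc m)) ≡ᵇ b)) n) (2 * length U))
                                                                         ≡⟨ cong (λ K → compositionCount (pathsOf (u ∷ U)) K (a + b) b) (sym (2*suc (length U))) ⟩
    compositionCount (pathsOf (u ∷ U)) (2 * length (u ∷ U)) (a + b) b    ∎
    where
    open ≡-Reasoning
    pre suf : ℕ
    pre = count (λ l → (l ≡ᵇ a + b) ∧ (prefixWt u l ≡ᵇ b)) n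
    suf = count (λ l → (l ≡ᵇ a + b) ∧ (suffixWt u l ≡ᵇ b)) n
    shifted : ∀ m → InRange (2 * length U) m
      → count (λ l → (l ≡ᵇ a + b) ∧ (pathsOf U l m ≡ᵇ b)) n ≡ count (λ l → (l ≡ᵇ a + b) ∧ (pathsOf (u ∷ U) l (suc (suc m)) ≡ᵇ b)) n
    shifted m r = count-cong n _ _ (λ l _ → cong (λ z → (l ≡ᵇ a + b) ∧ (z ≡ᵇ b)) (sym (pathsOf-shift u U l m (proj₁ r))))

  occurrences-cwfMultiset : ∀ K (X : ℕ → ℕ → ℕ) a b → (∀ m l → InRange K m → InRange n l → X l m ≤ l)
    → occurrences (a , b) (concatMap (λ m → map (λ l → (l ∸ X l m , X l m)) (range 1 n)) (range 1 K)) ≡ compositionCount X K (a + b) b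
  occurrences-cwfMultiset K X a b X≤ =
    trans (occurrences-concatMap (a , b) _ (range 1 K))
          (trans (sumMap-range1 _ K) (sumTo-cong K _ _ (λ m r → occurrences-compositions a b n _ (λ l → X l m) (λ _ _ → refl) (λ l r′ → X≤ m l r r′))))

  compositionCount-inside : ∀ X K c b → InRange n c → compositionCount X K c b ≡ levelCount X K c b
  compositionCount-inside X K c b rc = sumTo-cong K _ _ (λ m _ → count-at n c (λ l → X l m ≡ᵇ b) rc)

  compositionCount-outside : ∀ X K c b → ¬ InRange n c → compositionCount X K c b ≡ 0
  compositionCount-outside X K c b c∉ = trans (sumTo-cong K _ _ (λ m _ → count-at-outside n c (λ l → X l m ≡ᵇ b) c∉)) (sumTo-0 K)
    where
    sumTo-0 : ∀ K → sumTo (λ _ → 0) K ≡ 0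
    sumTo-0 zero    = refl
    sumTo-0 (suc K) = sumTo-0 K

  levelCounts⇒compositionCounts : ∀ X Y K → (∀ l v → InRange n l → levelCount X K l v ≡ levelCount Y K l v)
    → ∀ c b → compositionCount X K c b ≡ compositionCount Y K c b
  levelCounts⇒compositionCounts X Y K same c b with 1 ≤? c | c ≤? n
  ... | yes 1≤c | yes c≤n = trans (compositionCount-inside X K c b (1≤c , c≤n)) (trans (same c b (1≤c , c≤n)) (sym (compositionCount-inside Y K c b (1≤c , c≤n))))
  ... | no 1≰c  | _       = trans (compositionCount-outside X K c b (λ r → 1≰c (proj₁ r))) (sym (compositionCount-outside Y K c b (λ r → 1≰c (proj₁ r))))
  ... | yes _   | no c≰n  = trans (compositionCount-outside X K c b (λ r → c≰n (proj₂ r))) (sym (compositionCount-outside Y K c b (λ r → c≰n (proj₂ r))))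

  levelCount-above : ∀ X K l v → (∀ m → InRange K m → X l m ≤ l) → l < v → levelCount X K l v ≡ 0
  levelCount-above X K l v X≤ l<v = false⇒count≡0 K _ (λ m r → ≢⇒≡ᵇ-false (λ e → <-irrefl refl (<-≤-trans l<v (≤-trans (≤-reflexive (sym e)) (X≤ m r)))))

  compositionCounts⇒levelCounts : ∀ X Y K → (∀ m l → InRange K m → l ≤ n → X l m ≤ l) → (∀ m l → InRange K m → l ≤ n → Y l m ≤ l)
    → (∀ a b → compositionCount X K (a + b) b ≡ compositionCount Y K (a + b) b) → ∀ l v → InRange n l → levelCount X K l v ≡ levelCount Y K l v
  compositionCounts⇒levelCounts X Y K X≤ Y≤ same l v rl with v ≤? l
  ... | yes v≤l = begin
    levelCount X K l v                  ≡⟨ sym (compositionCount-inside X K l v rl) ⟩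
    compositionCount X K l v            ≡⟨ cong (λ z → compositionCount X K z v) (sym (m∸n+n≡m v≤l)) ⟩
    compositionCount X K (l ∸ v + v) v  ≡⟨ same (l ∸ v) v ⟩
    compositionCount Y K (l ∸ v + v) v  ≡⟨ cong (λ z → compositionCount Y K z v) (m∸n+n≡m v≤l) ⟩
    compositionCount Y K l v            ≡⟨ compositionCount-inside Y K l v rl ⟩
    levelCount Y K l v                  ∎
    where open ≡-Reasoning
  ... | no v≰l = trans (levelCount-above X K l v (λ m r → X≤ m l r (proj₂ rl)) (≰⇒> v≰l))
                       (sym (levelCount-above Y K l v (λ m r → Y≤ m l r (proj₂ rl)) (≰⇒> v≰l)))

  mult-∷ : ∀ (t u : Str n) U → mult t (u ∷ U) ≡ bit (does (≡-dec _≟ᴮ_ t u)) + mult t U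
  mult-∷ t u U with ≡-dec _≟ᴮ_ t u
  ... | yes _ = refl
  ... | no _  = refl

  does-≡ : ∀ (t u : Str n) (b : Bool) → (t ≡ u → b ≡ true) → (b ≡ true → t ≡ u) → does (≡-dec _≟ᴮ_ t u) ≡ b
  does-≡ t u b to from with ≡-dec _≟ᴮ_ t u
  ... | yes t≡u = sym (to t≡u)
  ... | no t≢u  = sym (¬true⇒false (λ b≡true → t≢u (from b≡true)))

  -- A string u equals t exactly when its prefix path is t's, and equals the reversal of t exactly when its suffix path is.
  classSize≡agreeCount : ∀ (t : Str n) U → mult t U + mult (V.reverse t) U ≡ agreeCount (pathsOf U) (2 * length U) (prefixWt t) n
  classSize≡agreeCount t []      = refl
  classSize≡agreeCount t (u ∷ U) = begin
    mult t (u ∷ U) + mult (V.reverse t) (u ∷ U)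
      ≡⟨ cong₂ _+_ (mult-∷ t u U) (mult-∷ (V.reverse t) u U) ⟩
    (bit (does (≡-dec _≟ᴮ_ t u)) + mult t U) + (bit (does (≡-dec _≟ᴮ_ (V.reverse t) u)) + mult (V.reverse t) U)
      ≡⟨ interchange (bit (does (≡-dec _≟ᴮ_ t u))) (mult t U) _ _ ⟩
    (bit (does (≡-dec _≟ᴮ_ t u)) + bit (does (≡-dec _≟ᴮ_ (V.reverse t) u))) + (mult t U + mult (V.reverse t) U)
      ≡⟨ cong₂ _+_ (cong₂ _+_ (cong bit u≡t) (cong bit u≡t*)) (classSize≡agreeCount t U) ⟩
    (bit (agreeUpTo (prefixWt u) (prefixWt t) n) + bit (agreeUpTo (suffixWt u) (prefixWt t) n)) + agreeCount (pathsOf U) (2 * length U) (prefixWt t) n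
      ≡⟨ +-assoc (bit (agreeUpTo (prefixWt u) (prefixWt t) n)) _ _ ⟩
    bit (agreeUpTo (prefixWt u) (prefixWt t) n) + (bit (agreeUpTo (suffixWt u) (prefixWt t) n) + agreeCount (pathsOf U) (2 * length U) (prefixWt t) n)
      ≡⟨ cong (λ z → bit (agreeUpTo (prefixWt u) (prefixWt t) n) + (bit (agreeUpTo (suffixWt u) (prefixWt t) n) + z)) (count-cong (2 * length U) _ _ shifted) ⟩
    agreeCount (pathsOf (u ∷ U)) (suc (suc (2 * length U))) (prefixWt t) n
      ≡⟨ cong (λ K → agreeCount (pathsOf (u ∷ U)) K (prefixWt t) n) (sym (2*suc (length U))) ⟩
    agreeCount (pathsOf (u ∷ U)) (2 * length (u ∷ U)) (prefixWt t) n ∎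
    where
    open ≡-Reasoning
    shifted : ∀ m → InRange (2 * length U) m
      → agreeUpTo (path (pathsOf U) m) (prefixWt t) n ≡ agreeUpTo (path (pathsOf (u ∷ U)) (suc (suc m))) (prefixWt t) n
    shifted m r = agreeUpTo-congˡ _ _ (prefixWt t) n (λ i _ → sym (pathsOf-shift u U i m (proj₁ r)))
    u≡t : does (≡-dec _≟ᴮ_ t u) ≡ agreeUpTo (prefixWt u) (prefixWt t) n
    u≡t = does-≡ t u _ (λ { refl → agreeUpTo-refl (prefixWt t) n }) (λ e → sym (prefixWt-injective u t (agreeUpTo⇒≡ _ _ n e)))
    u≡t* : does (≡-dec _≟ᴮ_ (V.reverse t) u) ≡ agreeUpTo (suffixWt u) (prefixWt t) n
    u≡t* = does-≡ (V.reverse t) u _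
      (λ { refl → ≡⇒agreeUpTo (suffixWt (V.reverse t)) (prefixWt t) n (λ i _ → cong (λ z → prefixWt z i) (reverse-involutive t)) })
      (λ e → trans (cong V.reverse (sym (prefixWt-injective (V.reverse u) t (agreeUpTo⇒≡ _ _ n e)))) (reverse-involutive u))

  bitsOf : (ℕ → ℕ) → (s k : ℕ) → Vec Bool k
  bitsOf φ s zero    = V.[]
  bitsOf φ s (suc k) = not (φ (suc s) ≡ᵇ φ s) V.∷ bitsOf φ (suc s) k

  wt-bitsOf : ∀ φ s k → (∀ i → s ≤ i → i < s + k → Step (φ i) (φ (suc i))) → ∀ l → l ≤ k
    → wt (take l (toList (bitsOf φ s k))) + φ s ≡ φ (s + l)
  wt-bitsOf φ s k steps zero _ = cong φ (sym (+-identityʳ s))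
  wt-bitsOf φ s (suc k) steps (suc l) (s≤s l≤k) with steps s ≤-refl (m<m+n s (s≤s z≤n))
  ... | inj₁ flat rewrite flat | ≡⇒≡ᵇ-true {φ s} refl =
    trans (cong (wt (take l (toList (bitsOf φ (suc s) k))) +_) (sym flat)) (trans rest (cong φ (sym (+-suc s l))))
    where
    rest : wt (take l (toList (bitsOf φ (suc s) k))) + φ (suc s) ≡ φ (suc s + l)
    rest = wt-bitsOf φ (suc s) k (λ i s<i i< → steps i (<⇒≤ s<i) (subst (i <_) (sym (+-suc s k)) i<)) l l≤k
  ... | inj₂ rise rewrite rise | ≢⇒≡ᵇ-false {suc (φ s)} {φ s} (λ e → <-irrefl (sym e) (n<1+n (φ s))) =
    trans (sym (+-suc (wt (take l (toList (bitsOf φ (suc s) k)))) (φ s)))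
          (trans (cong (wt (take l (toList (bitsOf φ (suc s) k))) +_) (sym rise)) (trans rest (cong φ (sym (+-suc s l)))))
    where
    rest : wt (take l (toList (bitsOf φ (suc s) k))) + φ (suc s) ≡ φ (suc s + l)
    rest = wt-bitsOf φ (suc s) k (λ i s<i i< → steps i (<⇒≤ s<i) (subst (i <_) (sym (+-suc s k)) i<)) l l≤k

  stringOf : (ℕ → ℕ) → Str n
  stringOf φ = bitsOf φ 0 n

  prefixWt-stringOf : ∀ φ → φ 0 ≡ 0 → (∀ i → i < n → Step (φ i) (φ (suc i))) → ∀ l → l ≤ n → prefixWt (stringOf φ) l ≡ φ l
  prefixWt-stringOf φ φ0≡0 steps l l≤n =
    trans (sym (+-identityʳ _)) (trans (cong (prefixWt (stringOf φ) l +_) (sym φ0≡0)) (wt-bitsOf φ 0 n (λ i _ i<n → steps i i<n) l l≤n))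

  stringsOf : (ℕ → ℕ → ℕ) → ℕ → List (Str n)
  stringsOf X zero    = []
  stringsOf X (suc h) = stringOf (λ i → X i 1) ∷ stringsOf (λ l m → X l (suc (suc m))) h

  length-stringsOf : ∀ X h → length (stringsOf X h) ≡ h
  length-stringsOf X zero    = refl
  length-stringsOf X (suc h) = cong suc (length-stringsOf (λ l m → X l (suc (suc m))) h)

  drop-first-pair : ∀ {h w X} → PathFamily n (suc h) w X → PathFamily n h w (λ l m → X l (suc (suc m)))
  drop-first-pair {h} {w} {X} F = record
    { start  = λ m r → PathFamily.start F (suc (suc m)) (inRange-add2 h m r)
    ; step   = λ m r → PathFamily.step F (suc (suc m)) (inRange-add2 h m r)
    ; end    = λ m r → PathFamily.end F (suc (suc m)) (inRange-add2 h m r)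
    ; mirror = λ m r i i≤n → trans (cong (λ z → X i z + X (n ∸ i) (suc (suc m))) (sym (star-suc-suc m (proj₁ r))))
                                   (PathFamily.mirror F (suc (suc m)) (inRange-add2 h m r) i i≤n) }

  1-inRange-2h : ∀ h → InRange (2 * suc h) 1
  1-inRange-2h h rewrite 2*suc h = 1-inRange

  pathsOf-stringsOf : ∀ h {w} X → PathFamily n h w X → ∀ m → InRange (2 * h) m → ∀ l → l ≤ n → pathsOf (stringsOf X h) l m ≡ X l m
  pathsOf-stringsOf zero    X F m r = ⊥-elim (¬inRange0 r)
  pathsOf-stringsOf (suc h) X F 1 r l l≤n = prefixWt-stringOf (λ i → X i 1) (PathFamily.start F 1 (1-inRange-2h h)) (PathFamily.step F 1 (1-inRange-2h h)) l l≤n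
  pathsOf-stringsOf (suc h) {w} X F 2 r l l≤n = begin
    suffixWt u l                                                       ≡⟨ suffixWt-drop u l l≤n ⟩
    wt (drop (n ∸ l) (toList u))                                       ≡⟨ sym (m+n∸m≡n (prefixWt u (n ∸ l)) _) ⟩
    (prefixWt u (n ∸ l) + wt (drop (n ∸ l) (toList u))) ∸ prefixWt u (n ∸ l)
                                                                       ≡⟨ cong₂ _∸_ (trans (wt-take+drop (n ∸ l) (toList u)) (sym (prefixWt-n u))) (u-path (n ∸ l) (m∸n≤m n l)) ⟩
    prefixWt u n ∸ X (n ∸ l) 1                                         ≡⟨ cong (_∸ X (n ∸ l) 1) (trans (u-path n ≤-refl) (PathFamily.end F 1 (1-inRange-2h h))) ⟩
    w ∸ X (n ∸ l) 1                                                    ≡⟨ sym (partner-height F 1 (1-inRange-2h h) l l≤n) ⟩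
    X l 2                                                              ∎
    where
    open ≡-Reasoning
    u : Str n
    u = stringOf (λ i → X i 1)
    u-path : ∀ i → i ≤ n → prefixWt u i ≡ X i 1
    u-path = prefixWt-stringOf (λ i → X i 1) (PathFamily.start F 1 (1-inRange-2h h)) (PathFamily.step F 1 (1-inRange-2h h))
  pathsOf-stringsOf (suc h) X F (suc (suc (suc m))) r l l≤n =
    pathsOf-stringsOf h (λ l m → X l (suc (suc m))) (drop-first-pair F) (suc m) (inRange-drop2 h (suc m) r (s≤s z≤n)) l l≤n

  stringsOf-covers : ∀ h {w} X → PathFamily n h w X → ∀ m → InRange (2 * h) m
    → Σ (Str n) (λ t → t ∈ stringsOf X h × ((∀ i → i ≤ n → X i m ≡ prefixWt t i) ⊎ (∀ i → i ≤ n → X i m ≡ suffixWt t i)))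
  stringsOf-covers zero    X F m r = ⊥-elim (¬inRange0 r)
  stringsOf-covers (suc h) X F 1 r = _ , here refl , inj₁ (λ i i≤n → sym (pathsOf-stringsOf (suc h) X F 1 r i i≤n))
  stringsOf-covers (suc h) X F 2 r = _ , here refl , inj₂ (λ i i≤n → sym (pathsOf-stringsOf (suc h) X F 2 r i i≤n))
  stringsOf-covers (suc h) X F (suc (suc (suc m))) r
    with stringsOf-covers h (λ l m → X l (suc (suc m))) (drop-first-pair F) (suc m) (inRange-drop2 h (suc m) r (s≤s z≤n))
  ... | t , t∈ , e = t , there t∈ , e

module Characterisation (n h w̄ : ℕ) (1≤n : 1 ≤ n) (H : List (Vec Bool n)) (length-H : length H ≡ h)
  (weights : All (λ t → wt (toList t) ≡ w̄) H) (f : ℕ → ℕ → ℕ) (cwf : CWF n h f) (sol : IsSolution n h f (Mset H)) where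

  open Multisets
  open Strings n
  open import Data.Nat
  open import Data.Nat.Properties
  open import Data.Bool using (_∧_)
  open import Data.List as L using ([]; _∷_; map; _++_)
  open import Data.List.Properties using (length-++; length-map)
  open import Data.List.Membership.Propositional using (_∈_)
  open import Data.List.Relation.Binary.Permutation.Propositional using (_↭_; ↭-refl)
  open import Data.List.Relation.Binary.Permutation.Propositional.Properties using (↭-length)
  open import Data.Vec as V using ()
  open import Data.Vec.Properties using (reverse-involutive)
  open import Data.Product using (_,_; Σ; proj₁; proj₂)
  open import Data.Sum using (_⊎_; inj₁; inj₂)
  open import Relation.Binary.PropositionalEquality

  K : ℕ
  K = 2 * h

  M : List (ℕ × ℕ)
  M = Mset H

  Compatible : List (Str n) → Set
  Compatible U = Mset U ↭ M

  f-start : ∀ m → InRange K m → f 0 m ≡ 0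
  f-start m (1≤m , m≤K) = proj₁ (proj₂ cwf) m 1≤m m≤K

  f-step : ∀ m → InRange K m → ∀ i → i < n → Step (f i m) (f (suc i) m)
  f-step m (1≤m , m≤K) i i<n = proj₁ (proj₂ (proj₂ cwf)) (suc i) m (s≤s z≤n) i<n 1≤m m≤K

  f-≤ : ∀ m l → InRange K m → l ≤ n → f l m ≤ l
  f-≤ m zero    r _     = ≤-reflexive (f-start m r)
  f-≤ m (suc l) r l<n with f-step m r l l<n
  ... | inj₁ flat = ≤-trans (≤-reflexive flat) (m≤n⇒m≤1+n (f-≤ m l r (<⇒≤ l<n)))
  ... | inj₂ rise = ≤-trans (≤-reflexive rise) (s≤s (f-≤ m l r (<⇒≤ l<n)))

  occurrences-M : ∀ a b → occurrences (a , b) M ≡ compositionCount f K (a + b) b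
  occurrences-M a b = trans (↭⇒occurrences-≡ sol (a , b)) (occurrences-cwfMultiset K f a b (λ m l r rl → f-≤ m l r (proj₂ rl)))

  length-Mset : ∀ (U : List (Str n)) → length (Mset U) ≡ length U * (n + n)
  length-Mset []      = refl
  length-Mset (u ∷ U) = trans (length-++ (Mstr u)) (cong₂ _+_ length-Mstr (length-Mset U))
    where
    length-range : ∀ K → length (range 1 K) ≡ K
    length-range K = trans (sym (sumMap-1 (range 1 K))) (trans (sumMap-range1 (λ _ → 1) K) (sumTo-1 K))
      where
      sumMap-1 : ∀ (xs : List ℕ) → sumMap (λ _ → 1) xs ≡ length xs
      sumMap-1 []       = refl
      sumMap-1 (x ∷ xs) = cong suc (sumMap-1 xs)
      sumTo-1 : ∀ K → sumTo (λ _ → 1) K ≡ K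
      sumTo-1 zero    = refl
      sumTo-1 (suc K) = cong suc (sumTo-1 K)
    length-Mstr : length (Mstr u) ≡ n + n
    length-Mstr = trans (length-++ (map (λ j → comp (L.take j (toList u))) (range 1 n)))
                        (cong₂ _+_ (trans (length-map _ (range 1 n)) (length-range n)) (trans (length-map _ (range 1 n)) (length-range n)))

  compatible-length : ∀ U → Compatible U → length U ≡ h
  compatible-length U U~M = trans (*-cancelʳ-≡ (length U) (length H) (n + n) {{>-nonZero (≤-trans 1≤n (m≤m+n n n))}}
                                               (trans (sym (length-Mset U)) (trans (↭-length U~M) (length-Mset H))))
                                  length-H

  compatible-levelCounts : ∀ U → Compatible U → ∀ l v → l ≤ n → levelCount (pathsOf U) K l v ≡ levelCount f K l v
  compatible-levelCounts U U~M zero    v _ = count-cong K _ _ (λ m r → cong (_≡ᵇ v) (trans (pathsOf-start U m) (sym (f-start m r))))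
  compatible-levelCounts U U~M (suc l) v l<n =
    compositionCounts⇒levelCounts (pathsOf U) f K (λ m l _ _ → pathsOf-≤ U m l) f-≤ same (suc l) v (s≤s z≤n , l<n)
    where
    same : ∀ a b → compositionCount (pathsOf U) K (a + b) b ≡ compositionCount f K (a + b) b
    same a b = begin
      compositionCount (pathsOf U) K (a + b) b                 ≡⟨ cong (λ k → compositionCount (pathsOf U) (2 * k) (a + b) b) (sym (compatible-length U U~M)) ⟩
      compositionCount (pathsOf U) (2 * length U) (a + b) b    ≡⟨ sym (occurrences-Mset U a b) ⟩
      occurrences (a , b) (Mset U)                             ≡⟨ ↭⇒occurrences-≡ U~M (a , b) ⟩
      occurrences (a , b) M                                    ≡⟨ occurrences-M a b ⟩
      compositionCount f K (a + b) b                           ∎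
      where open ≡-Reasoning

  same-ends : ∀ X Y → (∀ l v → l ≤ n → levelCount X K l v ≡ levelCount Y K l v) → (∀ m → InRange K m → X n m ≡ w̄)
    → ∀ m → InRange K m → Y n m ≡ w̄
  same-ends X Y same X-end m r =
    ≡ᵇ-true⇒≡ (count≡K⇒true K _ (trans (sym (same n w̄ ≤-refl)) (true⇒count≡K K _ (λ m′ r′ → ≡⇒≡ᵇ-true (X-end m′ r′)))) m r)

  f-end : ∀ m → InRange K m → f n m ≡ w̄
  f-end = same-ends (pathsOf H) f (compatible-levelCounts H ↭-refl)
    (λ m r → pathsOf-end H weights m (subst (λ k → InRange (2 * k) m) (sym length-H) r))

  next-odd : ∀ j → 1 ≤ j → 2 + (2 * j ∸ 1) ≡ 2 * suc j ∸ 1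
  next-odd j 1≤j = trans (sym (+-∸-assoc 2 (≤-trans 1≤j (m≤m+n j (j + 0))))) (cong (_∸ 1) (sym (2*suc j)))

  pair-of : ∀ m → 1 ≤ m → Σ ℕ (λ j → 1 ≤ j × ((m ≡ 2 * j ∸ 1 × star m ≡ 2 * j) ⊎ (m ≡ 2 * j × star m ≡ 2 * j ∸ 1)))
  pair-of 1 _ = 1 , s≤s z≤n , inj₁ (refl , refl)
  pair-of 2 _ = 1 , s≤s z≤n , inj₂ (refl , refl)
  pair-of (suc (suc (suc m))) _ with pair-of (suc m) (s≤s z≤n)
  ... | j , 1≤j , inj₁ (m≡ , m*≡) = suc j , s≤s z≤n , inj₁ (trans (cong (2 +_) m≡) (next-odd j 1≤j) , trans (star-suc-suc (suc m) (s≤s z≤n)) (trans (cong (2 +_) m*≡) (sym (2*suc j))))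
  ... | j , 1≤j , inj₂ (m≡ , m*≡) = suc j , s≤s z≤n , inj₂ (trans (cong (2 +_) m≡) (sym (2*suc j)) , trans (star-suc-suc (suc m) (s≤s z≤n)) (trans (cong (2 +_) m*≡) (next-odd j 1≤j)))

  pair-weight : ∀ j → 1 ≤ j → j ≤ h → ∀ l → l ≤ n → f l (2 * j ∸ 1) + f (n ∸ l) (2 * j) ≡ w̄
  pair-weight j 1≤j j≤h l l≤n with proj₂ (proj₂ (proj₂ cwf)) j 1≤j j≤h
  ... | wⱼ , _ , sum = trans (sum l l≤n) (sym w̄≡wⱼ)
    where
    1≤2j : 1 ≤ 2 * j
    1≤2j = ≤-trans 1≤j (m≤m+n j (j + 0))
    2j≤K : 2 * j ≤ K
    2j≤K = *-monoʳ-≤ 2 j≤h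
    1≤2j-1 : 1 ≤ 2 * j ∸ 1
    1≤2j-1 = m+n≤o⇒m≤o∸n 1 (*-monoʳ-≤ 2 1≤j)
    w̄≡wⱼ : w̄ ≡ wⱼ
    w̄≡wⱼ = begin
      w̄                                    ≡⟨ sym (+-identityʳ w̄) ⟩
      w̄ + 0                                ≡⟨ cong₂ _+_ (sym (f-end (2 * j ∸ 1) (1≤2j-1 , ≤-trans (m∸n≤m (2 * j) 1) 2j≤K))) (sym (f-start (2 * j) (1≤2j , 2j≤K))) ⟩
      f n (2 * j ∸ 1) + f 0 (2 * j)        ≡⟨ cong (λ z → f n (2 * j ∸ 1) + f z (2 * j)) (sym (n∸n≡0 n)) ⟩
      f n (2 * j ∸ 1) + f (n ∸ n) (2 * j)  ≡⟨ sum n ≤-refl ⟩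
      wⱼ                                   ∎
      where open ≡-Reasoning

  f-mirror : ∀ m → InRange K m → ∀ i → i ≤ n → f i (star m) + f (n ∸ i) m ≡ w̄
  f-mirror m r i i≤n with pair-of m (proj₁ r)
  ... | j , 1≤j , inj₁ (refl , m*≡) rewrite m*≡ =
    trans (+-comm (f i (2 * j)) _)
          (trans (cong (λ z → f (n ∸ i) (2 * j ∸ 1) + f z (2 * j)) (sym (m∸[m∸n]≡n i≤n)))
                 (pair-weight j 1≤j (*-cancelˡ-≤ 2 (subst (_≤ K) m*≡ (proj₂ (star-inRange h m r)))) (n ∸ i) (m∸n≤m n i)))
  ... | j , 1≤j , inj₂ (refl , m*≡) rewrite m*≡ = pair-weight j 1≤j (*-cancelˡ-≤ 2 (proj₂ r)) i i≤n

  f-family : PathFamily n h w̄ f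
  f-family = record { start = f-start ; step = f-step ; end = f-end ; mirror = f-mirror }

  compatible-family : ∀ U → Compatible U → PathFamily n h w̄ (pathsOf U)
  compatible-family U U~M = subst (λ k → PathFamily n k w̄ (pathsOf U)) (compatible-length U U~M) (pathsOf-family U w̄ ends)
    where
    ends : ∀ m → InRange (2 * length U) m → pathsOf U n m ≡ w̄
    ends m r = same-ends f (pathsOf U) (λ l v l≤n → sym (compatible-levelCounts U U~M l v l≤n)) f-end m
                         (subst (λ k → InRange (2 * k) m) (compatible-length U U~M) r)

  classSize : List (Str n) → Str n → ℕ
  classSize U t = mult t U + mult (V.reverse t) U

  classSize-reverse : ∀ U t → classSize U (V.reverse t) ≡ classSize U t
  classSize-reverse U t = trans (cong (λ z → mult (V.reverse t) U + mult z U) (reverse-involutive t)) (+-comm _ (mult t U))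

  classSize-compatible : ConditionI n h f → ConditionII n h f → ∀ U → Compatible U → ∀ t → classSize U t ≡ agreeCount f K (prefixWt t) n
  classSize-compatible condI condII U U~M t = begin
    classSize U t                                                ≡⟨ classSize≡agreeCount t U ⟩
    agreeCount (pathsOf U) (2 * length U) (prefixWt t) n         ≡⟨ cong (λ k → agreeCount (pathsOf U) (2 * k) (prefixWt t) n) (compatible-length U U~M) ⟩
    agreeCount (pathsOf U) K (prefixWt t) n                      ≡⟨ Sufficiency.agreeCount-≡ f-family (compatible-family U U~M) condI condII
                                                                                            (compatible-levelCounts U U~M) n ≤-refl (prefixWt t) ⟩
    agreeCount f K (prefixWt t) n                                ∎
    where open ≡-Reasoning

  unique-if-conditions : ConditionI n h f × ConditionII n h f → UniqueClass n M
  unique-if-conditions (condI , condII) =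
    (H , ↭-refl) , λ U V U~M V~M → trans (compatible-length V V~M) (sym (compatible-length U U~M))
                                 , λ t _ → trans (classSize-compatible condI condII U U~M t) (sym (classSize-compatible condI condII V V~M t))

  module _ (unique : UniqueClass n M) where

    stringsOf-compatible : ∀ X → PathFamily n h w̄ X → (∀ l v → l ≤ n → levelCount X K l v ≡ levelCount f K l v) → Compatible (stringsOf X h)
    stringsOf-compatible X FX same = occurrences-≡⇒↭ (Mset (stringsOf X h)) M λ { (a , b) → begin
      occurrences (a , b) (Mset (stringsOf X h))                                   ≡⟨ occurrences-Mset (stringsOf X h) a b ⟩
      compositionCount (pathsOf (stringsOf X h)) (2 * length (stringsOf X h)) (a + b) b
                                                                                   ≡⟨ cong (λ k → compositionCount (pathsOf (stringsOf X h)) (2 * k) (a + b) b) (length-stringsOf X h) ⟩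
      compositionCount (pathsOf (stringsOf X h)) K (a + b) b                       ≡⟨ sumTo-cong K _ _ (λ m r → count-cong n _ _ (λ l rl →
                                                                                         cong (λ z → (l ≡ᵇ a + b) ∧ (z ≡ᵇ b)) (pathsOf-stringsOf h X FX m r l (proj₂ rl)))) ⟩
      compositionCount X K (a + b) b                                               ≡⟨ levelCounts⇒compositionCounts X f K (λ l v r → same l v (proj₂ r)) (a + b) b ⟩
      compositionCount f K (a + b) b                                               ≡⟨ sym (occurrences-M a b) ⟩
      occurrences (a , b) M                                                        ∎ }
      where open ≡-Reasoning

    classSize-stringsOf : ∀ X → PathFamily n h w̄ X → ∀ t → classSize (stringsOf X h) t ≡ agreeCount X K (prefixWt t) n
    classSize-stringsOf X FX t =
      trans (classSize≡agreeCount t (stringsOf X h))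
            (trans (cong (λ k → agreeCount (pathsOf (stringsOf X h)) (2 * k) (prefixWt t) n) (length-stringsOf X h))
                   (count-cong K _ _ (λ m r → agreeUpTo-congˡ _ _ _ n (λ i i≤n → pathsOf-stringsOf h X FX m r i i≤n))))

    classes-agree : ∀ f′ → PathFamily n h w̄ f′ → (∀ l v → l ≤ n → levelCount f′ K l v ≡ levelCount f K l v)
      → ∀ t → t ∈ stringsOf f h → classSize (stringsOf f h) t ≡ classSize (stringsOf f′ h) t
    classes-agree f′ F′ same =
      proj₂ (proj₂ unique (stringsOf f h) (stringsOf f′ h) (stringsOf-compatible f f-family (λ _ _ _ → refl)) (stringsOf-compatible f′ F′ same))

    agreeCount-via-class : ∀ f′ → PathFamily n h w̄ f′ → ∀ m s → (∀ i → i ≤ n → f i m ≡ prefixWt s i)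
      → classSize (stringsOf f h) s ≡ classSize (stringsOf f′ h) s → agreeCount f′ K (path f m) n ≡ agreeCount f K (path f m) n
    agreeCount-via-class f′ F′ m s m≡s same-size = begin
      agreeCount f′ K (path f m) n       ≡⟨ along-s f′ ⟩
      agreeCount f′ K (prefixWt s) n     ≡⟨ sym (classSize-stringsOf f′ F′ s) ⟩
      classSize (stringsOf f′ h) s       ≡⟨ sym same-size ⟩
      classSize (stringsOf f h) s        ≡⟨ classSize-stringsOf f f-family s ⟩
      agreeCount f K (prefixWt s) n      ≡⟨ sym (along-s f) ⟩
      agreeCount f K (path f m) n        ∎
      where
      open ≡-Reasoning
      along-s : ∀ X → agreeCount X K (path f m) n ≡ agreeCount X K (prefixWt s) n
      along-s X = count-cong K _ _ (λ m′ _ → agreeUpTo-congʳ _ _ _ n m≡s)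

    rigid : ∀ f′ → PathFamily n h w̄ f′ → (∀ l v → l ≤ n → levelCount f′ K l v ≡ levelCount f K l v)
      → ∀ m → InRange K m → agreeCount f′ K (path f m) n ≡ agreeCount f K (path f m) n
    rigid f′ F′ same m r with stringsOf-covers h f f-family m r
    ... | t , t∈ , inj₁ m≡t  = agreeCount-via-class f′ F′ m t m≡t (classes-agree f′ F′ same t t∈)
    ... | t , t∈ , inj₂ m≡t* = agreeCount-via-class f′ F′ m (V.reverse t) m≡t*
      (trans (classSize-reverse (stringsOf f h) t) (trans (classes-agree f′ F′ same t t∈) (sym (classSize-reverse (stringsOf f′ h) t))))

    conditions-if-unique : ConditionI n h f × ConditionII n h f
    conditions-if-unique = Necessity.necessary-I f-family rigid , Necessity.necessary-II f-family rigid

theorem1 : (n h w̄ : ℕ) → 1 ≤ n → 1 ≤ h → w̄ ≤ n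
    → (H : List (Vec Bool n)) → length H ≡ h
    → All (λ t → wt (toList t) ≡ w̄) H
    → (f : ℕ → ℕ → ℕ) → CWF n h f → IsSolution n h f (Mset H)
    → UniqueClass n (Mset H) ⇔ (ConditionI n h f × ConditionII n h f)
theorem1 n h w̄ 1≤n _ _ H length-H weights f cwf sol =
  mk⇔ (Characterisation.conditions-if-unique n h w̄ 1≤n H length-H weights f cwf sol)
      (Characterisation.unique-if-conditions n h w̄ 1≤n H length-H weights f cwf sol)
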